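{- Let $\mathscr{P}\subseteq\mathbb{N}^p$ be a polymatroid and fix any lexicographic order $\prec$ on $\mathbb{N}^p$ used to define the stalactites of $\mathscr{P}$. Then \[\mathrm{Cave}_{\mathscr{P}}(\mathbf{t}) = \mathrm{Stal}_{\mathscr{P}}(\mathbf{t}) = \mathrm{Box}_{\mathscr{P}}(\mathbf{t}) = \text{M\"ob}_{\mathscr{P}}(\mathbf{t}).\]
   Context: Notation: $\mathbb{N}=\{0,1,2,\dots\}$, $[p]=\{1,\dots,p\}$, $\mathbf{e}_i$ is the $i$th standard basis vector of $\mathbb{R}^p$, $\mathbf{e}_J=\sum_{j\in J}\mathbf{e}_j$ for $J\subseteq[p]$ ($\mathbf e_\varnothing=\mathbf 0$), $|\mathbf{n}|=n_1+\cdots+n_p$, $\mathbf{t}^{\mathbf{n}}=t_1^{n_1}\cdots t_p^{n_p}$, and $\le$ on $\mathbb{N}^p$ is the componentwise order. A polymatroid is a finite set $\mathscr{P}\subseteq\mathbb{N}^p$ whose elements all have the same value of $|\cdot|$, called the rank $\mathrm{rk}(\mathscr{P})$, and which is M-convex: for all $\mathbf{u},\mathbf{v}\in\mathscr{P}$ and $i\in[p]$ with $u_i>v_i$ there is $j\in[p]$ with $u_j<v_j$ and $\mathbf{u}-\mathbf{e}_i+\mathbf{e}_j\in\mathscr{P}$. The base polytope is $B(\mathscr{P})=\mathrm{conv}(\mathscr{P})$ and the independence polytope is $I(\mathscr{P})=(B(\mathscr{P})+\mathbb{R}^p_{\le 0})\cap\mathbb{R}^p_{\ge 0}$. Sums "over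 $\mathbf{n}\in I(\mathscr{P})$" range over the lattice points $I(\mathscr{P})\cap\mathbb{N}^p$. Cave polynomial: let $\mathbb{1}_{\mathscr{P}}:\mathbb{R}^p\to\{0,1\}$ be $1$ on $B(\mathscr{P})$ and $0$ elsewhere. Then $\mathrm{Cave}_{\mathscr{P}}(\mathbf{t})=\sum_{\mathbf{n}\in\mathbb{N}^p,\ |\mathbf{n}|=\mathrm{rk}(\mathscr{P})}\mathbb{1}_{\mathscr{P}}(\mathbf{n})\prod_{i=1}^{p-1}\bigl(1-\max_{i<j\le p}\{\mathbb{1}_{\mathscr{P}}(\mathbf{n}-\mathbf{e}_i+\mathbf{e}_j)\}\,t_i^{ -1}\bigr)\mathbf{t}^{\mathbf{n}}$. Stalactite polynomial: a lexicographic order is the lex order on $\mathbb{N}^p$ with respect to some ordering of the coordinates (e.g. the standard one: $\mathbf a\prec\mathbf b$ iff $a_k<b_k$ at the first index $k$ where they differ). List $\mathscr{P}=\{\mathbf{a}_1\prec\cdots\prec\mathbf{a}_r\}$. For $\mathbf{u}\in\mathscr{P}$ and $V\subseteq\mathscr{P}$, let $L(\mathbf{u};V)$ be the set of $\ell\in[p]$ such that $\mathbf{u}-\mathbf{e}_\ell+\mathbf{e}_j\in V$ for some $j\in[p]$, $j\ne\ell$, and set $\mathrm{St}(\mathbf{u};V)=\{\mathbf{u}-\mathbf{e}_J: J\subseteq L(\mathbf{u};V)\}$. The stalactites of $\mathscr{P}$ are $\mathrm{St}(\mathbf{a}_i;\{\mathbf{a}_1,\dots,\mathbf{a}_{i-1}\})$,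 $i=1,\dots,r$. Let $c_{\mathbf n}(\mathscr{P})$ be the number of stalactites containing $\mathbf n$. Then $\mathrm{Stal}_{\mathscr{P}}(\mathbf{t})=\sum_{\mathbf{n}\in I(\mathscr{P})}(-1)^{\mathrm{rk}(\mathscr{P})-|\mathbf{n}|}c_{\mathbf{n}}(\mathscr{P})\mathbf{t}^{\mathbf{n}}$. Box polynomial: $\mathrm{Box}_{\mathscr{P}}(\mathbf{t})=\sum_{\mathbf{n}\in I(\mathscr{P})}\prod_{i=1}^p f_{n_i}(t_i)$, where $f_{k}(t)=t^{k}-t^{k-1}$ if $k\ge 1$ and $f_0(t)=1$. M\"obius polynomial: let $P$ be the poset on $(I(\mathscr{P})\cap\mathbb{N}^p)\sqcup\{\hat 1\}$ with the componentwise order and $\hat 1$ a new maximum, and $\mu_P$ its M\"obius function ($\mu_P(\mathbf x,\mathbf x)=1$, $\mu_P(\mathbf x,\mathbf y)=-\sum_{\mathbf x\le\mathbf z<\mathbf y}\mu_P(\mathbf x,\mathbf z)$ for $\mathbf x<\mathbf y$). Set $\mu_{\mathscr{P}}(\mathbf{n})=-\mu_P(\mathbf{n},\hat 1)$ and $\text{M\"ob}_{\mathscr{P}}(\mathbf{t})=\sum_{\mathbf{n}\in I(\mathscr{P})}\mu_{\mathscr{P}}(\mathbf{n})\mathbf{t}^{\mathbf{n}}$. -}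

module Defs where

open import Data.Bool using (Bool; true; false; if_then_else_; _∧_; _∨_; not)
open import Data.Nat as ℕ using (ℕ; zero; suc; _∸_; _<ᵇ_; _≡ᵇ_; _≤ᵇ_; _⊔_)
open import Data.Integer as ℤ using (ℤ; +_; -_)
open import Data.Rational as ℚ using (ℚ; 0ℚ; 1ℚ)
open import Data.Fin using (Fin; toℕ)
open import Data.Fin.Properties using () renaming (_≟_ to _≟F_)
open import Data.Fin.Subset using (Subset)
open import Data.Fin.Permutation using (Permutation′; _⟨$⟩ʳ_)
open import Data.Vec as V using (Vec; []; _∷_; lookup; tabulate; zipWith)
open import Data.Vec.Properties using (≡-dec)
open import Data.List as L using (List; []; _∷_; map; concatMap; filterᵇ; allFin; upTo; length; foldr)
open import Data.Bool.ListAction using (and; any; all)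
open import Data.List.Membership.Propositional using (_∈_)
open import Data.List.Relation.Unary.Unique.Propositional using (Unique)
open import Data.Product using (Σ; _×_; _,_; ∃)
open import Relation.Nullary using (does; ¬_)
open import Relation.Binary.PropositionalEquality using (_≡_; _≢_)
open import Function.Bundles using (_⇔_)

-- Points of ℕ^p and ℤ^p (as vectors; coordinate i ∈ [p] is index i-1 : Fin p)

Pt : ℕ → Set
Pt p = Vec ℕ p

PtZ : ℕ → Set
PtZ p = Vec ℤ p

toZ : ∀ {p} → Pt p → PtZ p
toZ = V.map +_

∣_∣ᵥ : ∀ {p} → Pt p → ℕ
∣ n ∣ᵥ = V.sum n

_+ᵥ_ _-ᵥ_ : ∀ {p} → PtZ p → PtZ p → PtZ p
x +ᵥ y = zipWith ℤ._+_ x y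
x -ᵥ y = zipWith ℤ._-_ x y

0ᵥ : ∀ {p} → PtZ p
0ᵥ = V.replicate _ (+ 0)

_·e_ : ∀ {p} → ℕ → Fin p → PtZ p
k ·e i = tabulate (λ j → if does (j ≟F i) then + k else + 0)

e : ∀ {p} → Fin p → PtZ p
e i = 1 ·e i

eSet : ∀ {p} → Subset p → PtZ p
eSet = V.map (λ b → if b then + 1 else + 0)

allSubsets : (p : ℕ) → List (Subset p)
allSubsets zero = [] ∷ []
allSubsets (suc p) = concatMap (λ J → (false ∷ J) ∷ (true ∷ J) ∷ []) (allSubsets p)

_≟ᶻ_ : ∀ {p} → PtZ p → PtZ p → Bool
x ≟ᶻ y = does (≡-dec ℤ._≟_ x y)

_≟ᴺ_ : ∀ {p} → Pt p → Pt p → Bool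
x ≟ᴺ y = does (≡-dec ℕ._≟_ x y)

_∈ᵇ_ : ∀ {p} → PtZ p → List (Pt p) → Bool
x ∈ᵇ S = any (λ u → toZ u ≟ᶻ x) S

_∈ᶻ_ : ∀ {p} → PtZ p → List (Pt p) → Set
x ∈ᶻ S = Σ _ λ u → u ∈ S × toZ u ≡ x

_≤ᵥ_ : ∀ {p} → Pt p → Pt p → Bool
x ≤ᵥ y = and (V.toList (zipWith _≤ᵇ_ x y))

MConvex : ∀ {p} → List (Pt p) → Set
MConvex {p} P = ∀ u v → u ∈ P → v ∈ P → (i : Fin p) → lookup v i ℕ.< lookup u i →
  ∃ λ (j : Fin p) → lookup u j ℕ.< lookup v j × (((toZ u -ᵥ e i) +ᵥ e j) ∈ᶻ P)

record IsPolymatroid {p} (P : List (Pt p)) (r : ℕ) : Set where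
  field
    distinct : Unique P
    nonempty : P ≢ []
    rank     : ∀ u → u ∈ P → ∣ u ∣ᵥ ≡ r
    mconvex  : MConvex P

ℕtoℚ : ℕ → ℚ
ℕtoℚ n = + n ℚ./ 1

sumFin : ∀ {m} → (Fin m → ℚ) → ℚ
sumFin {zero} f = 0ℚ
sumFin {suc m} f = f Fin.zero ℚ.+ sumFin (λ i → f (Fin.suc i))
  where import Data.Fin as Fin

InConv : ∀ {p} → List (Pt p) → Vec ℚ p → Set
InConv {p} P x = Σ (Fin (length P) → ℚ) λ λ′ →
  (∀ k → 0ℚ ℚ.≤ λ′ k) × sumFin λ′ ≡ 1ℚ ×
  (∀ (i : Fin p) → lookup x i ≡ sumFin (λ k → λ′ k ℚ.* ℕtoℚ (lookup (L.lookup P k) i)))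

InB : ∀ {p} → List (Pt p) → Pt p → Set
InB P n = InConv P (V.map ℕtoℚ n)

-- n lattice point of I(𝒫) = (B(𝒫) + ℝ^p_{≤0}) ∩ ℝ^p_{≥0}  (n ≥ 0 automatic)
InI : ∀ {p} → List (Pt p) → Pt p → Set
InI {p} P n = Σ (Vec ℚ p) λ x → InConv P x × (∀ i → ℕtoℚ (lookup n i) ℚ.≤ lookup x i)

Enumerates : ∀ {p} → List (Pt p) → (Pt p → Set) → Set
Enumerates L S = Unique L × (∀ n → (n ∈ L) ⇔ S n)

-- Laurent polynomials in t₁,…,t_p with ℤ coefficients, as finite lists of
-- monomials (coefficient, exponent vector); compared coefficientwise.

Poly : ℕ → Set
Poly p = List (ℤ × PtZ p)

coeff : ∀ {p} → Poly p → PtZ p → ℤ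
coeff [] m = + 0
coeff ((c , x) ∷ P) m = (if x ≟ᶻ m then c else + 0) ℤ.+ coeff P m

_≈ₚ_ : ∀ {p} → Poly p → Poly p → Set
P ≈ₚ Q = ∀ m → coeff P m ≡ coeff Q m

mono : ∀ {p} → ℤ → PtZ p → Poly p
mono c x = (c , x) ∷ []

oneₚ : ∀ {p} → Poly p
oneₚ = mono (+ 1) 0ᵥ

_*ₚ_ : ∀ {p} → Poly p → Poly p → Poly p
P *ₚ Q = concatMap (λ { (c , x) → map (λ { (d , y) → (c ℤ.* d , x +ᵥ y) }) Q }) P

sumₚ : ∀ {p} {A : Set} → List A → (A → Poly p) → Poly p
sumₚ A F = concatMap F A

prodₚ : ∀ {p} {A : Set} → List A → (A → Poly p) → Poly p
prodₚ A F = foldr (λ a acc → F a *ₚ acc) oneₚ A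

tpow : ∀ {p} → Pt p → Poly p
tpow n = mono (+ 1) (toZ n)

compositions : (p r : ℕ) → List (Pt p)
compositions zero zero = [] ∷ []
compositions zero (suc r) = []
compositions (suc p) r = concatMap (λ k → map (k ∷_) (compositions p (r ∸ k))) (upTo (suc r))

-- 𝟙_𝒫 evaluated at an integer point, B = list of lattice points of B(𝒫)
𝟙 : ∀ {p} → List (Pt p) → PtZ p → ℕ
𝟙 B x = if x ∈ᵇ B then 1 else 0

maxList : List ℕ → ℕ
maxList = foldr _⊔_ 0

Cave : ∀ {p} → (r : ℕ) → (B : List (Pt p)) → Poly p
Cave {p} r B = sumₚ (compositions p r) λ n →
  mono (+ 𝟙 B (toZ n)) 0ᵥ *ₚ
  (prodₚ (filterᵇ (λ i → suc (toℕ i) <ᵇ p) (allFin p)) (λ i →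
     let mx = maxList (map (λ j → 𝟙 B ((toZ n -ᵥ e i) +ᵥ e j))
                           (filterᵇ (λ j → toℕ i <ᵇ toℕ j) (allFin p)))
     in oneₚ L.++ mono (- (+ mx)) (0ᵥ -ᵥ e i))
   *ₚ tpow n)

lexLt : ∀ {n} → Vec ℕ n → Vec ℕ n → Bool
lexLt [] [] = false
lexLt (x ∷ xs) (y ∷ ys) = (x <ᵇ y) ∨ ((x ≡ᵇ y) ∧ lexLt xs ys)

-- lexicographic order w.r.t. the ordering σ(0), σ(1), … of the coordinates
lexLtσ : ∀ {p} → Permutation′ p → Pt p → Pt p → Bool
lexLtσ σ a b = lexLt (tabulate (λ k → lookup a (σ ⟨$⟩ʳ k))) (tabulate (λ k → lookup b (σ ⟨$⟩ʳ k)))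

inL : ∀ {p} → List (Pt p) → Pt p → Fin p → Bool
inL {p} V u ℓ = any (λ j → not (does (j ≟F ℓ)) ∧ (((toZ u -ᵥ e ℓ) +ᵥ e j) ∈ᵇ V)) (allFin p)

St : ∀ {p} → List (Pt p) → Pt p → List (PtZ p)
St {p} V u = map (λ J → toZ u -ᵥ eSet J)
  (filterᵇ (λ J → all (λ ℓ → not (lookup J ℓ) ∨ inL V u ℓ) (allFin p)) (allSubsets p))

stalactite : ∀ {p} → Permutation′ p → List (Pt p) → Pt p → List (PtZ p)
stalactite σ P u = St (filterᵇ (λ v → lexLtσ σ v u) P) u

cnt : ∀ {p} → Permutation′ p → List (Pt p) → Pt p → ℕ
cnt σ P n = length (filterᵇ (λ u → any (λ x → x ≟ᶻ toZ n) (stalactite σ P u)) P)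

Stal : ∀ {p} → Permutation′ p → List (Pt p) → (r : ℕ) → (I : List (Pt p)) → Poly p
Stal σ P r I = sumₚ I λ n → mono ((- (+ 1)) ℤ.^ (r ∸ ∣ n ∣ᵥ) ℤ.* + cnt σ P n) (toZ n)

fpoly : ∀ {p} → ℕ → Fin p → Poly p
fpoly zero i = oneₚ
fpoly (suc k) i = mono (+ 1) (suc k ·e i) L.++ mono (- (+ 1)) (k ·e i)

Box : ∀ {p} → (I : List (Pt p)) → Poly p
Box {p} I = sumₚ I λ n → prodₚ (allFin p) (λ i → fpoly (lookup n i) i)

sumℤ : List ℤ → ℤ
sumℤ = foldr ℤ._+_ (+ 0)

-- μ_P(x,y) for x,y ∈ I(𝒫) ∩ ℕ^p, computed by the defining recursion
-- μ(x,x)=1, μ(x,y) = -Σ_{x≤z<y} μ(x,z) (x<y), 0 otherwise, with fuel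
-- (fuel suc |y| is always sufficient since |z| < |y| in each recursive call).
μfuel : ∀ {p} → List (Pt p) → ℕ → Pt p → Pt p → ℤ
μfuel I zero x y = + 0
μfuel I (suc f) x y =
  if x ≟ᴺ y then + 1
  else if x ≤ᵥ y then - sumℤ (map (μfuel I f x)
         (filterᵇ (λ z → (x ≤ᵥ z) ∧ (z ≤ᵥ y) ∧ not (z ≟ᴺ y)) I))
  else + 0

μP : ∀ {p} → List (Pt p) → Pt p → Pt p → ℤ
μP I x y = μfuel I (suc ∣ y ∣ᵥ) x y

-- μ_P(x, 1̂) = - Σ_{x ≤ z < 1̂} μ_P(x,z)
μP1̂ : ∀ {p} → List (Pt p) → Pt p → ℤ
μP1̂ I x = - sumℤ (map (μP I x) (filterᵇ (λ z → x ≤ᵥ z) I))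

μ𝒫 : ∀ {p} → List (Pt p) → Pt p → ℤ
μ𝒫 I n = - μP1̂ I n

Möb : ∀ {p} → (I : List (Pt p)) → Poly p
Möb I = sumₚ I λ n → mono (μ𝒫 I n) (toZ n)

-- Let I be the lattice points of the independence polytope.  They are exactly the points below some
-- element of 𝒫: a lattice point of I(𝒫) below no element of 𝒫 is cut off by a 0/1 weight that is
-- maximised over 𝒫 at an element of least deficit (exchange property), and likewise the lattice points
-- of the base polytope are 𝒫 itself.  All four polynomials then have coefficient
-- Σ_{J ⊆ [p]} (-1)^|J| [m + e_J ∈ I] at t^m for m ∈ ℕᵖ, and 0 at exponents with a negative entry.
-- For Box this is the expansion of ∏ᵢ (tᵢ^nᵢ - tᵢ^(nᵢ-1)); for Möb it holds because I is down-closed,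
-- so its intervals are products of chains.  For Stal, M-convexity shows that y ≤ u ∈ 𝒫 lies below an
-- earlier element of 𝒫 iff y_ℓ < u_ℓ for some ℓ ∈ L(u); hence
-- (-1)^(|u|-|n|) [n ∈ St(u)] = ∏ᵢ ([nᵢ = uᵢ] - [i ∈ L(u)] [nᵢ + 1 = uᵢ]), and summing over u and J
-- counts every point of I once, at its lexicographically first dominating element.  Cave is the same
-- sum for the standard order, for which ℓ ∈ L(u) iff u - e_ℓ + e_j ∈ 𝒫 for some j > ℓ.

module Submission where

open import Defs
open import Algebra.Bundles using (CommutativeMonoid)
import Algebra.Properties.CommutativeSemigroup as CommutativeSemigroupProperties
open import Data.Bool as Bool using (Bool; true; false; if_then_else_; _∧_; _∨_; not; T?)
open import Data.Bool.ListAction using (any; all)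
open import Data.Bool.Properties using (T-≡; ∧-conicalˡ; ∧-conicalʳ; ∧-identityʳ; ∧-zeroʳ; ∨-identityʳ; ∨-zeroʳ)
open import Data.Empty using (⊥-elim)
open import Data.Fin using (Fin; toℕ) renaming (zero to fz; suc to fs)
open import Data.Fin.Permutation as Perm using (Permutation′; _⟨$⟩ʳ_; _⟨$⟩ˡ_)
open import Data.Fin.Properties using () renaming (_≟_ to _≟ᶠ_)
import Data.Fin.Properties as FP
open import Data.Integer as ℤ using (ℤ; +_; -_; _+_; _*_; _-_; -[1+_]; _^_)
import Data.Integer.Properties as ℤP
open import Data.Integer.Tactic.RingSolver using (solve-∀)
open import Data.List as L using (List; []; _∷_; map; concatMap; filterᵇ; _++_; allFin; upTo; length)
import Data.List.Properties as LP
open import Data.List.Extrema.Nat using (argmin; argmin-sel; f[argmin]≤f[⊤]; f[argmin]≤f[xs])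
open import Data.List.Membership.Propositional using (_∈_; _∉_; find; lose)
open import Data.List.Membership.Propositional.Properties
  using (∈-allFin; ∈-concatMap⁺; ∈-filter⁺; ∈-filter⁻; ∈-lookup; ∈-map⁻; ∈-map⁺; ∈-upTo⁺)
import Data.List.Relation.Unary.All as All
open All using ([]; _∷_)
open import Data.List.Relation.Unary.All.Properties using (all⁺; All¬⇒¬Any)
open import Data.List.Relation.Unary.AllPairs using ([]; _∷_)
import Data.List.Relation.Unary.Any as Any
open import Data.List.Relation.Unary.Any using (here; there)
open import Data.List.Relation.Unary.Any.Properties using (any⁺; any⁻; lookup-index)
open import Data.List.Relation.Unary.Unique.Propositional using (Unique)
open import Data.List.Relation.Unary.Unique.Propositional.Properties using (upTo⁺)
open import Data.Nat as ℕ using (ℕ; zero; suc; _∸_; _≤_; _<_; _≤ᵇ_; _<ᵇ_; _≡ᵇ_; z≤n; s≤s)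
import Data.Nat.Properties as ℕP
open import Data.Nat.Coprimality as Coprime using (1-coprimeTo)
open import Data.Product using (∃; ∃₂; _×_; _,_; proj₁; proj₂)
open import Data.Rational as ℚ using (ℚ; 0ℚ; 1ℚ; mkℚ)
import Data.Rational.Properties as ℚP
open import Data.Sum using (_⊎_; inj₁; inj₂)
open import Data.Vec as V using (Vec; []; _∷_; lookup; tabulate; zipWith)
import Data.Vec.Properties as VP
open import Function using (_∘_; id)
open import Function.Bundles using (Equivalence; _⇔_; mk⇔)
import Function.Properties.Equivalence as ⇔
open import Relation.Binary.Definitions using (DecidableEquality; tri<; tri≈; tri>)
open import Relation.Binary.PropositionalEquality hiding (J)
open import Relation.Nullary using (Dec; yes; no; does; ¬_)
open import Relation.Nullary.Decidable using (dec-true; dec-false; _×-dec_)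
open ≡-Reasoning

private variable p q : ℕ

-- Sums over lists and Kronecker deltas

false≢true : false ≢ true
false≢true ()

does-true⇒ : ∀ {a} {A : Set a} (d : Dec A) → does d ≡ true → A
does-true⇒ (yes a) _ = a

not-true⇒ : ∀ {b} → not b ≡ true → b ≡ false
not-true⇒ {false} _ = refl

does-false⇒ : ∀ {a} {A : Set a} (d : Dec A) → does d ≡ false → ¬ A
does-false⇒ (no ¬a) _ = ¬a

bool-ext : ∀ {b c : Bool} → (b ≡ true → c ≡ true) → (c ≡ true → b ≡ true) → b ≡ c
bool-ext {true}  {true}  _ _ = refl
bool-ext {true}  {false} f _ = sym (f refl)
bool-ext {false} {true}  _ g = g refl
bool-ext {false} {false} _ _ = refl

module _ {a} {A : Set a} where

  any-true⇒ : ∀ (f : A → Bool) xs → any f xs ≡ true → ∃ λ x → x ∈ xs × f x ≡ true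
  any-true⇒ f xs e with x , x∈ , fx ← find (any⁻ f xs (Equivalence.from T-≡ e)) =
    x , x∈ , Equivalence.to T-≡ fx

  any-true⇐ : ∀ (f : A → Bool) {xs} x → x ∈ xs → f x ≡ true → any f xs ≡ true
  any-true⇐ f x x∈ fx = Equivalence.to T-≡ (any⁺ f (lose x∈ (Equivalence.from T-≡ fx)))

  any-false⇒ : ∀ (f : A → Bool) {xs} → any f xs ≡ false → ∀ x → x ∈ xs → f x ≡ false
  any-false⇒ f e x x∈ with f x in fx
  ... | false = refl
  ... | true = sym (trans (sym e) (any-true⇐ f x x∈ fx))

  any-false⇐ : ∀ (f : A → Bool) xs → (∀ x → x ∈ xs → f x ≡ false) → any f xs ≡ false
  any-false⇐ f [] _ = refl
  any-false⇐ f (x ∷ xs) h rewrite h x (here refl) = any-false⇐ f xs (λ y y∈ → h y (there y∈))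

  all-true⇒ : ∀ (f : A → Bool) xs → all f xs ≡ true → ∀ x → x ∈ xs → f x ≡ true
  all-true⇒ f xs e x x∈ = Equivalence.to T-≡ (All.lookup (all⁺ f xs (Equivalence.from T-≡ e)) x∈)

  all-true⇐ : ∀ (f : A → Bool) xs → (∀ x → x ∈ xs → f x ≡ true) → all f xs ≡ true
  all-true⇐ f [] _ = refl
  all-true⇐ f (x ∷ xs) h rewrite h x (here refl) = all-true⇐ f xs (λ y y∈ → h y (there y∈))

  ∈-filterᵇ⁻ : ∀ (b : A → Bool) {xs x} → x ∈ filterᵇ b xs → x ∈ xs × b x ≡ true
  ∈-filterᵇ⁻ b x∈ with x∈xs , bx ← ∈-filter⁻ (T? ∘ b) x∈ = x∈xs , Equivalence.to T-≡ bx

  ∈-filterᵇ⁺ : ∀ (b : A → Bool) {xs x} → x ∈ xs → b x ≡ true → x ∈ filterᵇ b xs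
  ∈-filterᵇ⁺ b x∈ bx = ∈-filter⁺ (T? ∘ b) x∈ (Equivalence.from T-≡ bx)

χ : Bool → ℤ
χ true = + 1
χ false = + 0

χ-∧ : ∀ b c → χ (b ∧ c) ≡ χ b * χ c
χ-∧ true c = sym (ℤP.*-identityˡ _)
χ-∧ false c = refl

χ-not : ∀ b → χ (not b) ≡ + 1 - χ b
χ-not true = refl
χ-not false = refl

if-0≡χ* : ∀ b z → (if b then z else + 0) ≡ χ b * z
if-0≡χ* true z = sym (ℤP.*-identityˡ z)
if-0≡χ* false z = refl

∑ : ∀ {a} {A : Set a} → List A → (A → ℤ) → ℤ
∑ xs f = sumℤ (map f xs)

module _ {a} {A : Set a} where

  ∑-cong-∈ : ∀ xs {f g : A → ℤ} → (∀ x → x ∈ xs → f x ≡ g x) → ∑ xs f ≡ ∑ xs g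
  ∑-cong-∈ [] h = refl
  ∑-cong-∈ (x ∷ xs) h = cong₂ _+_ (h x (here refl)) (∑-cong-∈ xs (λ y y∈ → h y (there y∈)))

  ∑-cong : ∀ xs {f g : A → ℤ} → (∀ x → f x ≡ g x) → ∑ xs f ≡ ∑ xs g
  ∑-cong xs h = ∑-cong-∈ xs (λ x _ → h x)

  ∑-zero : ∀ xs (f : A → ℤ) → (∀ x → x ∈ xs → f x ≡ + 0) → ∑ xs f ≡ + 0
  ∑-zero [] f h = refl
  ∑-zero (x ∷ xs) f h = cong₂ _+_ (h x (here refl)) (∑-zero xs f (λ y y∈ → h y (there y∈)))

  ∑-++ : ∀ xs ys (f : A → ℤ) → ∑ (xs ++ ys) f ≡ ∑ xs f + ∑ ys f
  ∑-++ [] ys f = sym (ℤP.+-identityˡ _)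
  ∑-++ (x ∷ xs) ys f = trans (cong (_+_ (f x)) (∑-++ xs ys f)) (sym (ℤP.+-assoc (f x) _ _))

  ∑-distrib-+ : ∀ xs (f g : A → ℤ) → ∑ xs (λ x → f x + g x) ≡ ∑ xs f + ∑ xs g
  ∑-distrib-+ [] f g = refl
  ∑-distrib-+ (x ∷ xs) f g rewrite ∑-distrib-+ xs f g = interchange (f x) (g x) (∑ xs f) (∑ xs g)
    where open CommutativeSemigroupProperties ℤP.+-commutativeSemigroup using (interchange)

  *-distribˡ-∑ : ∀ c xs (f : A → ℤ) → c * ∑ xs f ≡ ∑ xs (λ x → c * f x)
  *-distribˡ-∑ c [] f = ℤP.*-zeroʳ c
  *-distribˡ-∑ c (x ∷ xs) f = trans (ℤP.*-distribˡ-+ c (f x) _) (cong (_+_ (c * f x)) (*-distribˡ-∑ c xs f))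

  *-distribʳ-∑ : ∀ c xs (f : A → ℤ) → ∑ xs f * c ≡ ∑ xs (λ x → f x * c)
  *-distribʳ-∑ c xs f = trans (ℤP.*-comm _ c) (trans (*-distribˡ-∑ c xs f) (∑-cong xs (λ x → ℤP.*-comm c (f x))))

  neg-distrib-∑ : ∀ xs (f : A → ℤ) → - ∑ xs f ≡ ∑ xs (λ x → - f x)
  neg-distrib-∑ [] f = refl
  neg-distrib-∑ (x ∷ xs) f = trans (ℤP.neg-distrib-+ (f x) _) (cong (_+_ (- f x)) (neg-distrib-∑ xs f))

  ∑-filterᵇ : ∀ (b : A → Bool) xs (f : A → ℤ) → ∑ (filterᵇ b xs) f ≡ ∑ xs (λ x → χ (b x) * f x)
  ∑-filterᵇ b [] f = refl
  ∑-filterᵇ b (x ∷ xs) f with b x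
  ... | true = cong₂ _+_ (sym (ℤP.*-identityˡ (f x))) (∑-filterᵇ b xs f)
  ... | false = trans (∑-filterᵇ b xs f) (sym (ℤP.+-identityˡ _))

  length-filterᵇ : ∀ (b : A → Bool) xs → + length (filterᵇ b xs) ≡ ∑ xs (λ x → χ (b x))
  length-filterᵇ b [] = refl
  length-filterᵇ b (x ∷ xs) with b x
  ... | true = trans (ℤP.pos-+ 1 _) (cong (_+_ (+ 1)) (length-filterᵇ b xs))
  ... | false = trans (length-filterᵇ b xs) (sym (ℤP.+-identityˡ _))

module _ {a b} {A : Set a} {B : Set b} where

  ∑-comm : ∀ xs (ys : List B) (f : A → B → ℤ) → ∑ xs (λ x → ∑ ys (f x)) ≡ ∑ ys (λ y → ∑ xs (λ x → f x y))
  ∑-comm [] ys f = sym (∑-zero ys _ (λ _ _ → refl))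
  ∑-comm (x ∷ xs) ys f = trans (cong (_+_ (∑ ys (f x))) (∑-comm xs ys f)) (sym (∑-distrib-+ ys (f x) _))

  ∑-map : ∀ (g : B → A) xs (f : A → ℤ) → ∑ (map g xs) f ≡ ∑ xs (f ∘ g)
  ∑-map g [] f = refl
  ∑-map g (x ∷ xs) f = cong (_+_ (f (g x))) (∑-map g xs f)

  ∑-concatMap : ∀ (F : B → List A) xs (f : A → ℤ) → ∑ (concatMap F xs) f ≡ ∑ xs (λ x → ∑ (F x) f)
  ∑-concatMap F [] f = refl
  ∑-concatMap F (x ∷ xs) f = trans (∑-++ (F x) (concatMap F xs) f) (cong (_+_ (∑ (F x) f)) (∑-concatMap F xs f))

module Kronecker {a} {A : Set a} (_≟_ : DecidableEquality A) where

  open import Data.List.Membership.DecPropositional _≟_ using (_∈?_)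

  δ : A → A → ℤ
  δ x y = χ (does (x ≟ y))

  δ-refl : ∀ x → δ x x ≡ + 1
  δ-refl x = cong χ (dec-true (x ≟ x) refl)

  δ-≢ : ∀ {x y} → x ≢ y → δ x y ≡ + 0
  δ-≢ {x} {y} x≢y = cong χ (dec-false (x ≟ y) x≢y)

  δ-sym : ∀ x y → δ x y ≡ δ y x
  δ-sym x y with x ≟ y
  ... | yes refl = sym (δ-refl x)
  ... | no x≢y = sym (δ-≢ (x≢y ∘ sym))

  δ-subst : ∀ x y (g : A → ℤ) → δ x y * g x ≡ δ x y * g y
  δ-subst x y g with x ≟ y
  ... | yes refl = refl
  ... | no _ = refl

  ∑-δ-∉ : ∀ xs {y} (g : A → ℤ) → y ∉ xs → ∑ xs (λ x → δ x y * g x) ≡ + 0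
  ∑-δ-∉ xs g y∉ = ∑-zero xs _ (λ x x∈ → cong (_* g x) (δ-≢ (λ { refl → y∉ x∈ })))

  ∑-δ-∈ : ∀ {xs y} (g : A → ℤ) → Unique xs → y ∈ xs → ∑ xs (λ x → δ x y * g x) ≡ g y
  ∑-δ-∈ {y ∷ xs} g (y∉ ∷ _) (here refl) =
    begin
      δ y y * g y + ∑ xs (λ x → δ x y * g x)  ≡⟨ cong₂ _+_ (cong (_* g y) (δ-refl y)) (∑-δ-∉ xs g (All¬⇒¬Any y∉)) ⟩
      + 1 * g y + + 0                         ≡⟨ trans (ℤP.+-identityʳ _) (ℤP.*-identityˡ _) ⟩
      g y                                     ∎
  ∑-δ-∈ {x ∷ xs} {y} g (x∉ ∷ uxs) (there y∈) =
    trans (cong (λ d → d * g x + ∑ xs (λ z → δ z y * g z)) (δ-≢ (λ { refl → All.lookup x∉ y∈ refl })))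
          (trans (ℤP.+-identityˡ _) (∑-δ-∈ g uxs y∈))

  ∑-δ : ∀ {xs} y (g : A → ℤ) → Unique xs → (y ∉ xs → g y ≡ + 0) → ∑ xs (λ x → δ x y * g x) ≡ g y
  ∑-δ {xs} y g uxs g0 with y ∈? xs
  ... | yes y∈ = ∑-δ-∈ g uxs y∈
  ... | no y∉ = trans (∑-δ-∉ xs g y∉) (sym (g0 y∉))

-- Products over coordinates and sums over subsets

∏ : ∀ {n} → (Fin n → ℤ) → ℤ
∏ {zero} f = + 1
∏ {suc n} f = f fz * ∏ (λ i → f (fs i))

∏-cong : ∀ {n} {f g : Fin n → ℤ} → (∀ i → f i ≡ g i) → ∏ f ≡ ∏ g
∏-cong {zero} h = refl
∏-cong {suc n} h = cong₂ _*_ (h fz) (∏-cong (λ i → h (fs i)))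

∏-distrib-* : ∀ {n} (f g : Fin n → ℤ) → ∏ (λ i → f i * g i) ≡ ∏ f * ∏ g
∏-distrib-* {zero} f g = refl
∏-distrib-* {suc n} f g rewrite ∏-distrib-* (λ i → f (fs i)) (λ i → g (fs i)) =
  interchange (f fz) (g fz) (∏ (λ i → f (fs i))) (∏ (λ i → g (fs i)))
  where open CommutativeSemigroupProperties ℤP.*-commutativeSemigroup using (interchange)

∏-zero : ∀ {n} (f : Fin n → ℤ) i → f i ≡ + 0 → ∏ f ≡ + 0
∏-zero f fz fi≡0 rewrite fi≡0 = refl
∏-zero f (fs i) fi≡0 rewrite ∏-zero (λ j → f (fs j)) i fi≡0 = ℤP.*-zeroʳ (f fz)

∏-one : ∀ {n} (f : Fin n → ℤ) → (∀ i → f i ≡ + 1) → ∏ f ≡ + 1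
∏-one {zero} f h = refl
∏-one {suc n} f h rewrite h fz | ∏-one (λ i → f (fs i)) (λ i → h (fs i)) = refl

allSubsets-complete : ∀ {n} (J : Vec Bool n) → J ∈ allSubsets n
allSubsets-complete [] = here refl
allSubsets-complete (false ∷ J) = ∈-concatMap⁺ _ (lose (allSubsets-complete J) (here refl))
allSubsets-complete (true ∷ J) = ∈-concatMap⁺ _ (lose (allSubsets-complete J) (there (here refl)))

∑-allSubsets-∏ : ∀ {n} (ψ : Fin n → Bool → ℤ) →
  ∑ (allSubsets n) (λ J → ∏ (λ i → ψ i (lookup J i))) ≡ ∏ (λ i → ψ i false + ψ i true)
∑-allSubsets-∏ {zero} ψ = refl
∑-allSubsets-∏ {suc n} ψ =
  begin
    ∑ (concatMap (λ J → (false ∷ J) ∷ (true ∷ J) ∷ []) (allSubsets n)) (λ J → ∏ (λ i → ψ i (lookup J i)))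
      ≡⟨ ∑-concatMap _ (allSubsets n) _ ⟩
    ∑ (allSubsets n) (λ J → ψ fz false * rest J + (ψ fz true * rest J + + 0))
      ≡⟨ ∑-cong (allSubsets n) (λ J → trans (cong (_+_ (ψ fz false * rest J)) (ℤP.+-identityʳ _))
                                             (sym (ℤP.*-distribʳ-+ (rest J) (ψ fz false) (ψ fz true)))) ⟩
    ∑ (allSubsets n) (λ J → (ψ fz false + ψ fz true) * rest J)
      ≡⟨ sym (*-distribˡ-∑ (ψ fz false + ψ fz true) (allSubsets n) rest) ⟩
    (ψ fz false + ψ fz true) * ∑ (allSubsets n) rest
      ≡⟨ cong ((ψ fz false + ψ fz true) *_) (∑-allSubsets-∏ (λ i → ψ (fs i))) ⟩
    ∏ (λ i → ψ i false + ψ i true) ∎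
  where
  rest : Vec Bool n → ℤ
  rest J = ∏ (λ i → ψ (fs i) (lookup J i))

sgn : ∀ {n} → Vec Bool n → ℤ
sgn J = ∏ (λ i → if lookup J i then - + 1 else + 1)

∑-allSubsets-sgn-∏ : ∀ {n} (φ : Fin n → Bool → ℤ) →
  ∑ (allSubsets n) (λ J → sgn J * ∏ (λ i → φ i (lookup J i))) ≡ ∏ (λ i → φ i false - φ i true)
∑-allSubsets-sgn-∏ {n} φ =
  begin
    ∑ (allSubsets n) (λ J → sgn J * ∏ (λ i → φ i (lookup J i)))
      ≡⟨ ∑-cong (allSubsets n) (λ J → sym (∏-distrib-* (λ i → sign (lookup J i)) (λ i → φ i (lookup J i)))) ⟩
    ∑ (allSubsets n) (λ J → ∏ (λ i → sign (lookup J i) * φ i (lookup J i)))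
      ≡⟨ ∑-allSubsets-∏ (λ i b → sign b * φ i b) ⟩
    ∏ (λ i → + 1 * φ i false + - + 1 * φ i true)
      ≡⟨ ∏-cong (λ i → signed-sum (φ i false) (φ i true)) ⟩
    ∏ (λ i → φ i false - φ i true) ∎
  where
  sign : Bool → ℤ
  sign b = if b then - + 1 else + 1
  signed-sum : ∀ a b → + 1 * a + - + 1 * b ≡ a - b
  signed-sum = solve-∀

allᶠ : ∀ {n} → (Fin n → Bool) → Bool
allᶠ {zero} f = true
allᶠ {suc n} f = f fz ∧ allᶠ (λ i → f (fs i))

χ-allᶠ : ∀ {n} (f : Fin n → Bool) → χ (allᶠ f) ≡ ∏ (λ i → χ (f i))
χ-allᶠ {zero} f = refl
χ-allᶠ {suc n} f = trans (χ-∧ (f fz) _) (cong (χ (f fz) *_) (χ-allᶠ (λ i → f (fs i))))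

allᶠ-true⇒ : ∀ {n} (f : Fin n → Bool) → allᶠ f ≡ true → ∀ i → f i ≡ true
allᶠ-true⇒ f e fz with f fz | e
... | true | _ = refl
allᶠ-true⇒ f e (fs i) with f fz | e
... | true | e′ = allᶠ-true⇒ (λ j → f (fs j)) e′ i

allᶠ-true⇐ : ∀ {n} (f : Fin n → Bool) → (∀ i → f i ≡ true) → allᶠ f ≡ true
allᶠ-true⇐ {zero} f h = refl
allᶠ-true⇐ {suc n} f h rewrite h fz = allᶠ-true⇐ (λ i → f (fs i)) (λ i → h (fs i))

allᶠ-false⇒ : ∀ {n} (f : Fin n → Bool) → allᶠ f ≡ false → ∃ λ i → f i ≡ false
allᶠ-false⇒ {suc n} f e with f fz in eq
... | false = fz , eq
... | true with i , fi ← allᶠ-false⇒ (λ j → f (fs j)) e = fs i , fi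

-- Coefficients of Laurent polynomials

lookup-ext : ∀ {a} {A : Set a} {n} {u v : Vec A n} → (∀ i → lookup u i ≡ lookup v i) → u ≡ v
lookup-ext {u = u} {v} h = trans (sym (VP.tabulate∘lookup u)) (trans (VP.tabulate-cong h) (VP.tabulate∘lookup v))

lookup-+ᵥ : ∀ (x y : PtZ p) i → lookup (x +ᵥ y) i ≡ lookup x i + lookup y i
lookup-+ᵥ x y i = VP.lookup-zipWith _+_ i x y

lookup--ᵥ : ∀ (x y : PtZ p) i → lookup (x -ᵥ y) i ≡ lookup x i - lookup y i
lookup--ᵥ x y i = VP.lookup-zipWith _-_ i x y

lookup-0ᵥ : ∀ i → lookup (0ᵥ {p}) i ≡ + 0
lookup-0ᵥ i = VP.lookup-replicate i (+ 0)

lookup-toZ : ∀ (x : Pt p) i → lookup (toZ x) i ≡ + lookup x i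
lookup-toZ x i = VP.lookup-map i +_ x

lookup-toZ-difference : ∀ (m u : Pt p) i → lookup (toZ m -ᵥ toZ u) i ≡ + lookup m i - + lookup u i
lookup-toZ-difference m u i = trans (lookup--ᵥ (toZ m) (toZ u) i) (cong₂ _-_ (lookup-toZ m i) (lookup-toZ u i))

-ᵥ-identityʳ : ∀ (m : PtZ p) → m -ᵥ 0ᵥ ≡ m
-ᵥ-identityʳ m = lookup-ext λ i → begin
  lookup (m -ᵥ 0ᵥ) i        ≡⟨ lookup--ᵥ m 0ᵥ i ⟩
  lookup m i - lookup 0ᵥ i  ≡⟨ cong (_-_ (lookup m i)) (lookup-0ᵥ i) ⟩
  lookup m i - + 0          ≡⟨ ℤP.+-identityʳ _ ⟩
  lookup m i                ∎

+ᵥ-comm : ∀ (x y : PtZ p) → x +ᵥ y ≡ y +ᵥ x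
+ᵥ-comm x y = lookup-ext λ i →
  trans (lookup-+ᵥ x y i) (trans (ℤP.+-comm (lookup x i) (lookup y i)) (sym (lookup-+ᵥ y x i)))

+ᵥ≡⇒≡-ᵥ : ∀ (x y m : PtZ p) → (x +ᵥ y ≡ m) → y ≡ m -ᵥ x
+ᵥ≡⇒≡-ᵥ x y m e = lookup-ext λ i → begin
  lookup y i                              ≡⟨ cancel (lookup x i) (lookup y i) ⟩
  (lookup x i + lookup y i) - lookup x i  ≡⟨ cong (_- lookup x i) (trans (sym (lookup-+ᵥ x y i)) (cong (λ z → lookup z i) e)) ⟩
  lookup m i - lookup x i                 ≡⟨ sym (lookup--ᵥ m x i) ⟩
  lookup (m -ᵥ x) i                       ∎
  where
  cancel : ∀ a b → b ≡ (a + b) - a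
  cancel = solve-∀

≡-ᵥ⇒+ᵥ≡ : ∀ (x y m : PtZ p) → y ≡ m -ᵥ x → x +ᵥ y ≡ m
≡-ᵥ⇒+ᵥ≡ x y m refl = lookup-ext λ i → begin
  lookup (x +ᵥ (m -ᵥ x)) i                 ≡⟨ lookup-+ᵥ x (m -ᵥ x) i ⟩
  lookup x i + lookup (m -ᵥ x) i           ≡⟨ cong (_+_ (lookup x i)) (lookup--ᵥ m x i) ⟩
  lookup x i + (lookup m i - lookup x i)   ≡⟨ cancel (lookup x i) (lookup m i) ⟩
  lookup m i                               ∎
  where
  cancel : ∀ a c → a + (c - a) ≡ c
  cancel = solve-∀

+ᵥ-≟-shiftʳ : ∀ (x y m : PtZ p) → (x +ᵥ y) ≟ᶻ m ≡ y ≟ᶻ (m -ᵥ x)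
+ᵥ-≟-shiftʳ x y m = bool-ext
  (λ e → dec-true (VP.≡-dec ℤ._≟_ y (m -ᵥ x)) (+ᵥ≡⇒≡-ᵥ x y m (does-true⇒ (VP.≡-dec ℤ._≟_ (x +ᵥ y) m) e)))
  (λ e → dec-true (VP.≡-dec ℤ._≟_ (x +ᵥ y) m) (≡-ᵥ⇒+ᵥ≡ x y m (does-true⇒ (VP.≡-dec ℤ._≟_ y (m -ᵥ x)) e)))

+ᵥ-≟-shiftˡ : ∀ (x y m : PtZ p) → (x +ᵥ y) ≟ᶻ m ≡ x ≟ᶻ (m -ᵥ y)
+ᵥ-≟-shiftˡ x y m = trans (cong (_≟ᶻ m) (+ᵥ-comm x y)) (+ᵥ-≟-shiftʳ y x m)

contribution : PtZ p → ℤ × PtZ p → ℤ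
contribution m cx = if proj₂ cx ≟ᶻ m then proj₁ cx else + 0

coeff≡∑ : ∀ (P : Poly p) m → coeff P m ≡ ∑ P (contribution m)
coeff≡∑ [] m = refl
coeff≡∑ (cx ∷ P) m = cong (_+_ (contribution m cx)) (coeff≡∑ P m)

coeff-++ : ∀ (P Q : Poly p) m → coeff (P ++ Q) m ≡ coeff P m + coeff Q m
coeff-++ P Q m = trans (coeff≡∑ (P ++ Q) m) (trans (∑-++ P Q (contribution m)) (sym (cong₂ _+_ (coeff≡∑ P m) (coeff≡∑ Q m))))

coeff-sumₚ : ∀ {A : Set} (xs : List A) (F : A → Poly p) m → coeff (sumₚ xs F) m ≡ ∑ xs (λ x → coeff (F x) m)
coeff-sumₚ xs F m =
  trans (coeff≡∑ (sumₚ xs F) m) (trans (∑-concatMap F xs (contribution m)) (∑-cong xs (λ x → sym (coeff≡∑ (F x) m))))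

coeff-mono : ∀ c (x m : PtZ p) → coeff (mono c x) m ≡ (if x ≟ᶻ m then c else + 0)
coeff-mono c x m = ℤP.+-identityʳ _

coeff-*ₚ : ∀ (P Q : Poly p) m → coeff (P *ₚ Q) m ≡
  ∑ P (λ cx → ∑ Q (λ dy → if (proj₂ cx +ᵥ proj₂ dy) ≟ᶻ m then proj₁ cx * proj₁ dy else + 0))
coeff-*ₚ [] Q m = refl
coeff-*ₚ ((c , x) ∷ P) Q m = trans (coeff-++ (map _ Q) (P *ₚ Q) m)
  (cong₂ _+_ (trans (coeff≡∑ (map _ Q) m) (∑-map _ Q (contribution m))) (coeff-*ₚ P Q m))

private
  *-if-0 : ∀ b c d → c * (if b then d else + 0) ≡ (if b then c * d else + 0)
  *-if-0 true c d = refl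
  *-if-0 false c d = ℤP.*-zeroʳ c

  if-0-* : ∀ b c d → (if b then c else + 0) * d ≡ (if b then c * d else + 0)
  if-0-* true c d = refl
  if-0-* false c d = refl

coeff-*ₚ-∑ˡ : ∀ (P Q : Poly p) m → coeff (P *ₚ Q) m ≡ ∑ P (λ cx → proj₁ cx * coeff Q (m -ᵥ proj₂ cx))
coeff-*ₚ-∑ˡ P Q m = trans (coeff-*ₚ P Q m) (∑-cong P λ cx → sym (begin
  proj₁ cx * coeff Q (m -ᵥ proj₂ cx)
    ≡⟨ cong (proj₁ cx *_) (coeff≡∑ Q _) ⟩
  proj₁ cx * ∑ Q (contribution (m -ᵥ proj₂ cx))
    ≡⟨ *-distribˡ-∑ (proj₁ cx) Q _ ⟩
  ∑ Q (λ dy → proj₁ cx * contribution (m -ᵥ proj₂ cx) dy)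
    ≡⟨ ∑-cong Q (λ dy → trans (*-if-0 _ (proj₁ cx) (proj₁ dy))
         (cong (λ b → if b then proj₁ cx * proj₁ dy else + 0) (sym (+ᵥ-≟-shiftʳ (proj₂ cx) (proj₂ dy) m)))) ⟩
  ∑ Q (λ dy → if (proj₂ cx +ᵥ proj₂ dy) ≟ᶻ m then proj₁ cx * proj₁ dy else + 0) ∎))

coeff-*ₚ-∑ʳ : ∀ (P Q : Poly p) m → coeff (P *ₚ Q) m ≡ ∑ Q (λ dy → coeff P (m -ᵥ proj₂ dy) * proj₁ dy)
coeff-*ₚ-∑ʳ P Q m = trans (coeff-*ₚ P Q m) (trans (∑-comm P Q _) (∑-cong Q λ dy → sym (begin
  coeff P (m -ᵥ proj₂ dy) * proj₁ dy
    ≡⟨ cong (_* proj₁ dy) (coeff≡∑ P _) ⟩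
  ∑ P (contribution (m -ᵥ proj₂ dy)) * proj₁ dy
    ≡⟨ *-distribʳ-∑ (proj₁ dy) P _ ⟩
  ∑ P (λ cx → contribution (m -ᵥ proj₂ dy) cx * proj₁ dy)
    ≡⟨ ∑-cong P (λ cx → trans (if-0-* _ (proj₁ cx) (proj₁ dy))
         (cong (λ b → if b then proj₁ cx * proj₁ dy else + 0) (sym (+ᵥ-≟-shiftˡ (proj₂ cx) (proj₂ dy) m)))) ⟩
  ∑ P (λ cx → if (proj₂ cx +ᵥ proj₂ dy) ≟ᶻ m then proj₁ cx * proj₁ dy else + 0) ∎)))

*ₚ-cong : ∀ {P P′ Q Q′ : Poly p} → P ≈ₚ P′ → Q ≈ₚ Q′ → (P *ₚ Q) ≈ₚ (P′ *ₚ Q′)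
*ₚ-cong {P = P} {P′} {Q} {Q′} P≈ Q≈ m = begin
  coeff (P *ₚ Q) m                                    ≡⟨ coeff-*ₚ-∑ʳ P Q m ⟩
  ∑ Q (λ dy → coeff P (m -ᵥ proj₂ dy) * proj₁ dy)     ≡⟨ ∑-cong Q (λ dy → cong (_* proj₁ dy) (P≈ _)) ⟩
  ∑ Q (λ dy → coeff P′ (m -ᵥ proj₂ dy) * proj₁ dy)    ≡⟨ sym (coeff-*ₚ-∑ʳ P′ Q m) ⟩
  coeff (P′ *ₚ Q) m                                   ≡⟨ coeff-*ₚ-∑ˡ P′ Q m ⟩
  ∑ P′ (λ cx → proj₁ cx * coeff Q (m -ᵥ proj₂ cx))    ≡⟨ ∑-cong P′ (λ cx → cong (proj₁ cx *_) (Q≈ _)) ⟩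
  ∑ P′ (λ cx → proj₁ cx * coeff Q′ (m -ᵥ proj₂ cx))   ≡⟨ sym (coeff-*ₚ-∑ˡ P′ Q′ m) ⟩
  coeff (P′ *ₚ Q′) m                                  ∎

oneₚ-*ₚ : ∀ (Q : Poly p) → (oneₚ *ₚ Q) ≈ₚ Q
oneₚ-*ₚ Q m = trans (coeff-*ₚ-∑ˡ oneₚ Q m)
  (trans (ℤP.+-identityʳ _) (trans (ℤP.*-identityˡ _) (cong (coeff Q) (-ᵥ-identityʳ m))))

liftₚ : ∀ {p} → Poly p → Poly (suc p)
liftₚ = map (λ cx → proj₁ cx , + 0 ∷ proj₂ cx)

coeff-liftₚ : ∀ {p} (Q : Poly p) b v → coeff (liftₚ Q) (b ∷ v) ≡ χ (does (+ 0 ℤ.≟ b)) * coeff Q v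
coeff-liftₚ Q b v = begin
  coeff (liftₚ Q) (b ∷ v)
    ≡⟨ coeff≡∑ (liftₚ Q) (b ∷ v) ⟩
  ∑ (liftₚ Q) (contribution (b ∷ v))
    ≡⟨ ∑-map _ Q (contribution (b ∷ v)) ⟩
  ∑ Q (λ cx → if does (+ 0 ℤ.≟ b) ∧ (proj₂ cx ≟ᶻ v) then proj₁ cx else + 0)
    ≡⟨ ∑-cong Q (λ cx → if-∧ (does (+ 0 ℤ.≟ b)) (proj₂ cx ≟ᶻ v) (proj₁ cx)) ⟩
  ∑ Q (λ cx → χ (does (+ 0 ℤ.≟ b)) * contribution v cx)
    ≡⟨ sym (*-distribˡ-∑ (χ (does (+ 0 ℤ.≟ b))) Q (contribution v)) ⟩
  χ (does (+ 0 ℤ.≟ b)) * ∑ Q (contribution v)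
    ≡⟨ cong (χ (does (+ 0 ℤ.≟ b)) *_) (sym (coeff≡∑ Q v)) ⟩
  χ (does (+ 0 ℤ.≟ b)) * coeff Q v ∎
  where
  if-∧ : ∀ b c z → (if b ∧ c then z else + 0) ≡ χ b * (if c then z else + 0)
  if-∧ true c z = sym (ℤP.*-identityˡ _)
  if-∧ false c z = refl

liftₚ-*ₚ : ∀ {p} (P Q : Poly p) → liftₚ (P *ₚ Q) ≈ₚ (liftₚ P *ₚ liftₚ Q)
liftₚ-*ₚ P Q (b ∷ v) = begin
  coeff (liftₚ (P *ₚ Q)) (b ∷ v)
    ≡⟨ coeff-liftₚ (P *ₚ Q) b v ⟩
  z * coeff (P *ₚ Q) v
    ≡⟨ cong (z *_) (coeff-*ₚ-∑ˡ P Q v) ⟩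
  z * ∑ P (λ cx → proj₁ cx * coeff Q (v -ᵥ proj₂ cx))
    ≡⟨ *-distribˡ-∑ z P _ ⟩
  ∑ P (λ cx → z * (proj₁ cx * coeff Q (v -ᵥ proj₂ cx)))
    ≡⟨ ∑-cong P (λ cx → trans (swap z (proj₁ cx) _) (cong (proj₁ cx *_) (sym (lifted cx)))) ⟩
  ∑ P (λ cx → proj₁ cx * coeff (liftₚ Q) ((b ∷ v) -ᵥ (+ 0 ∷ proj₂ cx)))
    ≡⟨ sym (∑-map _ P _) ⟩
  ∑ (liftₚ P) (λ cx → proj₁ cx * coeff (liftₚ Q) ((b ∷ v) -ᵥ proj₂ cx))
    ≡⟨ sym (coeff-*ₚ-∑ˡ (liftₚ P) (liftₚ Q) (b ∷ v)) ⟩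
  coeff (liftₚ P *ₚ liftₚ Q) (b ∷ v) ∎
  where
  z = χ (does (+ 0 ℤ.≟ b))
  swap : ∀ a c d → a * (c * d) ≡ c * (a * d)
  swap = solve-∀
  lifted : ∀ cx → coeff (liftₚ Q) ((b ∷ v) -ᵥ (+ 0 ∷ proj₂ cx)) ≡ z * coeff Q (v -ᵥ proj₂ cx)
  lifted cx = trans (coeff-liftₚ Q (b - + 0) (v -ᵥ proj₂ cx)) (cong (λ a → χ (does (+ 0 ℤ.≟ a)) * _) (ℤP.+-identityʳ b))

∏ₚ : ∀ {n p} → (Fin n → Poly p) → Poly p
∏ₚ {zero} F = oneₚ
∏ₚ {suc n} F = F fz *ₚ ∏ₚ (λ i → F (fs i))

prodₚ-allFin : ∀ {n p} (F : Fin n → Poly p) → prodₚ (allFin n) F ≡ ∏ₚ F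
prodₚ-allFin = go id
  where
  go : ∀ {n p} {A : Set} (g : Fin n → A) (F : A → Poly p) → prodₚ (L.tabulate g) F ≡ ∏ₚ (λ i → F (g i))
  go {zero} g F = refl
  go {suc n} g F = cong (F (g fz) *ₚ_) (go (λ i → g (fs i)) F)

prodₚ-filterᵇ : ∀ {p} {A : Set} (b : A → Bool) xs (G : A → Poly p) →
  prodₚ (filterᵇ b xs) G ≈ₚ prodₚ xs (λ x → if b x then G x else oneₚ)
prodₚ-filterᵇ b [] G m = refl
prodₚ-filterᵇ b (x ∷ xs) G m with b x
... | true = *ₚ-cong {P = G x} {G x} {prodₚ (filterᵇ b xs) G} {prodₚ xs (λ x → if b x then G x else oneₚ)} (λ _ → refl) (prodₚ-filterᵇ b xs G) m
... | false = trans (prodₚ-filterᵇ b xs G m) (sym (oneₚ-*ₚ (prodₚ xs (λ x → if b x then G x else oneₚ)) m))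

∏ₚ-liftₚ : ∀ {n p} (H : Fin n → Poly (suc p)) (G : Fin n → Poly p) →
  (∀ i → H i ≈ₚ liftₚ (G i)) → ∏ₚ H ≈ₚ liftₚ (∏ₚ G)
∏ₚ-liftₚ {zero} H G h m = refl
∏ₚ-liftₚ {suc n} H G h m =
  trans (*ₚ-cong {P = H fz} {liftₚ (G fz)} {∏ₚ (λ i → H (fs i))} {liftₚ (∏ₚ (λ i → G (fs i)))}
           (h fz) (∏ₚ-liftₚ (λ i → H (fs i)) (λ i → G (fs i)) (λ i → h (fs i))) m)
        (sym (liftₚ-*ₚ (G fz) (∏ₚ (λ i → G (fs i))) m))

UPoly : Set
UPoly = List (ℤ × ℤ)

ucoeff : UPoly → ℤ → ℤ
ucoeff q a = ∑ q (λ ca → if does (proj₂ ca ℤ.≟ a) then proj₁ ca else + 0)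

_·eᶻ_ : ∀ {p} → ℤ → Fin p → PtZ p
a ·eᶻ i = tabulate (λ j → if does (j ≟ᶠ i) then a else + 0)

inVar : ∀ {p} → Fin p → UPoly → Poly p
inVar i = map (λ ca → proj₁ ca , proj₂ ca ·eᶻ i)

coeff-∏ₚ-inVar : ∀ {p} (F : Fin p → Poly p) (q : Fin p → UPoly) → (∀ i → F i ≈ₚ inVar i (q i)) →
  ∀ m → coeff (∏ₚ F) m ≡ ∏ (λ i → ucoeff (q i) (lookup m i))
coeff-∏ₚ-inVar {zero} F q h [] = refl
coeff-∏ₚ-inVar {suc p} F q h (m₀ ∷ m) = begin
  coeff (∏ₚ F) (m₀ ∷ m)
    ≡⟨ *ₚ-cong {P = F fz} {inVar fz (q fz)} {∏ₚ (λ i → F (fs i))} {liftₚ (∏ₚ G)} (h fz) rest≈ (m₀ ∷ m) ⟩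
  coeff (inVar fz (q fz) *ₚ liftₚ (∏ₚ G)) (m₀ ∷ m)
    ≡⟨ coeff-*ₚ-∑ˡ (inVar fz (q fz)) (liftₚ (∏ₚ G)) (m₀ ∷ m) ⟩
  ∑ (inVar fz (q fz)) (λ cx → proj₁ cx * coeff (liftₚ (∏ₚ G)) ((m₀ ∷ m) -ᵥ proj₂ cx))
    ≡⟨ ∑-map _ (q fz) _ ⟩
  ∑ (q fz) (λ ca → proj₁ ca * coeff (liftₚ (∏ₚ G)) ((m₀ - proj₂ ca) ∷ (m -ᵥ zeros)))
    ≡⟨ ∑-cong (q fz) (λ ca → cong (proj₁ ca *_) (first-factor ca)) ⟩
  ∑ (q fz) (λ ca → proj₁ ca * (χ (does (proj₂ ca ℤ.≟ m₀)) * R))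
    ≡⟨ ∑-cong (q fz) (λ ca → trans (reassoc (proj₁ ca) (χ (does (proj₂ ca ℤ.≟ m₀))) R)
         (cong (_* R) (sym (if-0≡χ* (does (proj₂ ca ℤ.≟ m₀)) (proj₁ ca))))) ⟩
  ∑ (q fz) (λ ca → (if does (proj₂ ca ℤ.≟ m₀) then proj₁ ca else + 0) * R)
    ≡⟨ sym (*-distribʳ-∑ R (q fz) _) ⟩
  ucoeff (q fz) m₀ * R ∎
  where
  G : Fin p → Poly p
  G i = inVar i (q (fs i))
  rest≈ : ∏ₚ (λ i → F (fs i)) ≈ₚ liftₚ (∏ₚ G)
  rest≈ = ∏ₚ-liftₚ (λ i → F (fs i)) G (λ i v → trans (h (fs i) v) (cong (λ P → coeff P v) (LP.map-∘ (q (fs i)))))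
  R : ℤ
  R = ∏ (λ i → ucoeff (q (fs i)) (lookup m i))
  zeros : PtZ p
  zeros = tabulate (λ _ → + 0)
  -zeros : m -ᵥ zeros ≡ m
  -zeros = lookup-ext λ i → trans (lookup--ᵥ m zeros i) (trans (cong (_-_ (lookup m i)) (VP.lookup∘tabulate _ i)) (ℤP.+-identityʳ _))
  reassoc : ∀ a b c → a * (b * c) ≡ (b * a) * c
  reassoc = solve-∀
  0≟-shift : ∀ a → does (+ 0 ℤ.≟ m₀ - a) ≡ does (a ℤ.≟ m₀)
  0≟-shift a = bool-ext
    (λ e → dec-true (a ℤ.≟ m₀) (trans (sym (ℤP.+-identityʳ a)) (trans (cong (_+_ a) (does-true⇒ (+ 0 ℤ.≟ m₀ - a) e)) (cancel a m₀))))
    (λ e → dec-true (+ 0 ℤ.≟ m₀ - a) (sym (trans (cong (_- a) (sym (does-true⇒ (a ℤ.≟ m₀) e))) (ℤP.+-inverseʳ a))))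
    where
    cancel : ∀ a c → a + (c - a) ≡ c
    cancel = solve-∀
  first-factor : ∀ ca → coeff (liftₚ (∏ₚ G)) ((m₀ - proj₂ ca) ∷ (m -ᵥ zeros)) ≡ χ (does (proj₂ ca ℤ.≟ m₀)) * R
  first-factor ca = trans (coeff-liftₚ (∏ₚ G) _ _)
    (cong₂ _*_ (cong χ (0≟-shift (proj₂ ca))) (trans (cong (coeff (∏ₚ G)) -zeros) (coeff-∏ₚ-inVar G (λ i → q (fs i)) (λ i _ → refl) m)))

-- Lattice points and the alternating count

_≤ᴾ_ : Pt p → Pt p → Set
x ≤ᴾ y = ∀ i → lookup x i ≤ lookup y i

≤ᴾ-trans : ∀ {x y z : Pt p} → x ≤ᴾ y → y ≤ᴾ z → x ≤ᴾ z
≤ᴾ-trans x≤y y≤z i = ℕP.≤-trans (x≤y i) (y≤z i)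

≤ᵥ≡allᶠ : ∀ (x y : Pt p) → x ≤ᵥ y ≡ allᶠ (λ i → lookup x i ≤ᵇ lookup y i)
≤ᵥ≡allᶠ [] [] = refl
≤ᵥ≡allᶠ (a ∷ x) (b ∷ y) = cong ((a ≤ᵇ b) ∧_) (≤ᵥ≡allᶠ x y)

≟ᴺ≡allᶠ : ∀ (x y : Pt p) → x ≟ᴺ y ≡ allᶠ (λ i → lookup x i ≡ᵇ lookup y i)
≟ᴺ≡allᶠ [] [] = refl
≟ᴺ≡allᶠ (a ∷ x) (b ∷ y) = cong ((a ≡ᵇ b) ∧_) (≟ᴺ≡allᶠ x y)

≤ᵥ⇒≤ᴾ : ∀ (x y : Pt p) → x ≤ᵥ y ≡ true → x ≤ᴾ y
≤ᵥ⇒≤ᴾ x y e i = does-true⇒ (_ ℕ.≤? _) (allᶠ-true⇒ _ (trans (sym (≤ᵥ≡allᶠ x y)) e) i)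

≤ᴾ⇒≤ᵥ : ∀ (x y : Pt p) → x ≤ᴾ y → x ≤ᵥ y ≡ true
≤ᴾ⇒≤ᵥ x y x≤y = trans (≤ᵥ≡allᶠ x y) (allᶠ-true⇐ _ (λ i → dec-true (_ ℕ.≤? _) (x≤y i)))

≟ᴺ⇒≡ : ∀ (x y : Pt p) → x ≟ᴺ y ≡ true → x ≡ y
≟ᴺ⇒≡ x y = does-true⇒ (VP.≡-dec ℕ._≟_ x y)

≡⇒≟ᴺ : ∀ (x y : Pt p) → x ≡ y → x ≟ᴺ y ≡ true
≡⇒≟ᴺ x y = dec-true (VP.≡-dec ℕ._≟_ x y)

≟ᶻ⇒≡ : ∀ (x y : PtZ p) → x ≟ᶻ y ≡ true → x ≡ y
≟ᶻ⇒≡ x y = does-true⇒ (VP.≡-dec ℤ._≟_ x y)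

≡⇒≟ᶻ : ∀ (x y : PtZ p) → x ≡ y → x ≟ᶻ y ≡ true
≡⇒≟ᶻ x y = dec-true (VP.≡-dec ℤ._≟_ x y)

∣∣-mono-≤ : ∀ (x y : Pt p) → x ≤ᴾ y → ∣ x ∣ᵥ ≤ ∣ y ∣ᵥ
∣∣-mono-≤ [] [] _ = ℕ.z≤n
∣∣-mono-≤ (_ ∷ x) (_ ∷ y) x≤y = ℕP.+-mono-≤ (x≤y fz) (∣∣-mono-≤ x y (λ i → x≤y (fs i)))

∣∣-mono-< : ∀ (x y : Pt p) → x ≤ᴾ y → x ≢ y → ∣ x ∣ᵥ < ∣ y ∣ᵥ
∣∣-mono-< [] [] _ x≢y = ⊥-elim (x≢y refl)
∣∣-mono-< (a ∷ x) (b ∷ y) x≤y x≢y with a ℕ.≟ b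
... | yes refl = ℕP.+-mono-≤-< (ℕP.≤-refl {a}) (∣∣-mono-< x y (λ i → x≤y (fs i)) (λ e → x≢y (cong (a ∷_) e)))
... | no a≢b = ℕP.+-mono-<-≤ (ℕP.≤∧≢⇒< (x≤y fz) a≢b) (∣∣-mono-≤ x y (λ i → x≤y (fs i)))

toZ-injective : ∀ (x y : Pt p) → toZ x ≡ toZ y → x ≡ y
toZ-injective x y e = lookup-ext λ i →
  ℤP.+-injective (trans (sym (lookup-toZ x i)) (trans (cong (λ z → lookup z i) e) (lookup-toZ y i)))

toZ-≟ : ∀ (x y : Pt p) → toZ x ≟ᶻ toZ y ≡ x ≟ᴺ y
toZ-≟ x y = bool-ext
  (λ e → ≡⇒≟ᴺ x y (toZ-injective x y (≟ᶻ⇒≡ (toZ x) (toZ y) e)))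
  (λ e → ≡⇒≟ᶻ (toZ x) (toZ y) (cong toZ (≟ᴺ⇒≡ x y e)))

HasNegative : PtZ p → Set
HasNegative m = ∃ λ i → ∃ λ j → lookup m i ≡ -[1+ j ]

toZ-≟-HasNegative : ∀ (x : Pt p) {m} → HasNegative m → toZ x ≟ᶻ m ≡ false
toZ-≟-HasNegative x {m} (i , j , mᵢ<0) with toZ x ≟ᶻ m in eq
... | false = refl
... | true with () ← trans (sym (lookup-toZ x i)) (trans (cong (λ z → lookup z i) (≟ᶻ⇒≡ (toZ x) m eq)) mᵢ<0)

toZ⊎HasNegative : ∀ (m : PtZ p) → (∃ λ m′ → m ≡ toZ m′) ⊎ HasNegative m
toZ⊎HasNegative [] = inj₁ ([] , refl)
toZ⊎HasNegative (-[1+ j ] ∷ m) = inj₂ (fz , j , refl)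
toZ⊎HasNegative (+ a ∷ m) with toZ⊎HasNegative m
... | inj₁ (m′ , refl) = inj₁ (a ∷ m′ , refl)
... | inj₂ (i , j , e) = inj₂ (fs i , j , e)

record _HasCoefficients_ (X : Poly p) (c : Pt p → ℤ) : Set where
  field
    at-ℕᵖ : ∀ m → coeff X (toZ m) ≡ c m
    at-negative : ∀ m → HasNegative m → coeff X m ≡ + 0

open _HasCoefficients_

≈ₚ-from-coefficients : ∀ {X Y : Poly p} {c} → X HasCoefficients c → Y HasCoefficients c → X ≈ₚ Y
≈ₚ-from-coefficients X∼c Y∼c m with toZ⊎HasNegative m
... | inj₁ (m′ , refl) = trans (at-ℕᵖ X∼c m′) (sym (at-ℕᵖ Y∼c m′))
... | inj₂ neg = trans (at-negative X∼c m neg) (sym (at-negative Y∼c m neg))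

open module KroneckerPt {p} = Kronecker (VP.≡-dec {n = p} ℕ._≟_) public renaming (δ to δᴺ)

δᴺ≡∏ : ∀ (x y : Pt p) → δᴺ x y ≡ ∏ (λ i → χ (lookup x i ≡ᵇ lookup y i))
δᴺ≡∏ x y = trans (cong χ (≟ᴺ≡allᶠ x y)) (χ-allᶠ (λ i → lookup x i ≡ᵇ lookup y i))

sumₚ-mono-HasCoefficients : ∀ {I : List (Pt p)} (a c : Pt p → ℤ) → Unique I →
  (∀ n → n ∈ I → a n ≡ c n) → (∀ m → m ∉ I → c m ≡ + 0) →
  sumₚ I (λ n → mono (a n) (toZ n)) HasCoefficients c
sumₚ-mono-HasCoefficients {I = I} a c uniq a≡c c≡0 = record
  { at-ℕᵖ = λ m → begin
      coeff (sumₚ I (λ n → mono (a n) (toZ n))) (toZ m)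
        ≡⟨ coeff-sumₚ I _ (toZ m) ⟩
      ∑ I (λ n → coeff (mono (a n) (toZ n)) (toZ m))
        ≡⟨ ∑-cong-∈ I (λ n n∈ → trans (coeff-mono (a n) (toZ n) (toZ m))
             (trans (cong (λ b → if b then a n else + 0) (toZ-≟ n m)) (trans (if-0≡χ* _ (a n)) (cong (δᴺ n m *_) (a≡c n n∈))))) ⟩
      ∑ I (λ n → δᴺ n m * c n)
        ≡⟨ ∑-δ m c uniq (c≡0 m) ⟩
      c m ∎
  ; at-negative = λ m neg → trans (coeff-sumₚ I _ m) (∑-zero I _ (λ n _ →
      trans (coeff-mono (a n) (toZ n) m) (cong (λ b → if b then a n else + 0) (toZ-≟-HasNegative n neg))))
  }

_+ₛ_ : Pt p → Vec Bool p → Pt p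
x +ₛ J = zipWith (λ a b → if b then suc a else a) x J

lookup-+ₛ : ∀ (x : Pt p) J i → lookup (x +ₛ J) i ≡ (if lookup J i then suc (lookup x i) else lookup x i)
lookup-+ₛ x J i = VP.lookup-zipWith _ i x J

x≤x+ₛJ : ∀ (x : Pt p) J → x ≤ᴾ (x +ₛ J)
x≤x+ₛJ x J i rewrite lookup-+ₛ x J i with lookup J i
... | true = ℕP.n≤1+n _
... | false = ℕP.≤-refl

DownClosed : List (Pt p) → Set
DownClosed I = ∀ {x y} → x ≤ᴾ y → y ∈ I → x ∈ I

multiplicity : List (Pt p) → Pt p → ℤ
multiplicity I x = ∑ I (λ z → δᴺ z x * + 1)

altCount : List (Pt p) → Pt p → ℤ
altCount {p} I m = ∑ (allSubsets p) (λ J → sgn J * multiplicity I (m +ₛ J))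

altCount-∉ : ∀ {I : List (Pt p)} → DownClosed I → ∀ m → m ∉ I → altCount I m ≡ + 0
altCount-∉ {p} {I} down m m∉ = ∑-zero (allSubsets p) _ (λ J _ →
  trans (cong (sgn J *_) (∑-δ-∉ I (λ _ → + 1) (λ m+J∈ → m∉ (down (x≤x+ₛJ m J) m+J∈)))) (ℤP.*-zeroʳ (sgn J)))

Dominated : List (Pt p) → Pt p → Set
Dominated P y = ∃ λ u → u ∈ P × y ≤ᴾ u

Enumerates-⇔ : ∀ {L : List (Pt p)} {S S′ : Pt p → Set} → (∀ n → S n ⇔ S′ n) → Enumerates L S → Enumerates L S′
Enumerates-⇔ S⇔S′ (unique , L⇔S) = unique , λ n → ⇔.trans (L⇔S n) (S⇔S′ n)

Enumerates⇒DownClosed : ∀ {P I : List (Pt p)} → Enumerates I (Dominated P) → DownClosed I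
Enumerates⇒DownClosed (_ , I≡) {x} {y} x≤y y∈ with u , u∈ , y≤u ← Equivalence.to (I≡ y) y∈ =
  Equivalence.from (I≡ x) (u , u∈ , ≤ᴾ-trans {x = x} {y} {u} x≤y y≤u)

multiplicity-Dominated : ∀ {P I : List (Pt p)} → Enumerates I (Dominated P) → ∀ y → multiplicity I y ≡ χ (any (y ≤ᵥ_) P)
multiplicity-Dominated {P = P} {I} (unique , I≡) y with any (y ≤ᵥ_) P in dom
... | true with u , u∈ , y≤u ← any-true⇒ _ P dom = ∑-δ-∈ (λ _ → + 1) unique (Equivalence.from (I≡ y) (u , u∈ , ≤ᵥ⇒≤ᴾ y u y≤u))
... | false = ∑-δ-∉ I (λ _ → + 1) λ y∈ → let u , u∈ , y≤u = Equivalence.to (I≡ y) y∈ in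
  false≢true (trans (sym (any-false⇒ _ dom u u∈)) (≤ᴾ⇒≤ᵥ y u y≤u))

μᴺ₁ : ℕ → ℕ → ℤ
μᴺ₁ a c = χ (c ≡ᵇ a) - χ (c ≡ᵇ suc a)

μᴺ : Pt p → Pt p → ℤ
μᴺ {p} x y = ∑ (allSubsets p) (λ J → sgn J * δᴺ y (x +ₛ J))

μᴺ≡∏ : ∀ (x y : Pt p) → μᴺ x y ≡ ∏ (λ i → μᴺ₁ (lookup x i) (lookup y i))
μᴺ≡∏ {p} x y = begin
  ∑ (allSubsets p) (λ J → sgn J * δᴺ y (x +ₛ J))
    ≡⟨ ∑-cong (allSubsets p) (λ J → cong (sgn J *_) (trans (δᴺ≡∏ y (x +ₛ J))
         (∏-cong (λ i → cong (λ z → χ (lookup y i ≡ᵇ z)) (lookup-+ₛ x J i))))) ⟩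
  ∑ (allSubsets p) (λ J → sgn J * ∏ (λ i → χ (lookup y i ≡ᵇ (if lookup J i then suc (lookup x i) else lookup x i))))
    ≡⟨ ∑-allSubsets-sgn-∏ (λ i b → χ (lookup y i ≡ᵇ (if b then suc (lookup x i) else lookup x i))) ⟩
  ∏ (λ i → μᴺ₁ (lookup x i) (lookup y i)) ∎

∑-μᴺ : ∀ (I : List (Pt p)) m → ∑ I (μᴺ m) ≡ altCount I m
∑-μᴺ {p} I m = trans (∑-comm I (allSubsets p) (λ n J → sgn J * δᴺ n (m +ₛ J)))
  (∑-cong (allSubsets p) (λ J → trans (sym (*-distribˡ-∑ (sgn J) I (λ n → δᴺ n (m +ₛ J))))
    (cong (sgn J *_) (∑-cong I (λ n → sym (ℤP.*-identityʳ _))))))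

-- The box polynomial

fpolyᵤ : ℕ → UPoly
fpolyᵤ zero = (+ 1 , + 0) ∷ []
fpolyᵤ (suc k) = (+ 1 , + suc k) ∷ (- + 1 , + k) ∷ []

0ᵥ≡0·eᶻ : ∀ (i : Fin p) → 0ᵥ ≡ (+ 0) ·eᶻ i
0ᵥ≡0·eᶻ i = lookup-ext λ j → trans (lookup-0ᵥ j) (sym (trans (VP.lookup∘tabulate _ j) (if-same (does (j ≟ᶠ i)))))
  where
  if-same : ∀ b → (if b then + 0 else + 0) ≡ + 0
  if-same true = refl
  if-same false = refl

fpoly≈inVar : ∀ k (i : Fin p) → fpoly k i ≈ₚ inVar i (fpolyᵤ k)
fpoly≈inVar zero i m = cong (λ x → (if x ≟ᶻ m then + 1 else + 0) + + 0) (0ᵥ≡0·eᶻ i)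
fpoly≈inVar (suc k) i m = refl

ucoeff-fpolyᵤ-ℕ : ∀ k j → ucoeff (fpolyᵤ k) (+ j) ≡ μᴺ₁ j k
ucoeff-fpolyᵤ-ℕ zero zero = refl
ucoeff-fpolyᵤ-ℕ zero (suc j) = refl
ucoeff-fpolyᵤ-ℕ (suc k) j with suc k ≡ᵇ j | k ≡ᵇ j
... | true | true = refl
... | true | false = refl
... | false | true = refl
... | false | false = refl

ucoeff-fpolyᵤ-neg : ∀ k j → ucoeff (fpolyᵤ k) -[1+ j ] ≡ + 0
ucoeff-fpolyᵤ-neg zero j = refl
ucoeff-fpolyᵤ-neg (suc k) j = refl

coeff-Box-term : ∀ (n : Pt p) m → coeff (prodₚ (allFin p) (λ i → fpoly (lookup n i) i)) m ≡
  ∏ (λ i → ucoeff (fpolyᵤ (lookup n i)) (lookup m i))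
coeff-Box-term n m rewrite prodₚ-allFin (λ i → fpoly (lookup n i) i) =
  coeff-∏ₚ-inVar _ (λ i → fpolyᵤ (lookup n i)) (λ i → fpoly≈inVar (lookup n i) i) m

Box-HasCoefficients : ∀ (I : List (Pt p)) → Box I HasCoefficients altCount I
Box-HasCoefficients I = record
  { at-ℕᵖ = λ m → begin
      coeff (Box I) (toZ m)
        ≡⟨ coeff-sumₚ I _ (toZ m) ⟩
      ∑ I (λ n → coeff (prodₚ (allFin _) (λ i → fpoly (lookup n i) i)) (toZ m))
        ≡⟨ ∑-cong I (λ n → trans (coeff-Box-term n (toZ m)) (∏-cong (λ i →
             trans (cong (ucoeff (fpolyᵤ (lookup n i))) (lookup-toZ m i)) (ucoeff-fpolyᵤ-ℕ (lookup n i) (lookup m i))))) ⟩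
      ∑ I (λ n → ∏ (λ i → μᴺ₁ (lookup m i) (lookup n i)))
        ≡⟨ ∑-cong I (λ n → sym (μᴺ≡∏ m n)) ⟩
      ∑ I (μᴺ m)
        ≡⟨ ∑-μᴺ I m ⟩
      altCount I m ∎
  ; at-negative = λ { m (i , j , mᵢ<0) → trans (coeff-sumₚ I _ m) (∑-zero I _ (λ n _ →
      trans (coeff-Box-term n m) (∏-zero _ i (trans (cong (ucoeff (fpolyᵤ (lookup n i))) mᵢ<0) (ucoeff-fpolyᵤ-neg (lookup n i) j))))) }
  }

-- The Möbius polynomial

≤ᵇ-suc : ∀ a c → (suc a ≤ᵇ suc c) ≡ (a ≤ᵇ c)
≤ᵇ-suc zero c = refl
≤ᵇ-suc (suc a) c = refl

χ≤ᵇ-difference : ∀ a c → χ (a ≤ᵇ c) - χ (suc a ≤ᵇ c) ≡ χ (a ≡ᵇ c)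
χ≤ᵇ-difference zero zero = refl
χ≤ᵇ-difference zero (suc c) = refl
χ≤ᵇ-difference (suc a) zero = refl
χ≤ᵇ-difference (suc a) (suc c) rewrite ≤ᵇ-suc a c | ≤ᵇ-suc (suc a) c = χ≤ᵇ-difference a c

μᴺ-refl : ∀ (y : Pt p) → μᴺ y y ≡ + 1
μᴺ-refl y = trans (μᴺ≡∏ y y) (∏-one _ (λ i → μᴺ₁-refl (lookup y i)))
  where
  μᴺ₁-refl : ∀ a → μᴺ₁ a a ≡ + 1
  μᴺ₁-refl zero = refl
  μᴺ₁-refl (suc a) = μᴺ₁-refl a

μᴺ-≰ : ∀ (x y : Pt p) → x ≤ᵥ y ≡ false → μᴺ x y ≡ + 0
μᴺ-≰ x y x≰y with i , xᵢ≰yᵢ ← allᶠ-false⇒ _ (trans (sym (≤ᵥ≡allᶠ x y)) x≰y) =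
  trans (μᴺ≡∏ x y) (∏-zero _ i (μᴺ₁-≰ (lookup x i) (lookup y i)
    (λ le → false≢true (trans (sym xᵢ≰yᵢ) (dec-true (_ ℕ.≤? _) le)))))
  where
  μᴺ₁-≰ : ∀ a c → ¬ a ≤ c → μᴺ₁ a c ≡ + 0
  μᴺ₁-≰ a c a≰c = cong₂ (λ u v → χ u - χ v)
    (dec-false (c ℕ.≟ a) (λ { refl → a≰c ℕP.≤-refl }))
    (dec-false (c ℕ.≟ suc a) (λ { refl → a≰c (ℕP.n≤1+n a) }))

μᴺ≡χ≤ᵥ* : ∀ (x y : Pt p) → μᴺ x y ≡ χ (x ≤ᵥ y) * μᴺ x y
μᴺ≡χ≤ᵥ* x y with x ≤ᵥ y in x≤y
... | true = sym (ℤP.*-identityˡ _)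
... | false = μᴺ-≰ x y x≤y

∑-sgn-≤ᵥ : ∀ (x y : Pt p) → ∑ (allSubsets p) (λ J → sgn J * χ ((x +ₛ J) ≤ᵥ y)) ≡ δᴺ x y
∑-sgn-≤ᵥ {p} x y = begin
  ∑ (allSubsets p) (λ J → sgn J * χ ((x +ₛ J) ≤ᵥ y))
    ≡⟨ ∑-cong (allSubsets p) (λ J → cong (sgn J *_) (trans (cong χ (≤ᵥ≡allᶠ (x +ₛ J) y))
         (trans (χ-allᶠ (λ i → lookup (x +ₛ J) i ≤ᵇ lookup y i)) (∏-cong (λ i → cong (λ a → χ (a ≤ᵇ lookup y i)) (lookup-+ₛ x J i)))))) ⟩
  ∑ (allSubsets p) (λ J → sgn J * ∏ (λ i → χ ((if lookup J i then suc (lookup x i) else lookup x i) ≤ᵇ lookup y i)))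
    ≡⟨ ∑-allSubsets-sgn-∏ (λ i b → χ ((if b then suc (lookup x i) else lookup x i) ≤ᵇ lookup y i)) ⟩
  ∏ (λ i → χ (lookup x i ≤ᵇ lookup y i) - χ (suc (lookup x i) ≤ᵇ lookup y i))
    ≡⟨ ∏-cong (λ i → χ≤ᵇ-difference (lookup x i) (lookup y i)) ⟩
  ∏ (λ i → χ (lookup x i ≡ᵇ lookup y i))
    ≡⟨ sym (δᴺ≡∏ x y) ⟩
  δᴺ x y ∎

below : Pt p → Pt p → Pt p → Bool
below x y z = (x ≤ᵥ z) ∧ (z ≤ᵥ y) ∧ not (z ≟ᴺ y)

module _ {I : List (Pt p)} (unique : Unique I) (down : DownClosed I) where

  multiplicity-∈ : ∀ {x} → x ∈ I → multiplicity I x ≡ + 1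
  multiplicity-∈ x∈ = ∑-δ-∈ (λ _ → + 1) unique x∈

  multiplicity*χ≤∧≢ : ∀ w y → y ∈ I → multiplicity I w * χ ((w ≤ᵥ y) ∧ not (w ≟ᴺ y)) ≡ χ (w ≤ᵥ y) - δᴺ w y
  multiplicity*χ≤∧≢ w y y∈ with w ≤ᵥ y in w≤y
  ... | true = begin
    multiplicity I w * χ (not (w ≟ᴺ y))  ≡⟨ cong (_* χ (not (w ≟ᴺ y))) (multiplicity-∈ (down (≤ᵥ⇒≤ᴾ w y w≤y) y∈)) ⟩
    + 1 * χ (not (w ≟ᴺ y))               ≡⟨ ℤP.*-identityˡ _ ⟩
    χ (not (w ≟ᴺ y))                     ≡⟨ χ-not (w ≟ᴺ y) ⟩
    + 1 - δᴺ w y                         ∎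
  ... | false = begin
    multiplicity I w * + 0  ≡⟨ ℤP.*-zeroʳ (multiplicity I w) ⟩
    + 0                     ≡⟨ cong (λ d → + 0 - d) (sym (δ-≢ w≢y)) ⟩
    + 0 - δᴺ w y            ∎
    where
    w≢y : w ≢ y
    w≢y refl with () ← trans (sym w≤y) (≤ᴾ⇒≤ᵥ w w (λ i → ℕP.≤-refl))

  multiplicity*below : ∀ x {w} y → y ∈ I → x ≤ᴾ w → multiplicity I w * χ (below x y w) ≡ χ (w ≤ᵥ y) - δᴺ w y
  multiplicity*below x {w} y y∈ x≤w =
    trans (cong (λ b → multiplicity I w * χ (b ∧ (w ≤ᵥ y) ∧ not (w ≟ᴺ y))) (≤ᴾ⇒≤ᵥ x w x≤w)) (multiplicity*χ≤∧≢ w y y∈)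

  -- μᴺ satisfies the recursion defining μ_P(x, y): every x + e_J ≤ y lies in I since I is down-closed.
  ∑-below-μᴺ : ∀ {x y} → y ∈ I → x ≢ y → ∑ I (λ z → χ (below x y z) * μᴺ x z) ≡ - μᴺ x y
  ∑-below-μᴺ {x} {y} y∈ x≢y = begin
    ∑ I (λ z → χ (below x y z) * ∑ (allSubsets p) (λ J → sgn J * δᴺ z (x +ₛ J)))
      ≡⟨ ∑-cong I (λ z → *-distribˡ-∑ (χ (below x y z)) (allSubsets p) _) ⟩
    ∑ I (λ z → ∑ (allSubsets p) (λ J → χ (below x y z) * (sgn J * δᴺ z (x +ₛ J))))
      ≡⟨ ∑-comm I (allSubsets p) _ ⟩
    ∑ (allSubsets p) (λ J → ∑ I (λ z → χ (below x y z) * (sgn J * δᴺ z (x +ₛ J))))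
      ≡⟨ ∑-cong (allSubsets p) (λ J → localise (x +ₛ J) (sgn J)) ⟩
    ∑ (allSubsets p) (λ J → sgn J * (multiplicity I (x +ₛ J) * χ (below x y (x +ₛ J))))
      ≡⟨ ∑-cong (allSubsets p) (λ J → cong (sgn J *_) (multiplicity*below x y y∈ (x≤x+ₛJ x J))) ⟩
    ∑ (allSubsets p) (λ J → sgn J * (χ ((x +ₛ J) ≤ᵥ y) - δᴺ (x +ₛ J) y))
      ≡⟨ ∑-cong (allSubsets p) (λ J → trans (ℤP.*-distribˡ-+ (sgn J) _ _)
           (cong (_+_ (sgn J * χ ((x +ₛ J) ≤ᵥ y))) (trans (sym (ℤP.neg-distribʳ-* (sgn J) _)) (cong (λ d → - (sgn J * d)) (δ-sym (x +ₛ J) y))))) ⟩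
    ∑ (allSubsets p) (λ J → sgn J * χ ((x +ₛ J) ≤ᵥ y) + - (sgn J * δᴺ y (x +ₛ J)))
      ≡⟨ ∑-distrib-+ (allSubsets p) _ _ ⟩
    ∑ (allSubsets p) (λ J → sgn J * χ ((x +ₛ J) ≤ᵥ y)) + ∑ (allSubsets p) (λ J → - (sgn J * δᴺ y (x +ₛ J)))
      ≡⟨ cong₂ _+_ (trans (∑-sgn-≤ᵥ x y) (δ-≢ x≢y)) (sym (neg-distrib-∑ (allSubsets p) _)) ⟩
    + 0 + - μᴺ x y
      ≡⟨ ℤP.+-identityˡ _ ⟩
    - μᴺ x y ∎
    where
    localise : ∀ w s → ∑ I (λ z → χ (below x y z) * (s * δᴺ z w)) ≡ s * (multiplicity I w * χ (below x y w))
    localise w s = begin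
      ∑ I (λ z → χ (below x y z) * (s * δᴺ z w))  ≡⟨ ∑-cong I (λ z → rearrange (χ (below x y z)) s (δᴺ z w)) ⟩
      ∑ I (λ z → s * (δᴺ z w * χ (below x y z)))  ≡⟨ ∑-cong I (λ z → cong (s *_) (δ-subst z w (λ v → χ (below x y v)))) ⟩
      ∑ I (λ z → s * (δᴺ z w * χ (below x y w)))  ≡⟨ sym (*-distribˡ-∑ s I _) ⟩
      s * ∑ I (λ z → δᴺ z w * χ (below x y w))    ≡⟨ cong (s *_) (trans (∑-cong I (λ z → cong (δᴺ z w *_) (sym (ℤP.*-identityˡ _))))
                                                       (trans (∑-cong I (λ z → sym (ℤP.*-assoc (δᴺ z w) (+ 1) _)))
                                                         (sym (*-distribʳ-∑ (χ (below x y w)) I (λ z → δᴺ z w * + 1))))) ⟩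
      s * (multiplicity I w * χ (below x y w))    ∎
      where
      rearrange : ∀ a b c → a * (b * c) ≡ b * (c * a)
      rearrange a b c = trans (ℤP.*-comm a (b * c)) (ℤP.*-assoc b c a)

  μfuel≡μᴺ : ∀ f x {y} → y ∈ I → ∣ y ∣ᵥ < f → μfuel I f x y ≡ μᴺ x y
  μfuel≡μᴺ (suc f) x {y} y∈ (s≤s |y|≤f) with x ≟ᴺ y in x≟y
  ... | true rewrite ≟ᴺ⇒≡ x y x≟y = sym (μᴺ-refl y)
  ... | false with x ≤ᵥ y in x≤y
  ... | false = sym (μᴺ-≰ x y x≤y)
  ... | true = begin
    - ∑ (filterᵇ (below x y) I) (μfuel I f x)             ≡⟨ cong -_ (∑-filterᵇ (below x y) I _) ⟩
    - ∑ I (λ z → χ (below x y z) * μfuel I f x z)         ≡⟨ cong -_ (∑-cong-∈ I recurse) ⟩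
    - ∑ I (λ z → χ (below x y z) * μᴺ x z)            ≡⟨ cong -_ (∑-below-μᴺ y∈ x≢y) ⟩
    - - μᴺ x y                                        ≡⟨ ℤP.neg-involutive _ ⟩
    μᴺ x y                                            ∎
    where
    x≢y : x ≢ y
    x≢y x≡y = false≢true (trans (sym x≟y) (≡⇒≟ᴺ x y x≡y))
    recurse : ∀ z → z ∈ I → χ (below x y z) * μfuel I f x z ≡ χ (below x y z) * μᴺ x z
    recurse z z∈ with below x y z in b
    ... | false = refl
    ... | true = cong (+ 1 *_) (μfuel≡μᴺ f x z∈ (ℕP.<-≤-trans (∣∣-mono-< z y z≤y z≢y) |y|≤f))
      where
      z≤y : z ≤ᴾ y
      z≤y = ≤ᵥ⇒≤ᴾ z y (∧-conicalˡ (z ≤ᵥ y) _ (∧-conicalʳ (x ≤ᵥ z) _ b))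
      z≢y : z ≢ y
      z≢y z≡y = false≢true (trans (sym (not-true⇒ (∧-conicalʳ (z ≤ᵥ y) _ (∧-conicalʳ (x ≤ᵥ z) _ b)))) (≡⇒≟ᴺ z y z≡y))

  μ𝒫≡altCount : ∀ n → μ𝒫 I n ≡ altCount I n
  μ𝒫≡altCount n = begin
    - - ∑ (filterᵇ (n ≤ᵥ_) I) (μP I n)          ≡⟨ ℤP.neg-involutive _ ⟩
    ∑ (filterᵇ (n ≤ᵥ_) I) (μP I n)              ≡⟨ ∑-filterᵇ (n ≤ᵥ_) I (μP I n) ⟩
    ∑ I (λ z → χ (n ≤ᵥ z) * μP I n z)
      ≡⟨ ∑-cong-∈ I (λ z z∈ → cong (χ (n ≤ᵥ z) *_) (μfuel≡μᴺ (suc ∣ z ∣ᵥ) n z∈ ℕP.≤-refl)) ⟩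
    ∑ I (λ z → χ (n ≤ᵥ z) * μᴺ n z)         ≡⟨ ∑-cong I (λ z → sym (μᴺ≡χ≤ᵥ* n z)) ⟩
    ∑ I (μᴺ n)                              ≡⟨ ∑-μᴺ I n ⟩
    altCount I n                                ∎

  Möb-HasCoefficients : Möb I HasCoefficients altCount I
  Möb-HasCoefficients = sumₚ-mono-HasCoefficients (μ𝒫 I) (altCount I) unique (λ n _ → μ𝒫≡altCount n) (altCount-∉ down)

-- Exchanges and lexicographic orders

∈ᵇ⇒∈ᶻ : ∀ (x : PtZ p) V → x ∈ᵇ V ≡ true → x ∈ᶻ V
∈ᵇ⇒∈ᶻ x V e with u , u∈ , eq ← any-true⇒ (λ u → toZ u ≟ᶻ x) V e = u , u∈ , ≟ᶻ⇒≡ (toZ u) x eq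

∈ᶻ⇒∈ᵇ : ∀ (x : PtZ p) V → x ∈ᶻ V → x ∈ᵇ V ≡ true
∈ᶻ⇒∈ᵇ x V (u , u∈ , eq) = any-true⇐ (λ u → toZ u ≟ᶻ x) u u∈ (≡⇒≟ᶻ (toZ u) x eq)

exchange : Pt p → Fin p → Fin p → PtZ p
exchange u a b = (toZ u -ᵥ e a) +ᵥ e b

record IsExchange (v u : Pt p) (a b : Fin p) : Set where
  field
    at-source : suc (lookup v a) ≡ lookup u a
    at-target : lookup v b ≡ suc (lookup u b)
    elsewhere : ∀ t → t ≢ a → t ≢ b → lookup v t ≡ lookup u t

lookup-e : ∀ (i t : Fin p) → lookup (e i) t ≡ χ (does (t ≟ᶠ i))
lookup-e i t = trans (VP.lookup∘tabulate _ t) (if-1-0 (does (t ≟ᶠ i)))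
  where
  if-1-0 : ∀ b → (if b then + 1 else + 0) ≡ χ b
  if-1-0 true = refl
  if-1-0 false = refl

lookup-exchange : ∀ (u : Pt p) a b t →
  lookup (exchange u a b) t ≡ (+ lookup u t - χ (does (t ≟ᶠ a))) + χ (does (t ≟ᶠ b))
lookup-exchange u a b t = trans (lookup-+ᵥ (toZ u -ᵥ e a) (e b) t)
  (cong₂ _+_ (trans (lookup--ᵥ (toZ u) (e a) t) (cong₂ _-_ (lookup-toZ u t) (lookup-e a t))) (lookup-e b t))

toZ≡exchange⇒IsExchange : ∀ {v u : Pt p} {a b} → a ≢ b → toZ v ≡ exchange u a b → IsExchange v u a b
toZ≡exchange⇒IsExchange {v = v} {u} {a} {b} a≢b eq = record
  { at-source = ℤP.+-injective (trans (ℤP.pos-+ 1 _) (trans (cong (_+_ (+ 1)) (coordinate a))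
      (trans (cong₂ (λ x y → + 1 + ((+ lookup u a - χ x) + χ y)) (dec-true (a ≟ᶠ a) refl) (dec-false (a ≟ᶠ b) a≢b)) (add-sub (+ lookup u a)))))
  ; at-target = ℤP.+-injective (trans (coordinate b)
      (trans (cong₂ (λ x y → (+ lookup u b - χ x) + χ y) (dec-false (b ≟ᶠ a) (a≢b ∘ sym)) (dec-true (b ≟ᶠ b) refl)) (sub0-add (+ lookup u b))))
  ; elsewhere = λ t t≢a t≢b → ℤP.+-injective (trans (coordinate t)
      (trans (cong₂ (λ x y → (+ lookup u t - χ x) + χ y) (dec-false (t ≟ᶠ a) t≢a) (dec-false (t ≟ᶠ b) t≢b)) (sub0-add0 (+ lookup u t))))
  }
  where
  coordinate : ∀ t → + lookup v t ≡ (+ lookup u t - χ (does (t ≟ᶠ a))) + χ (does (t ≟ᶠ b))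
  coordinate t = trans (sym (lookup-toZ v t)) (trans (cong (λ z → lookup z t) eq) (lookup-exchange u a b t))
  add-sub : ∀ x → + 1 + ((x - + 1) + + 0) ≡ x
  add-sub = solve-∀
  sub0-add : ∀ x → (x - + 0) + + 1 ≡ + 1 + x
  sub0-add = solve-∀
  sub0-add0 : ∀ x → (x - + 0) + + 0 ≡ x
  sub0-add0 = solve-∀

IsExchange⇒toZ≡exchange : ∀ {v u : Pt p} {a b} → a ≢ b → IsExchange v u a b → toZ v ≡ exchange u a b
IsExchange⇒toZ≡exchange {v = v} {u} {a} {b} a≢b X = lookup-ext λ t →
  trans (lookup-toZ v t) (trans (coordinate t) (sym (lookup-exchange u a b t)))
  where
  open IsExchange X
  sub-cancel : ∀ x → x ≡ ((+ 1 + x) - + 1) + + 0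
  sub-cancel = solve-∀
  add-sub0 : ∀ x → + 1 + x ≡ (x - + 0) + + 1
  add-sub0 = solve-∀
  sub0-add0 : ∀ x → (x - + 0) + + 0 ≡ x
  sub0-add0 = solve-∀
  coordinate : ∀ t → + lookup v t ≡ (+ lookup u t - χ (does (t ≟ᶠ a))) + χ (does (t ≟ᶠ b))
  coordinate t with t ≟ᶠ a | t ≟ᶠ b
  ... | yes refl | yes refl = ⊥-elim (a≢b refl)
  ... | yes refl | no _ = trans (sub-cancel (+ lookup v t)) (cong (λ c → (+ c - + 1) + + 0) at-source)
  ... | no _ | yes refl = trans (cong +_ at-target) (trans (ℤP.pos-+ 1 (lookup u t)) (add-sub0 (+ lookup u t)))
  ... | no t≢a | no t≢b = trans (cong +_ (elsewhere t t≢a t≢b)) (sym (sub0-add0 (+ lookup u t)))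

module _ {P : List (Pt p)} (mconvex : MConvex P) where

  exchange-axiom : ∀ {u v} → u ∈ P → v ∈ P → ∀ i → lookup v i < lookup u i →
    ∃ λ j → lookup u j < lookup v j × i ≢ j × ∃ λ w → w ∈ P × IsExchange w u i j
  exchange-axiom u∈ v∈ i vᵢ<uᵢ with j , uⱼ<vⱼ , w , w∈ , eq ← mconvex _ _ u∈ v∈ i vᵢ<uᵢ =
    j , uⱼ<vⱼ , i≢j , w , w∈ , toZ≡exchange⇒IsExchange i≢j eq
    where
    i≢j : i ≢ j
    i≢j refl = ℕP.<-asym vᵢ<uᵢ uⱼ<vⱼ

inL⇒ : ∀ (V : List (Pt p)) u ℓ → inL V u ℓ ≡ true → ∃ λ j → ℓ ≢ j × ∃ λ w → w ∈ V × IsExchange w u ℓ j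
inL⇒ V u ℓ e with j , _ , j∈L ← any-true⇒ _ (allFin _) e with j ≟ᶠ ℓ
... | no j≢ℓ with w , w∈ , eq ← ∈ᵇ⇒∈ᶻ _ V j∈L = j , j≢ℓ ∘ sym , w , w∈ , toZ≡exchange⇒IsExchange (j≢ℓ ∘ sym) eq

inL⇐ : ∀ (V : List (Pt p)) {u ℓ j w} → ℓ ≢ j → w ∈ V → IsExchange w u ℓ j → inL V u ℓ ≡ true
inL⇐ V {j = j} {w} ℓ≢j w∈ X = any-true⇐ _ j (∈-allFin j)
  (cong₂ _∧_ (cong not (dec-false (j ≟ᶠ _) (ℓ≢j ∘ sym))) (∈ᶻ⇒∈ᵇ _ V (w , w∈ , IsExchange⇒toZ≡exchange ℓ≢j X)))

LexAt : Vec ℕ q → Vec ℕ q → Fin q → Set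
LexAt a b k = (∀ k′ → toℕ k′ < toℕ k → lookup a k′ ≡ lookup b k′) × lookup a k < lookup b k

lexLt⇒LexAt : ∀ (a b : Vec ℕ q) → lexLt a b ≡ true → ∃ (LexAt a b)
lexLt⇒LexAt [] [] ()
lexLt⇒LexAt (x ∷ xs) (y ∷ ys) e with x <ᵇ y in x<y
... | true = fz , (λ _ ()) , does-true⇒ (x ℕ.<? y) x<y
... | false with x ≡ᵇ y in x≡y
... | true with k , agree , lt ← lexLt⇒LexAt xs ys e = fs k , agree′ , lt
  where
  agree′ : ∀ k′ → toℕ k′ < toℕ (fs k) → lookup (x ∷ xs) k′ ≡ lookup (y ∷ ys) k′
  agree′ fz _ = does-true⇒ (x ℕ.≟ y) x≡y
  agree′ (fs k′) (s≤s k′<k) = agree k′ k′<k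

LexAt⇒lexLt : ∀ (a b : Vec ℕ q) k → LexAt a b k → lexLt a b ≡ true
LexAt⇒lexLt (x ∷ xs) (y ∷ ys) fz (_ , x<y) rewrite dec-true (x ℕ.<? y) x<y = refl
LexAt⇒lexLt (x ∷ xs) (y ∷ ys) (fs k) (agree , lt)
  rewrite dec-false (x ℕ.<? y) (ℕP.<-irrefl (agree fz (s≤s z≤n)))
        | dec-true (x ℕ.≟ y) (agree fz (s≤s z≤n))
  = LexAt⇒lexLt xs ys k ((λ k′ k′<k → agree (fs k′) (s≤s k′<k)) , lt)

lexLt-irrefl : ∀ (a : Vec ℕ q) → lexLt a a ≡ false
lexLt-irrefl [] = refl
lexLt-irrefl (x ∷ xs) rewrite dec-false (x ℕ.<? x) (ℕP.<-irrefl refl) | dec-true (x ℕ.≟ x) refl = lexLt-irrefl xs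

lexLt-trans : ∀ (a b c : Vec ℕ q) → lexLt a b ≡ true → lexLt b c ≡ true → lexLt a c ≡ true
lexLt-trans a b c a<b b<c with k₁ , agree₁ , lt₁ ← lexLt⇒LexAt a b a<b | k₂ , agree₂ , lt₂ ← lexLt⇒LexAt b c b<c
  with ℕP.<-cmp (toℕ k₁) (toℕ k₂)
... | tri< k₁<k₂ _ _ = LexAt⇒lexLt a c k₁
  ( (λ k′ k′<k₁ → trans (agree₁ k′ k′<k₁) (agree₂ k′ (ℕP.<-trans k′<k₁ k₁<k₂)))
  , ℕP.<-≤-trans lt₁ (ℕP.≤-reflexive (agree₂ k₁ k₁<k₂)))
... | tri> _ _ k₂<k₁ = LexAt⇒lexLt a c k₂
  ( (λ k′ k′<k₂ → trans (agree₁ k′ (ℕP.<-trans k′<k₂ k₂<k₁)) (agree₂ k′ k′<k₂))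
  , ℕP.≤-<-trans (ℕP.≤-reflexive (agree₁ k₂ k₂<k₁)) lt₂)
... | tri≈ _ k₁≡k₂ _ rewrite FP.toℕ-injective k₁≡k₂ = LexAt⇒lexLt a c k₂
  ((λ k′ k′<k → trans (agree₁ k′ k′<k) (agree₂ k′ k′<k)) , ℕP.<-trans lt₁ lt₂)

lexLt-total : ∀ (a b : Vec ℕ q) → a ≢ b → (lexLt a b ≡ true) ⊎ (lexLt b a ≡ true)
lexLt-total [] [] a≢b = ⊥-elim (a≢b refl)
lexLt-total (x ∷ xs) (y ∷ ys) a≢b with ℕP.<-cmp x y
... | tri< x<y _ _ rewrite dec-true (x ℕ.<? y) x<y = inj₁ refl
... | tri> _ _ y<x rewrite dec-true (y ℕ.<? x) y<x = inj₂ refl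
... | tri≈ _ refl _ rewrite dec-false (x ℕ.<? x) (ℕP.<-irrefl refl) | dec-true (x ℕ.≟ x) refl =
  lexLt-total xs ys (λ xs≡ys → a≢b (cong (x ∷_) xs≡ys))

permute : Permutation′ p → Pt p → Pt p
permute σ a = tabulate (λ k → lookup a (σ ⟨$⟩ʳ k))

module _ (σ : Permutation′ p) where

  lookup-permute : ∀ a k → lookup (permute σ a) k ≡ lookup a (σ ⟨$⟩ʳ k)
  lookup-permute a k = VP.lookup∘tabulate _ k

  ⟨$⟩ʳ-injective : ∀ {k k′} → σ ⟨$⟩ʳ k ≡ σ ⟨$⟩ʳ k′ → k ≡ k′
  ⟨$⟩ʳ-injective eq = trans (sym (Perm.inverseˡ σ)) (trans (cong (σ ⟨$⟩ˡ_) eq) (Perm.inverseˡ σ))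

  permute-injective : ∀ {a b} → permute σ a ≡ permute σ b → a ≡ b
  permute-injective {a} {b} eq = lookup-ext λ i → begin
    lookup a i                             ≡⟨ cong (lookup a) (sym (Perm.inverseʳ σ)) ⟩
    lookup a (σ ⟨$⟩ʳ (σ ⟨$⟩ˡ i))            ≡⟨ sym (lookup-permute a (σ ⟨$⟩ˡ i)) ⟩
    lookup (permute σ a) (σ ⟨$⟩ˡ i)         ≡⟨ cong (λ v → lookup v (σ ⟨$⟩ˡ i)) eq ⟩
    lookup (permute σ b) (σ ⟨$⟩ˡ i)         ≡⟨ lookup-permute b (σ ⟨$⟩ˡ i) ⟩
    lookup b (σ ⟨$⟩ʳ (σ ⟨$⟩ˡ i))            ≡⟨ cong (lookup b) (Perm.inverseʳ σ) ⟩
    lookup b i                             ∎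

  lexLtσ-irrefl : ∀ a → lexLtσ σ a a ≡ false
  lexLtσ-irrefl a = lexLt-irrefl (permute σ a)

  lexLtσ-trans : ∀ a b c → lexLtσ σ a b ≡ true → lexLtσ σ b c ≡ true → lexLtσ σ a c ≡ true
  lexLtσ-trans a b c = lexLt-trans (permute σ a) (permute σ b) (permute σ c)

  lexLtσ-total : ∀ a b → a ≢ b → (lexLtσ σ a b ≡ true) ⊎ (lexLtσ σ b a ≡ true)
  lexLtσ-total a b a≢b = lexLt-total (permute σ a) (permute σ b) (λ eq → a≢b (permute-injective eq))

module _ {A : Set} (_≟_ : DecidableEquality A) (_≺_ : A → A → Bool)
         (≺-trans : ∀ a b c → a ≺ b ≡ true → b ≺ c ≡ true → a ≺ c ≡ true)
         (≺-total : ∀ a b → a ≢ b → (a ≺ b ≡ true) ⊎ (b ≺ a ≡ true)) where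

  IsLeast : (A → Bool) → List A → A → Set
  IsLeast q xs m = m ∈ xs × q m ≡ true × (∀ v → v ∈ xs → q v ≡ true → v ≡ m ⊎ m ≺ v ≡ true)

  least : ∀ (q : A → Bool) xs → any q xs ≡ true → ∃ (IsLeast q xs)
  least q (x ∷ xs) e with any q xs in any-xs
  ... | false = x , here refl , qx , minimal
    where
    qx : q x ≡ true
    qx = trans (sym (∨-identityʳ (q x))) e
    minimal : ∀ v → v ∈ x ∷ xs → q v ≡ true → v ≡ x ⊎ x ≺ v ≡ true
    minimal v (here refl) _ = inj₁ refl
    minimal v (there v∈) qv = ⊥-elim (false≢true (trans (sym (any-false⇒ q any-xs v v∈)) qv))
  ... | true with m , m∈ , qm , m-least ← least q xs any-xs with q x in qx
  ... | false = m , there m∈ , qm , minimal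
    where
    minimal : ∀ v → v ∈ x ∷ xs → q v ≡ true → v ≡ m ⊎ m ≺ v ≡ true
    minimal v (here refl) qv = ⊥-elim (false≢true (trans (sym qx) qv))
    minimal v (there v∈) qv = m-least v v∈ qv
  ... | true with x ≟ m
  ... | yes refl = m , there m∈ , qm , minimal
    where
    minimal : ∀ v → v ∈ x ∷ xs → q v ≡ true → v ≡ m ⊎ m ≺ v ≡ true
    minimal v (here refl) _ = inj₁ refl
    minimal v (there v∈) qv = m-least v v∈ qv
  ... | no x≢m with ≺-total x m x≢m
  ... | inj₁ x≺m = x , here refl , qx , minimal
    where
    minimal : ∀ v → v ∈ x ∷ xs → q v ≡ true → v ≡ x ⊎ x ≺ v ≡ true
    minimal v (here refl) _ = inj₁ refl
    minimal v (there v∈) qv with m-least v v∈ qv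
    ... | inj₁ refl = inj₂ x≺m
    ... | inj₂ m≺v = inj₂ (≺-trans x m v x≺m m≺v)
  ... | inj₂ m≺x = m , there m∈ , qm , minimal
    where
    minimal : ∀ v → v ∈ x ∷ xs → q v ≡ true → v ≡ m ⊎ m ≺ v ≡ true
    minimal v (here refl) _ = inj₂ m≺x
    minimal v (there v∈) qv = m-least v v∈ qv

-- Stalactites

earlier : Permutation′ p → List (Pt p) → Pt p → List (Pt p)
earlier σ P u = filterᵇ (λ v → lexLtσ σ v u) P

Lσ : Permutation′ p → List (Pt p) → Pt p → Fin p → Bool
Lσ σ P u = inL (earlier σ P u) u

module _ (σ : Permutation′ p) where

  exchange-precedes : ∀ {u v w k j} → LexAt (permute σ v) (permute σ u) k →
    IsExchange w u (σ ⟨$⟩ʳ k) j → lookup u j < lookup v j → lexLtσ σ w u ≡ true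
  exchange-precedes {u} {v} {w} {k} {j} (agree , _) X uⱼ<vⱼ = LexAt⇒lexLt (permute σ w) (permute σ u) k (agree′ , wᵢ<uᵢ)
    where
    open IsExchange X
    wᵢ<uᵢ : lookup (permute σ w) k < lookup (permute σ u) k
    wᵢ<uᵢ rewrite lookup-permute σ w k | lookup-permute σ u k = ℕP.≤-reflexive at-source
    agree′ : ∀ k′ → toℕ k′ < toℕ k → lookup (permute σ w) k′ ≡ lookup (permute σ u) k′
    agree′ k′ k′<k rewrite lookup-permute σ w k′ | lookup-permute σ u k′ = elsewhere (σ ⟨$⟩ʳ k′) t≢i t≢j
      where
      t≢i : σ ⟨$⟩ʳ k′ ≢ σ ⟨$⟩ʳ k
      t≢i eq = ℕP.<-irrefl (cong toℕ (⟨$⟩ʳ-injective σ eq)) k′<k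
      t≢j : σ ⟨$⟩ʳ k′ ≢ j
      t≢j refl = ℕP.<-irrefl (trans (sym (lookup-permute σ u k′)) (trans (sym (agree k′ k′<k)) (lookup-permute σ v k′))) uⱼ<vⱼ

  module _ {P : List (Pt p)} where

    dominated-by-earlier⇐ : ∀ {u y ℓ} → Lσ σ P u ℓ ≡ true → y ≤ᴾ u → lookup y ℓ < lookup u ℓ →
      ∃ λ v → v ∈ earlier σ P u × y ≤ᴾ v
    dominated-by-earlier⇐ {u} {y} {ℓ} ℓ∈L y≤u yℓ<uℓ with j , ℓ≢j , w , w∈ , X ← inL⇒ (earlier σ P u) u ℓ ℓ∈L = w , w∈ , y≤w
      where
      open IsExchange X
      y≤w : y ≤ᴾ w
      y≤w t with t ≟ᶠ ℓ | t ≟ᶠ j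
      ... | yes refl | _ = ℕP.≤-pred (subst (lookup y t <_) (sym at-source) yℓ<uℓ)
      ... | no _ | yes refl = subst (lookup y t ≤_) (sym at-target) (ℕP.m≤n⇒m≤1+n (y≤u t))
      ... | no t≢ℓ | no t≢j = subst (lookup y t ≤_) (sym (elsewhere t t≢ℓ t≢j)) (y≤u t)

    dominated-by-earlier⇒ : MConvex P → ∀ {u v y} → u ∈ P → v ∈ earlier σ P u → y ≤ᴾ v →
      ∃ λ ℓ → Lσ σ P u ℓ ≡ true × lookup y ℓ < lookup u ℓ
    dominated-by-earlier⇒ mconvex {u} {v} {y} u∈ v∈ y≤v
      with v∈P , v≺u ← ∈-filterᵇ⁻ (λ v → lexLtσ σ v u) v∈
      with k , agree , lt ← lexLt⇒LexAt (permute σ v) (permute σ u) v≺u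
      with j , uⱼ<vⱼ , i≢j , w , w∈P , X ←
             exchange-axiom mconvex u∈ v∈P (σ ⟨$⟩ʳ k) (subst₂ _<_ (lookup-permute σ v k) (lookup-permute σ u k) lt) =
      σ ⟨$⟩ʳ k ,
      inL⇐ (earlier σ P u) i≢j (∈-filterᵇ⁺ (λ v → lexLtσ σ v u) w∈P (exchange-precedes {v = v} (agree , lt) X uⱼ<vⱼ)) X ,
      ℕP.≤-<-trans (y≤v (σ ⟨$⟩ʳ k)) (subst₂ _<_ (lookup-permute σ v k) (lookup-permute σ u k) lt)

isFirstDominator : Permutation′ p → List (Pt p) → Pt p → Pt p → Bool
isFirstDominator σ P u y = (y ≤ᵥ u) ∧ not (any (y ≤ᵥ_) (earlier σ P u))

-- Coordinatewise data: l = [i ∈ L(u)], c = uᵢ, and a is the i-th coordinate of the point in question.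
stalCondition : Bool → ℕ → ℕ → Bool
stalCondition l c a = (a ≤ᵇ c) ∧ (not l ∨ (a ≡ᵇ c))

stalFactor : Bool → ℕ → ℕ → ℤ
stalFactor l c a = χ (a ≡ᵇ c) - χ l * χ (suc a ≡ᵇ c)

χ-stalCondition-difference : ∀ l c a → χ (stalCondition l c a) - χ (stalCondition l c (suc a)) ≡ stalFactor l c a
χ-stalCondition-difference false c a = begin
  χ ((a ≤ᵇ c) ∧ true) - χ ((suc a ≤ᵇ c) ∧ true)
    ≡⟨ cong₂ (λ x y → χ x - χ y) (∧-identityʳ (a ≤ᵇ c)) (∧-identityʳ (suc a ≤ᵇ c)) ⟩
  χ (a ≤ᵇ c) - χ (suc a ≤ᵇ c)                    ≡⟨ χ≤ᵇ-difference a c ⟩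
  χ (a ≡ᵇ c)                                     ≡⟨ sym (ℤP.+-identityʳ _) ⟩
  χ (a ≡ᵇ c) - + 0 * χ (suc a ≡ᵇ c)              ∎
χ-stalCondition-difference true c a = begin
  χ ((a ≤ᵇ c) ∧ (a ≡ᵇ c)) - χ ((suc a ≤ᵇ c) ∧ (suc a ≡ᵇ c))
    ≡⟨ cong₂ (λ x y → χ x - χ y) (≤ᵇ∧≡ᵇ a c) (≤ᵇ∧≡ᵇ (suc a) c) ⟩
  χ (a ≡ᵇ c) - χ (suc a ≡ᵇ c)                                ≡⟨ cong (λ z → χ (a ≡ᵇ c) - z) (sym (ℤP.*-identityˡ _)) ⟩
  χ (a ≡ᵇ c) - + 1 * χ (suc a ≡ᵇ c)                          ∎
  where
  ≤ᵇ∧≡ᵇ : ∀ a c → ((a ≤ᵇ c) ∧ (a ≡ᵇ c)) ≡ (a ≡ᵇ c)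
  ≤ᵇ∧≡ᵇ a c with a ≡ᵇ c in a≡c
  ... | true = trans (∧-identityʳ _) (dec-true (a ℕ.≤? c) (ℕP.≤-reflexive (does-true⇒ (a ℕ.≟ c) a≡c)))
  ... | false = ∧-zeroʳ (a ≤ᵇ c)

module _ (σ : Permutation′ p) {P : List (Pt p)} (mconvex : MConvex P) where

  isFirstDominator≡allᶠ : ∀ {u} y → u ∈ P →
    isFirstDominator σ P u y ≡ allᶠ (λ i → stalCondition (Lσ σ P u i) (lookup u i) (lookup y i))
  isFirstDominator≡allᶠ {u} y u∈ = bool-ext ⇒ ⇐
    where
    ⇒ : isFirstDominator σ P u y ≡ true → allᶠ (λ i → stalCondition (Lσ σ P u i) (lookup u i) (lookup y i)) ≡ true
    ⇒ first = allᶠ-true⇐ _ condition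
      where
      y≤u : y ≤ᴾ u
      y≤u = ≤ᵥ⇒≤ᴾ y u (∧-conicalˡ _ _ first)
      none-earlier : any (y ≤ᵥ_) (earlier σ P u) ≡ false
      none-earlier = not-true⇒ (∧-conicalʳ (y ≤ᵥ u) _ first)
      condition : ∀ i → stalCondition (Lσ σ P u i) (lookup u i) (lookup y i) ≡ true
      condition i rewrite dec-true (lookup y i ℕ.≤? lookup u i) (y≤u i) with Lσ σ P u i in i∈L
      ... | false = refl
      ... | true with lookup y i ℕ.≟ lookup u i
      ... | yes yᵢ≡uᵢ = dec-true (lookup y i ℕ.≟ lookup u i) yᵢ≡uᵢ
      ... | no yᵢ≢uᵢ with v , v∈ , y≤v ← dominated-by-earlier⇐ σ {P} {u} {y} i∈L y≤u (ℕP.≤∧≢⇒< (y≤u i) yᵢ≢uᵢ) =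
        ⊥-elim (false≢true (trans (sym none-earlier) (any-true⇐ (y ≤ᵥ_) v v∈ (≤ᴾ⇒≤ᵥ y v y≤v))))
    ⇐ : allᶠ (λ i → stalCondition (Lσ σ P u i) (lookup u i) (lookup y i)) ≡ true → isFirstDominator σ P u y ≡ true
    ⇐ conditions = cong₂ _∧_ (≤ᴾ⇒≤ᵥ y u y≤u) (cong not none-earlier)
      where
      condition : ∀ i → stalCondition (Lσ σ P u i) (lookup u i) (lookup y i) ≡ true
      condition = allᶠ-true⇒ _ conditions
      y≤u : y ≤ᴾ u
      y≤u i = does-true⇒ (lookup y i ℕ.≤? lookup u i) (∧-conicalˡ _ _ (condition i))
      equal-if-in-L : ∀ i → Lσ σ P u i ≡ true → (lookup y i ≡ᵇ lookup u i) ≡ true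
      equal-if-in-L i i∈L =
        subst (λ l → (not l ∨ (lookup y i ≡ᵇ lookup u i)) ≡ true) i∈L (∧-conicalʳ (lookup y i ≤ᵇ lookup u i) _ (condition i))
      none-earlier : any (y ≤ᵥ_) (earlier σ P u) ≡ false
      none-earlier with any (y ≤ᵥ_) (earlier σ P u) in some
      ... | false = refl
      ... | true with v , v∈ , y≤v ← any-true⇒ (y ≤ᵥ_) (earlier σ P u) some
                 with ℓ , ℓ∈L , yℓ<uℓ ← dominated-by-earlier⇒ σ mconvex {y = y} u∈ v∈ (≤ᵥ⇒≤ᴾ y v y≤v) =
        ⊥-elim (ℕP.<-irrefl (does-true⇒ (lookup y ℓ ℕ.≟ lookup u ℓ) (equal-if-in-L ℓ ℓ∈L)) yℓ<uℓ)

  ∑-isFirstDominator : Unique P → ∀ y → ∑ P (λ u → χ (isFirstDominator σ P u y)) ≡ χ (any (y ≤ᵥ_) P)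
  ∑-isFirstDominator unique y with any (y ≤ᵥ_) P in dominated
  ... | false = ∑-zero P _ (λ u u∈ → cong (λ b → χ (b ∧ not (any (y ≤ᵥ_) (earlier σ P u)))) (any-false⇒ (y ≤ᵥ_) dominated u u∈))
  ... | true with m , m∈ , y≤m , m-least ← least (VP.≡-dec ℕ._≟_) (lexLtσ σ) (lexLtσ-trans σ) (lexLtσ-total σ) (y ≤ᵥ_) P dominated =
    trans (∑-cong-∈ P (λ u u∈ → trans (first≡δ u u∈) (sym (ℤP.*-identityʳ _)))) (∑-δ-∈ (λ _ → + 1) unique m∈)
    where
    not-below-earlier-than-m : ∀ v → v ∈ earlier σ P m → (y ≤ᵥ v) ≡ false
    not-below-earlier-than-m v v∈ with y ≤ᵥ v in y≤v | ∈-filterᵇ⁻ (λ v → lexLtσ σ v m) v∈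
    ... | false | _ = refl
    ... | true | v∈P , v≺m with m-least v v∈P y≤v
    ... | inj₁ refl = ⊥-elim (false≢true (trans (sym (lexLtσ-irrefl σ v)) v≺m))
    ... | inj₂ m≺v = ⊥-elim (false≢true (trans (sym (lexLtσ-irrefl σ m)) (lexLtσ-trans σ m v m m≺v v≺m)))
    m-first : (y ≤ᵥ m) ∧ not (any (y ≤ᵥ_) (earlier σ P m)) ≡ true
    m-first = cong₂ _∧_ y≤m (cong not (any-false⇐ (y ≤ᵥ_) (earlier σ P m) not-below-earlier-than-m))
    others-not-first : ∀ u → u ∈ P → u ≢ m → (y ≤ᵥ u) ∧ not (any (y ≤ᵥ_) (earlier σ P u)) ≡ false
    others-not-first u u∈ u≢m with y ≤ᵥ u in y≤u
    ... | false = refl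
    ... | true with m-least u u∈ y≤u
    ... | inj₁ u≡m = ⊥-elim (u≢m u≡m)
    ... | inj₂ m≺u = cong not (any-true⇐ (y ≤ᵥ_) m (∈-filterᵇ⁺ (λ v → lexLtσ σ v u) m∈ m≺u) y≤m)
    first≡δ : ∀ u → u ∈ P → χ (isFirstDominator σ P u y) ≡ δᴺ u m
    first≡δ u u∈ with VP.≡-dec ℕ._≟_ u m
    ... | yes refl = cong χ m-first
    ... | no u≢m = cong χ (others-not-first u u∈ u≢m)

  ∑-∏-stalFactor : Unique P → ∀ {I} → Enumerates I (Dominated P) → ∀ m →
    ∑ P (λ u → ∏ (λ i → stalFactor (Lσ σ P u i) (lookup u i) (lookup m i))) ≡ altCount I m
  ∑-∏-stalFactor unique {I} I-enum m = sym (begin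
    ∑ (allSubsets p) (λ J → sgn J * multiplicity I (m +ₛ J))
      ≡⟨ ∑-cong (allSubsets p) (λ J → cong (sgn J *_) (trans (multiplicity-Dominated I-enum (m +ₛ J)) (sym (∑-isFirstDominator unique (m +ₛ J))))) ⟩
    ∑ (allSubsets p) (λ J → sgn J * ∑ P (λ u → χ (isFirstDominator σ P u (m +ₛ J))))
      ≡⟨ ∑-cong (allSubsets p) (λ J → *-distribˡ-∑ (sgn J) P _) ⟩
    ∑ (allSubsets p) (λ J → ∑ P (λ u → sgn J * χ (isFirstDominator σ P u (m +ₛ J))))
      ≡⟨ ∑-comm (allSubsets p) P _ ⟩
    ∑ P (λ u → ∑ (allSubsets p) (λ J → sgn J * χ (isFirstDominator σ P u (m +ₛ J))))
      ≡⟨ ∑-cong-∈ P (λ u u∈ → ∑-cong (allSubsets p) (λ J → cong (sgn J *_) (per-coordinate u∈ J))) ⟩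
    ∑ P (λ u → ∑ (allSubsets p) (λ J → sgn J * ∏ (λ i → χ (stalCondition (Lσ σ P u i) (lookup u i) (if lookup J i then suc (lookup m i) else lookup m i)))))
      ≡⟨ ∑-cong P (λ u → ∑-allSubsets-sgn-∏ (λ i b → χ (stalCondition (Lσ σ P u i) (lookup u i) (if b then suc (lookup m i) else lookup m i)))) ⟩
    ∑ P (λ u → ∏ (λ i → χ (stalCondition (Lσ σ P u i) (lookup u i) (lookup m i)) - χ (stalCondition (Lσ σ P u i) (lookup u i) (suc (lookup m i)))))
      ≡⟨ ∑-cong P (λ u → ∏-cong (λ i → χ-stalCondition-difference (Lσ σ P u i) (lookup u i) (lookup m i))) ⟩
    ∑ P (λ u → ∏ (λ i → stalFactor (Lσ σ P u i) (lookup u i) (lookup m i))) ∎)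
    where
    per-coordinate : ∀ {u} → u ∈ P → ∀ J → χ (isFirstDominator σ P u (m +ₛ J)) ≡
      ∏ (λ i → χ (stalCondition (Lσ σ P u i) (lookup u i) (if lookup J i then suc (lookup m i) else lookup m i)))
    per-coordinate {u} u∈ J = trans (cong χ (isFirstDominator≡allᶠ (m +ₛ J) u∈))
      (trans (χ-allᶠ (λ i → stalCondition (Lσ σ P u i) (lookup u i) (lookup (m +ₛ J) i)))
        (∏-cong (λ i → cong (λ a → χ (stalCondition (Lσ σ P u i) (lookup u i) a)) (lookup-+ₛ m J i))))

-1^ : ℕ → ℤ
-1^ k = (- + 1) ^ k

stalMember : Bool → ℕ → ℕ → Bool
stalMember l c a = (a ≡ᵇ c) ∨ (l ∧ (suc a ≡ᵇ c))

stalMember⇒≤ : ∀ l c a → stalMember l c a ≡ true → a ≤ c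
stalMember⇒≤ l c a member with a ≡ᵇ c in a≡c
... | true = ℕP.≤-reflexive (does-true⇒ (a ℕ.≟ c) a≡c)
... | false = ℕP.<⇒≤ (ℕP.≤-reflexive (does-true⇒ (suc a ℕ.≟ c) (∧-conicalʳ l _ member)))

stalFactor≡ : ∀ l c a → stalFactor l c a ≡ -1^ (c ∸ a) * χ (stalMember l c a)
stalFactor≡ l c a with a ≡ᵇ c in a≡c | suc a ≡ᵇ c in 1+a≡c
... | true | true with refl ← does-true⇒ (a ℕ.≟ c) a≡c = ⊥-elim (ℕP.1+n≢n (does-true⇒ (suc a ℕ.≟ a) 1+a≡c))
... | true | false with refl ← does-true⇒ (a ℕ.≟ c) a≡c rewrite ℕP.n∸n≡0 a | ℤP.*-zeroʳ (χ l) = refl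
... | false | true with refl ← does-true⇒ (suc a ℕ.≟ c) 1+a≡c rewrite ℕP.m+n∸n≡m 1 a = at-predecessor l
  where
  at-predecessor : ∀ l → + 0 - χ l * + 1 ≡ - + 1 * + 1 * χ (l ∧ true)
  at-predecessor true = refl
  at-predecessor false = refl
... | false | false rewrite ∧-zeroʳ l = trans (cong (λ z → + 0 - z) (ℤP.*-zeroʳ (χ l))) (sym (ℤP.*-zeroʳ (-1^ (c ∸ a))))

∏-sign-χ : ∀ {q} (c a : Vec ℕ q) (b : Fin q → Bool) → (∀ i → b i ≡ true → lookup a i ≤ lookup c i) →
  ∏ (λ i → -1^ (lookup c i ∸ lookup a i) * χ (b i)) ≡ -1^ (∣ c ∣ᵥ ∸ ∣ a ∣ᵥ) * χ (allᶠ b)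
∏-sign-χ [] [] b _ = refl
∏-sign-χ (x ∷ c) (y ∷ a) b b⇒≤ with b fz in b₀ | allᶠ (λ i → b (fs i)) in rest
... | false | _ = trans (cong (_* ∏ (λ i → -1^ (lookup c i ∸ lookup a i) * χ (b (fs i)))) (ℤP.*-zeroʳ (-1^ (x ∸ y))))
                        (sym (ℤP.*-zeroʳ (-1^ ((x ℕ.+ ∣ c ∣ᵥ) ∸ (y ℕ.+ ∣ a ∣ᵥ)))))
... | true | r rewrite ∏-sign-χ c a (λ i → b (fs i)) (λ i → b⇒≤ (fs i)) | rest with r
...   | false = trans (cong (-1^ (x ∸ y) * + 1 *_) (ℤP.*-zeroʳ (-1^ (∣ c ∣ᵥ ∸ ∣ a ∣ᵥ))))
                  (trans (ℤP.*-zeroʳ (-1^ (x ∸ y) * + 1)) (sym (ℤP.*-zeroʳ (-1^ ((x ℕ.+ ∣ c ∣ᵥ) ∸ (y ℕ.+ ∣ a ∣ᵥ))))))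
...   | true = begin
  -1^ (x ∸ y) * + 1 * (-1^ (∣ c ∣ᵥ ∸ ∣ a ∣ᵥ) * + 1)  ≡⟨ drop-ones (-1^ (x ∸ y)) (-1^ (∣ c ∣ᵥ ∸ ∣ a ∣ᵥ)) ⟩
  -1^ (x ∸ y) * -1^ (∣ c ∣ᵥ ∸ ∣ a ∣ᵥ) * + 1
    ≡⟨ cong (_* + 1) (sym (ℤP.^-distribˡ-+-* (- + 1) (x ∸ y) (∣ c ∣ᵥ ∸ ∣ a ∣ᵥ))) ⟩
  -1^ ((x ∸ y) ℕ.+ (∣ c ∣ᵥ ∸ ∣ a ∣ᵥ)) * + 1          ≡⟨ cong (λ k → -1^ k * + 1) (sym exponent) ⟩
  -1^ ((x ℕ.+ ∣ c ∣ᵥ) ∸ (y ℕ.+ ∣ a ∣ᵥ)) * + 1       ∎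
  where
  drop-ones : ∀ s t → s * + 1 * (t * + 1) ≡ s * t * + 1
  drop-ones = solve-∀
  y≤x : y ≤ x
  y≤x = b⇒≤ fz b₀
  ∣a∣≤∣c∣ : ∣ a ∣ᵥ ≤ ∣ c ∣ᵥ
  ∣a∣≤∣c∣ = ∣∣-mono-≤ a c (λ i → b⇒≤ (fs i) (allᶠ-true⇒ (λ i → b (fs i)) rest i))
  exponent : (x ℕ.+ ∣ c ∣ᵥ) ∸ (y ℕ.+ ∣ a ∣ᵥ) ≡ (x ∸ y) ℕ.+ (∣ c ∣ᵥ ∸ ∣ a ∣ᵥ)
  exponent = begin
    (x ℕ.+ ∣ c ∣ᵥ) ∸ (y ℕ.+ ∣ a ∣ᵥ)  ≡⟨ sym (ℕP.∸-+-assoc (x ℕ.+ ∣ c ∣ᵥ) y ∣ a ∣ᵥ) ⟩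
    (x ℕ.+ ∣ c ∣ᵥ) ∸ y ∸ ∣ a ∣ᵥ      ≡⟨ cong (_∸ ∣ a ∣ᵥ) (ℕP.+-∸-comm ∣ c ∣ᵥ y≤x) ⟩
    (x ∸ y) ℕ.+ ∣ c ∣ᵥ ∸ ∣ a ∣ᵥ      ≡⟨ ℕP.+-∸-assoc (x ∸ y) ∣a∣≤∣c∣ ⟩
    (x ∸ y) ℕ.+ (∣ c ∣ᵥ ∸ ∣ a ∣ᵥ)    ∎

private
  bit : Bool → ℤ
  bit b = if b then + 1 else + 0

  minus-bit⇒ : ∀ c a b → + c - bit b ≡ + a → (if b then suc a else a) ≡ c
  minus-bit⇒ c a false eq = ℤP.+-injective (trans (sym eq) (ℤP.+-identityʳ (+ c)))
  minus-bit⇒ c a true eq = ℤP.+-injective (trans (cong (_+_ (+ 1)) (sym eq)) (add-sub (+ c)))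
    where
    add-sub : ∀ x → + 1 + (x - + 1) ≡ x
    add-sub = solve-∀

  minus-bit⇐ : ∀ c a b → (if b then suc a else a) ≡ c → + c - bit b ≡ + a
  minus-bit⇐ c a false refl = ℤP.+-identityʳ (+ a)
  minus-bit⇐ c a true refl = sub-add (+ a)
    where
    sub-add : ∀ x → (+ 1 + x) - + 1 ≡ x
    sub-add = solve-∀

lookup-St-point : ∀ (u : Pt p) J i → lookup (toZ u -ᵥ eSet J) i ≡ + lookup u i - bit (lookup J i)
lookup-St-point u J i = trans (lookup--ᵥ (toZ u) (eSet J) i) (cong₂ _-_ (lookup-toZ u i) (VP.lookup-map i bit J))

∈St≡allᶠ : ∀ (V : List (Pt p)) (u n : Pt p) →
  any (_≟ᶻ toZ n) (St V u) ≡ allᶠ (λ i → stalMember (inL V u i) (lookup u i) (lookup n i))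
∈St≡allᶠ {p} V u n = bool-ext ⇒ ⇐
  where
  J⊆L : Vec Bool p → Bool
  J⊆L J = all (λ ℓ → not (lookup J ℓ) ∨ inL V u ℓ) (allFin p)
  ⇒ : any (_≟ᶻ toZ n) (St V u) ≡ true → allᶠ (λ i → stalMember (inL V u i) (lookup u i) (lookup n i)) ≡ true
  ⇒ n∈St with x , x∈ , x≡n ← any-true⇒ (_≟ᶻ toZ n) (St V u) n∈St
         with J , J∈ , refl ← ∈-map⁻ (λ J → toZ u -ᵥ eSet J) x∈ = allᶠ-true⇐ _ member
    where
    coordinate : ∀ i → (if lookup J i then suc (lookup n i) else lookup n i) ≡ lookup u i
    coordinate i = minus-bit⇒ (lookup u i) (lookup n i) (lookup J i)
      (trans (sym (lookup-St-point u J i)) (trans (cong (λ z → lookup z i) (≟ᶻ⇒≡ (toZ u -ᵥ eSet J) (toZ n) x≡n)) (lookup-toZ n i)))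
    member : ∀ i → stalMember (inL V u i) (lookup u i) (lookup n i) ≡ true
    member i with lookup J i in Jᵢ | coordinate i
    ... | false | nᵢ≡uᵢ rewrite dec-true (lookup n i ℕ.≟ lookup u i) nᵢ≡uᵢ = refl
    ... | true | 1+nᵢ≡uᵢ
      rewrite dec-true (suc (lookup n i) ℕ.≟ lookup u i) 1+nᵢ≡uᵢ
            | subst (λ b → (not b ∨ inL V u i) ≡ true) Jᵢ (all-true⇒ _ (allFin p) (proj₂ (∈-filterᵇ⁻ J⊆L {allSubsets p} J∈)) i (∈-allFin i))
      = ∨-zeroʳ (lookup n i ≡ᵇ lookup u i)
  ⇐ : allᶠ (λ i → stalMember (inL V u i) (lookup u i) (lookup n i)) ≡ true → any (_≟ᶻ toZ n) (St V u) ≡ true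
  ⇐ members = any-true⇐ (_≟ᶻ toZ n) (toZ u -ᵥ eSet J) (∈-map⁺ (λ J → toZ u -ᵥ eSet J) (∈-filterᵇ⁺ J⊆L (allSubsets-complete J) J⊆L-true))
    (≡⇒≟ᶻ (toZ u -ᵥ eSet J) (toZ n) (lookup-ext λ i → trans (lookup-St-point u J i) (trans (coordinate i) (sym (lookup-toZ n i)))))
    where
    J : Vec Bool p
    J = tabulate (λ i → not (lookup n i ≡ᵇ lookup u i))
    member : ∀ i → stalMember (inL V u i) (lookup u i) (lookup n i) ≡ true
    member = allᶠ-true⇒ _ members
    J⊆L-true : J⊆L J ≡ true
    J⊆L-true = all-true⇐ _ (allFin p) (λ ℓ _ → in-L ℓ)
      where
      in-L : ∀ ℓ → (not (lookup J ℓ) ∨ inL V u ℓ) ≡ true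
      in-L ℓ rewrite VP.lookup∘tabulate (λ i → not (lookup n i ≡ᵇ lookup u i)) ℓ with lookup n ℓ ≡ᵇ lookup u ℓ | member ℓ
      ... | true | _ = refl
      ... | false | m = ∧-conicalˡ _ _ m
    coordinate : ∀ i → + lookup u i - bit (lookup J i) ≡ + lookup n i
    coordinate i rewrite VP.lookup∘tabulate (λ i → not (lookup n i ≡ᵇ lookup u i)) i with lookup n i ≡ᵇ lookup u i in nᵢ≡uᵢ | member i
    ... | true | _ = minus-bit⇐ (lookup u i) (lookup n i) false (does-true⇒ (lookup n i ℕ.≟ lookup u i) nᵢ≡uᵢ)
    ... | false | m = minus-bit⇐ (lookup u i) (lookup n i) true (does-true⇒ (suc (lookup n i) ℕ.≟ lookup u i) (∧-conicalʳ _ _ m))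

module _ (σ : Permutation′ p) {P : List (Pt p)} {r} (isP : IsPolymatroid P r) {I} (I-enum : Enumerates I (Dominated P)) where

  open IsPolymatroid isP

  Stal-coefficient : ∀ n → -1^ (r ∸ ∣ n ∣ᵥ) * + cnt σ P n ≡ altCount I n
  Stal-coefficient n = begin
    -1^ (r ∸ ∣ n ∣ᵥ) * + cnt σ P n
      ≡⟨ cong (-1^ (r ∸ ∣ n ∣ᵥ) *_) (length-filterᵇ (λ u → any (_≟ᶻ toZ n) (stalactite σ P u)) P) ⟩
    -1^ (r ∸ ∣ n ∣ᵥ) * ∑ P (λ u → χ (any (_≟ᶻ toZ n) (stalactite σ P u)))
      ≡⟨ *-distribˡ-∑ (-1^ (r ∸ ∣ n ∣ᵥ)) P _ ⟩
    ∑ P (λ u → -1^ (r ∸ ∣ n ∣ᵥ) * χ (any (_≟ᶻ toZ n) (stalactite σ P u)))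
      ≡⟨ ∑-cong-∈ P (λ u u∈ → cong₂ (λ k b → -1^ (k ∸ ∣ n ∣ᵥ) * χ b) (sym (rank u u∈)) (∈St≡allᶠ (earlier σ P u) u n)) ⟩
    ∑ P (λ u → -1^ (∣ u ∣ᵥ ∸ ∣ n ∣ᵥ) * χ (allᶠ (λ i → stalMember (Lσ σ P u i) (lookup u i) (lookup n i))))
      ≡⟨ ∑-cong P (λ u → sym (∏-sign-χ u n _ (λ i → stalMember⇒≤ (Lσ σ P u i) (lookup u i) (lookup n i)))) ⟩
    ∑ P (λ u → ∏ (λ i → -1^ (lookup u i ∸ lookup n i) * χ (stalMember (Lσ σ P u i) (lookup u i) (lookup n i))))
      ≡⟨ ∑-cong P (λ u → ∏-cong (λ i → sym (stalFactor≡ (Lσ σ P u i) (lookup u i) (lookup n i)))) ⟩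
    ∑ P (λ u → ∏ (λ i → stalFactor (Lσ σ P u i) (lookup u i) (lookup n i)))
      ≡⟨ ∑-∏-stalFactor σ mconvex distinct I-enum n ⟩
    altCount I n ∎

  Stal-HasCoefficients : Stal σ P r I HasCoefficients altCount I
  Stal-HasCoefficients = sumₚ-mono-HasCoefficients _ (altCount I) (proj₁ I-enum)
    (λ n _ → Stal-coefficient n) (altCount-∉ (Enumerates⇒DownClosed I-enum))

-- The cave polynomial

∑-compositions-δ : ∀ q r (u : Pt q) → ∣ u ∣ᵥ ≡ r → ∑ (compositions q r) (λ n → δᴺ n u) ≡ + 1
∑-compositions-δ zero zero [] _ = refl
∑-compositions-δ (suc q) r (a ∷ u) ∣a∷u∣≡r = begin
  ∑ (concatMap (λ k → map (k ∷_) (compositions q (r ∸ k))) (upTo (suc r))) (λ n → δᴺ n (a ∷ u))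
    ≡⟨ ∑-concatMap (λ k → map (k ∷_) (compositions q (r ∸ k))) (upTo (suc r)) (λ n → δᴺ n (a ∷ u)) ⟩
  ∑ (upTo (suc r)) (λ k → ∑ (map (k ∷_) (compositions q (r ∸ k))) (λ n → δᴺ n (a ∷ u)))
    ≡⟨ ∑-cong (upTo (suc r)) (λ k → trans (∑-map (k ∷_) (compositions q (r ∸ k)) _)
         (trans (∑-cong (compositions q (r ∸ k)) (λ n → χ-∧ (k ≡ᵇ a) (n ≟ᴺ u)))
           (sym (*-distribˡ-∑ (χ (k ≡ᵇ a)) (compositions q (r ∸ k)) (λ n → δᴺ n u))))) ⟩
  ∑ (upTo (suc r)) (λ k → Kronecker.δ ℕ._≟_ k a * ∑ (compositions q (r ∸ k)) (λ n → δᴺ n u))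
    ≡⟨ Kronecker.∑-δ-∈ ℕ._≟_ (λ k → ∑ (compositions q (r ∸ k)) (λ n → δᴺ n u)) (upTo⁺ (suc r)) (∈-upTo⁺ (s≤s a≤r)) ⟩
  ∑ (compositions q (r ∸ a)) (λ n → δᴺ n u)
    ≡⟨ ∑-compositions-δ q (r ∸ a) u (trans (sym (ℕP.m+n∸m≡n a ∣ u ∣ᵥ)) (cong (_∸ a) ∣a∷u∣≡r)) ⟩
  + 1 ∎
  where
  a≤r : a ≤ r
  a≤r = subst (a ≤_) ∣a∷u∣≡r (ℕP.m≤m+n a ∣ u ∣ᵥ)

∑-compositions-multiplicity : ∀ {r} {P : List (Pt p)} → (∀ u → u ∈ P → ∣ u ∣ᵥ ≡ r) → ∀ (φ : Pt p → ℤ) →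
  ∑ (compositions p r) (λ n → multiplicity P n * φ n) ≡ ∑ P φ
∑-compositions-multiplicity {p} {r} {P} rank φ = begin
  ∑ (compositions p r) (λ n → multiplicity P n * φ n)
    ≡⟨ ∑-cong (compositions p r) (λ n → *-distribʳ-∑ (φ n) P (λ u → δᴺ u n * + 1)) ⟩
  ∑ (compositions p r) (λ n → ∑ P (λ u → δᴺ u n * + 1 * φ n))
    ≡⟨ ∑-comm (compositions p r) P _ ⟩
  ∑ P (λ u → ∑ (compositions p r) (λ n → δᴺ u n * + 1 * φ n))
    ≡⟨ ∑-cong-∈ P (λ u u∈ → begin
         ∑ (compositions p r) (λ n → δᴺ u n * + 1 * φ n)
           ≡⟨ ∑-cong (compositions p r) (λ n → trans (cong (_* φ n) (trans (ℤP.*-identityʳ _) (δ-sym u n))) (δ-subst n u φ)) ⟩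
         ∑ (compositions p r) (λ n → δᴺ n u * φ u)
           ≡⟨ sym (*-distribʳ-∑ (φ u) (compositions p r) (λ n → δᴺ n u)) ⟩
         ∑ (compositions p r) (λ n → δᴺ n u) * φ u
           ≡⟨ trans (cong (_* φ u) (∑-compositions-δ p r u (rank u u∈))) (ℤP.*-identityˡ _) ⟩
         φ u ∎) ⟩
  ∑ P φ ∎

𝟙≡multiplicity : ∀ {P B : List (Pt p)} → Unique P → Enumerates B (_∈ P) → ∀ n → + 𝟙 B (toZ n) ≡ multiplicity P n
𝟙≡multiplicity {P = P} {B} unique (_ , B≡) n with toZ n ∈ᵇ B in n∈B
... | true with v , v∈ , v≡n ← ∈ᵇ⇒∈ᶻ (toZ n) B n∈B rewrite toZ-injective v n v≡n =
  sym (∑-δ-∈ (λ _ → + 1) unique (Equivalence.to (B≡ n) v∈))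
... | false = sym (∑-δ-∉ P (λ _ → + 1) (λ n∈P →
  false≢true (trans (sym n∈B) (∈ᶻ⇒∈ᵇ (toZ n) B (n , Equivalence.from (B≡ n) n∈P , refl)))))

module _ {P : List (Pt p)} where

  later-exchange⇒L : ∀ {u w i j} → toℕ i < toℕ j → w ∈ P → IsExchange w u i j → Lσ Perm.id P u i ≡ true
  later-exchange⇒L {u = u} {w} {i} {j} i<j w∈ X =
    inL⇐ (earlier Perm.id P u) (FP.<⇒≢ i<j) (∈-filterᵇ⁺ (λ v → lexLtσ Perm.id v u) w∈ w≺u) X
    where
    open IsExchange X
    w≺u : lexLtσ Perm.id w u ≡ true
    w≺u = LexAt⇒lexLt (permute Perm.id w) (permute Perm.id u) i
      ( (λ k k<i → trans (lookup-permute Perm.id w k)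
           (trans (elsewhere k (FP.<⇒≢ k<i) (FP.<⇒≢ (ℕP.<-trans k<i i<j))) (sym (lookup-permute Perm.id u k))))
      , subst₂ _<_ (sym (lookup-permute Perm.id w i)) (sym (lookup-permute Perm.id u i)) (ℕP.≤-reflexive at-source))

  L⇒later-exchange : ∀ {u i} → Lσ Perm.id P u i ≡ true → ∃ λ j → toℕ i < toℕ j × ∃ λ w → w ∈ P × IsExchange w u i j
  L⇒later-exchange {u} {i} i∈L with j , i≢j , w , w∈ , X ← inL⇒ (earlier Perm.id P u) u i i∈L
    with w∈P , w≺u ← ∈-filterᵇ⁻ (λ v → lexLtσ Perm.id v u) w∈
    with k , agree , wₖ<uₖ ← lexLt⇒LexAt (permute Perm.id w) (permute Perm.id u) w≺u = j , i<j , w , w∈P , X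
    where
    open IsExchange X
    wₖ<uₖ′ : lookup w k < lookup u k
    wₖ<uₖ′ = subst₂ _<_ (lookup-permute Perm.id w k) (lookup-permute Perm.id u k) wₖ<uₖ
    k≡i : k ≡ i
    k≡i with k ≟ᶠ i | k ≟ᶠ j
    ... | yes k≡i | _ = k≡i
    ... | no _ | yes refl = ⊥-elim (ℕP.<-asym wₖ<uₖ′ (ℕP.≤-reflexive (sym at-target)))
    ... | no k≢i | no k≢j = ⊥-elim (ℕP.<-irrefl (elsewhere k k≢i k≢j) wₖ<uₖ′)
    i<j : toℕ i < toℕ j
    i<j with ℕP.<-cmp (toℕ i) (toℕ j)
    ... | tri< i<j _ _ = i<j
    ... | tri≈ _ i≡j _ = ⊥-elim (i≢j (FP.toℕ-injective i≡j))
    ... | tri> _ _ j<i = ⊥-elim (ℕP.1+n≢n (trans (sym at-target) wⱼ≡uⱼ))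
      where
      wⱼ≡uⱼ : lookup w j ≡ lookup u j
      wⱼ≡uⱼ = trans (sym (lookup-permute Perm.id w j))
        (trans (agree j (subst (λ x → toℕ j < toℕ x) (sym k≡i) j<i)) (lookup-permute Perm.id u j))

laterCoordinates : Fin p → List (Fin p)
laterCoordinates {p} i = filterᵇ (λ j → toℕ i <ᵇ toℕ j) (allFin p)

caveMax : List (Pt p) → Pt p → Fin p → ℕ
caveMax B n i = maxList (map (λ j → 𝟙 B (exchange n i j)) (laterCoordinates i))

notLast : Fin p → Bool
notLast {p} i = suc (toℕ i) <ᵇ p

caveFactor : List (Pt p) → Pt p → Fin p → Poly p
caveFactor B n i = oneₚ L.++ mono (- (+ caveMax B n i)) (0ᵥ -ᵥ e i)

caveFactorᵤ : Bool → ℕ → UPoly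
caveFactorᵤ false _ = (+ 1 , + 0) ∷ []
caveFactorᵤ true mx = (+ 1 , + 0) ∷ (- + mx , -[1+ 0 ]) ∷ []

caveFactor≈inVar : ∀ (B : List (Pt p)) n i →
  (if notLast i then caveFactor B n i else oneₚ) ≈ₚ inVar i (caveFactorᵤ (notLast i) (caveMax B n i))
caveFactor≈inVar B n i m with notLast i
... | true = cong₂ (λ x y → (if x ≟ᶻ m then + 1 else + 0) + ((if y ≟ᶻ m then - (+ caveMax B n i) else + 0) + + 0))
               (0ᵥ≡0·eᶻ i) 0ᵥ-eᵢ≡-1·eᶻ
  where
  0ᵥ-eᵢ≡-1·eᶻ : 0ᵥ -ᵥ e i ≡ -[1+ 0 ] ·eᶻ i
  0ᵥ-eᵢ≡-1·eᶻ = lookup-ext λ t → trans (lookup--ᵥ 0ᵥ (e i) t) (trans (cong₂ _-_ (lookup-0ᵥ t) (lookup-e i t))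
    (sym (trans (VP.lookup∘tabulate _ t) (negated (does (t ≟ᶠ i))))))
    where
    negated : ∀ b → (if b then -[1+ 0 ] else + 0) ≡ + 0 - χ b
    negated true = refl
    negated false = refl
... | false = cong (λ x → (if x ≟ᶻ m then + 1 else + 0) + + 0) (0ᵥ≡0·eᶻ i)

coeff-Cave : ∀ r (B : List (Pt p)) m → coeff (Cave r B) m ≡
  ∑ (compositions p r) (λ n → + 𝟙 B (toZ n) * ∏ (λ i → ucoeff (caveFactorᵤ (notLast i) (caveMax B n i)) (lookup (m -ᵥ toZ n) i)))
coeff-Cave {p} r B m = trans (coeff-sumₚ (compositions p r) _ m) (∑-cong (compositions p r) summand)
  where
  product : Pt p → Poly p
  product n = prodₚ (filterᵇ notLast (allFin p)) (caveFactor B n)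
  coeff-product : ∀ n d → coeff (product n) d ≡ ∏ (λ i → ucoeff (caveFactorᵤ (notLast i) (caveMax B n i)) (lookup d i))
  coeff-product n d = trans (prodₚ-filterᵇ notLast (allFin p) (caveFactor B n) d)
    (trans (cong (λ X → coeff X d) (prodₚ-allFin (λ i → if notLast i then caveFactor B n i else oneₚ)))
      (coeff-∏ₚ-inVar _ (λ i → caveFactorᵤ (notLast i) (caveMax B n i)) (caveFactor≈inVar B n) d))
  summand : ∀ n → coeff (mono (+ 𝟙 B (toZ n)) 0ᵥ *ₚ (product n *ₚ tpow n)) m ≡
    + 𝟙 B (toZ n) * ∏ (λ i → ucoeff (caveFactorᵤ (notLast i) (caveMax B n i)) (lookup (m -ᵥ toZ n) i))
  summand n = begin
    coeff (mono (+ 𝟙 B (toZ n)) 0ᵥ *ₚ (product n *ₚ tpow n)) m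
      ≡⟨ trans (coeff-*ₚ-∑ˡ (mono (+ 𝟙 B (toZ n)) 0ᵥ) (product n *ₚ tpow n) m) (ℤP.+-identityʳ _) ⟩
    + 𝟙 B (toZ n) * coeff (product n *ₚ tpow n) (m -ᵥ 0ᵥ)
      ≡⟨ cong (λ d → + 𝟙 B (toZ n) * coeff (product n *ₚ tpow n) d) (-ᵥ-identityʳ m) ⟩
    + 𝟙 B (toZ n) * coeff (product n *ₚ tpow n) m
      ≡⟨ cong (+ 𝟙 B (toZ n) *_) (trans (coeff-*ₚ-∑ʳ (product n) (tpow n) m) (trans (ℤP.+-identityʳ _) (ℤP.*-identityʳ _))) ⟩
    + 𝟙 B (toZ n) * coeff (product n) (m -ᵥ toZ n)
      ≡⟨ cong (+ 𝟙 B (toZ n) *_) (coeff-product n (m -ᵥ toZ n)) ⟩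
    + 𝟙 B (toZ n) * ∏ (λ i → ucoeff (caveFactorᵤ (notLast i) (caveMax B n i)) (lookup (m -ᵥ toZ n) i)) ∎

maxList-indicator : ∀ {A : Set} (c : A → Bool) xs → maxList (map (λ x → if c x then 1 else 0) xs) ≡ (if any c xs then 1 else 0)
maxList-indicator c [] = refl
maxList-indicator c (x ∷ xs) rewrite maxList-indicator c xs with c x | any c xs
... | true | true = refl
... | true | false = refl
... | false | true = refl
... | false | false = refl

caveMax≡any : ∀ (B : List (Pt p)) n i → caveMax B n i ≡ (if any (λ j → exchange n i j ∈ᵇ B) (laterCoordinates i) then 1 else 0)
caveMax≡any B n i = maxList-indicator (λ j → exchange n i j ∈ᵇ B) (laterCoordinates i)

0≟-difference : ∀ a c → does (+ 0 ℤ.≟ + a - + c) ≡ (a ≡ᵇ c)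
0≟-difference a c = bool-ext
  (λ e → dec-true (a ℕ.≟ c) (ℤP.+-injective (trans (add-back (+ a) (+ c)) (cong (_+ + c) (sym (does-true⇒ (+ 0 ℤ.≟ + a - + c) e))))))
  (λ e → dec-true (+ 0 ℤ.≟ + a - + c) (sym (trans (cong (λ x → + a - + x) (sym (does-true⇒ (a ℕ.≟ c) e))) (ℤP.+-inverseʳ (+ a)))))
  where
  add-back : ∀ x y → x ≡ (x - y) + y
  add-back = solve-∀

-1≟-difference : ∀ a c → does (-[1+ 0 ] ℤ.≟ + a - + c) ≡ (suc a ≡ᵇ c)
-1≟-difference a c = bool-ext
  (λ e → dec-true (suc a ℕ.≟ c) (ℤP.+-injective (sym (trans (recover (+ a) (+ c))
    (trans (cong (λ z → + a - z) (sym (does-true⇒ (-[1+ 0 ] ℤ.≟ + a - + c) e))) (minus-minus-one (+ a)))))))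
  (λ e → dec-true (-[1+ 0 ] ℤ.≟ + a - + c) (trans (minus-one (+ a)) (cong (λ x → + a - + x) (does-true⇒ (suc a ℕ.≟ c) e))))
  where
  recover : ∀ x y → y ≡ x - (x - y)
  recover = solve-∀
  minus-minus-one : ∀ x → x - - + 1 ≡ + 1 + x
  minus-minus-one = solve-∀
  minus-one : ∀ x → - + 1 ≡ x - (+ 1 + x)
  minus-one = solve-∀

module _ {P B : List (Pt p)} (B-enum : Enumerates B (_∈ P)) where

  χ-caveMax : ∀ u i → + caveMax B u i ≡ χ (Lσ Perm.id P u i)
  χ-caveMax u i = trans (cong +_ (caveMax≡any B u i)) (trans (if-χ _) (cong χ (bool-ext ⇒ ⇐)))
    where
    if-χ : ∀ b → + (if b then 1 else 0) ≡ χ b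
    if-χ true = refl
    if-χ false = refl
    ⇒ : any (λ j → exchange u i j ∈ᵇ B) (laterCoordinates i) ≡ true → Lσ Perm.id P u i ≡ true
    ⇒ some with j , j∈ , exchange∈B ← any-true⇒ _ (laterCoordinates i) some
               with w , w∈B , w≡ ← ∈ᵇ⇒∈ᶻ _ B exchange∈B =
      later-exchange⇒L i<j (Equivalence.to (proj₂ B-enum w) w∈B) (toZ≡exchange⇒IsExchange (FP.<⇒≢ i<j) w≡)
      where
      i<j : toℕ i < toℕ j
      i<j = does-true⇒ (toℕ i ℕ.<? toℕ j) (proj₂ (∈-filterᵇ⁻ (λ j → toℕ i <ᵇ toℕ j) {allFin p} j∈))
    ⇐ : Lσ Perm.id P u i ≡ true → any (λ j → exchange u i j ∈ᵇ B) (laterCoordinates i) ≡ true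
    ⇐ i∈L with j , i<j , w , w∈P , X ← L⇒later-exchange {P = P} {u} {i} i∈L =
      any-true⇐ _ j (∈-filterᵇ⁺ (λ j → toℕ i <ᵇ toℕ j) (∈-allFin j) (dec-true (toℕ i ℕ.<? toℕ j) i<j))
        (∈ᶻ⇒∈ᵇ _ B (w , Equivalence.from (proj₂ B-enum w) w∈P , IsExchange⇒toZ≡exchange (FP.<⇒≢ i<j) X))

  L⇒notLast : ∀ {u i} → Lσ Perm.id P u i ≡ true → notLast i ≡ true
  L⇒notLast {u} {i} i∈L with j , i<j , _ ← L⇒later-exchange {P = P} {u} {i} i∈L =
    dec-true (suc (toℕ i) ℕ.<? p) (ℕP.<-≤-trans (s≤s i<j) (FP.toℕ<n j))

  ucoeff-caveFactor : ∀ u i a → ucoeff (caveFactorᵤ (notLast i) (caveMax B u i)) (+ a - + lookup u i) ≡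
    stalFactor (Lσ Perm.id P u i) (lookup u i) a
  ucoeff-caveFactor u i a with notLast i in last?
  ... | true rewrite 0≟-difference a (lookup u i) | -1≟-difference a (lookup u i) =
    cong₂ _+_ (if-χ (a ≡ᵇ lookup u i)) (tail (suc a ≡ᵇ lookup u i))
    where
    if-χ : ∀ b → (if b then + 1 else + 0) ≡ χ b
    if-χ true = refl
    if-χ false = refl
    tail : ∀ s → (if s then - (+ caveMax B u i) else + 0) + + 0 ≡ - (χ (Lσ Perm.id P u i) * χ s)
    tail true = trans (ℤP.+-identityʳ _) (cong -_ (trans (χ-caveMax u i) (sym (ℤP.*-identityʳ _))))
    tail false = cong -_ (sym (ℤP.*-zeroʳ (χ (Lσ Perm.id P u i))))
  ... | false rewrite 0≟-difference a (lookup u i) with Lσ Perm.id P u i in i∈L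
  ...   | true = ⊥-elim (false≢true (trans (sym last?) (L⇒notLast {u} {i} i∈L)))
  ...   | false = trans (ℤP.+-identityʳ _) (sym (trans (ℤP.+-identityʳ _) (if-χ (a ≡ᵇ lookup u i))))
    where
    if-χ : ∀ b → χ b ≡ (if b then + 1 else + 0)
    if-χ true = refl
    if-χ false = refl

caveMax-zero : ∀ (B : List (Pt p)) n i → lookup n i ≡ 0 → caveMax B n i ≡ 0
caveMax-zero B n i nᵢ≡0 = trans (caveMax≡any B n i) (cong (λ b → if b then 1 else 0)
  (any-false⇐ _ (laterCoordinates i) (λ j j∈ → any-false⇐ _ B (λ v _ → toZ-≟-HasNegative v (i , 0 , negative-at-i j j∈)))))
  where
  negative-at-i : ∀ j → j ∈ laterCoordinates i → lookup (exchange n i j) i ≡ -[1+ 0 ]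
  negative-at-i j j∈ = begin
    lookup (exchange n i j) i                                      ≡⟨ lookup-exchange n i j i ⟩
    (+ lookup n i - χ (does (i ≟ᶠ i))) + χ (does (i ≟ᶠ j))
      ≡⟨ cong₂ (λ x y → (+ x - χ y) + χ (does (i ≟ᶠ j))) nᵢ≡0 (dec-true (i ≟ᶠ i) refl) ⟩
    - + 1 + χ (does (i ≟ᶠ j))                                      ≡⟨ cong (λ b → - + 1 + χ b) (dec-false (i ≟ᶠ j) (FP.<⇒≢ i<j)) ⟩
    -[1+ 0 ]                                                       ∎
    where
    i<j : toℕ i < toℕ j
    i<j = does-true⇒ (toℕ i ℕ.<? toℕ j) (proj₂ (∈-filterᵇ⁻ (λ j → toℕ i <ᵇ toℕ j) {allFin _} j∈))

ucoeff-caveFactor-negative : ∀ b mx k → (k ≡ 0 → mx ≡ 0) → ucoeff (caveFactorᵤ b mx) -[1+ k ] ≡ + 0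
ucoeff-caveFactor-negative false mx k _ = refl
ucoeff-caveFactor-negative true mx (suc k) _ = refl
ucoeff-caveFactor-negative true mx zero mx≡0 rewrite mx≡0 refl = refl

module _ {P : List (Pt p)} {r} (isP : IsPolymatroid P r) {B I} (B-enum : Enumerates B (_∈ P)) (I-enum : Enumerates I (Dominated P)) where

  open IsPolymatroid isP

  Cave-HasCoefficients : Cave r B HasCoefficients altCount I
  Cave-HasCoefficients = record { at-ℕᵖ = coefficient ; at-negative = vanishing }
    where
    factor : Pt p → Fin p → ℤ → ℤ
    factor n i = ucoeff (caveFactorᵤ (notLast i) (caveMax B n i))
    factors : Pt p → Pt p → ℤ
    factors m n = ∏ (λ i → factor n i (lookup (toZ m -ᵥ toZ n) i))
    coefficient : ∀ m → coeff (Cave r B) (toZ m) ≡ altCount I m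
    coefficient m = begin
      coeff (Cave r B) (toZ m)
        ≡⟨ coeff-Cave r B (toZ m) ⟩
      ∑ (compositions p r) (λ n → + 𝟙 B (toZ n) * factors m n)
        ≡⟨ ∑-cong (compositions p r) (λ n → cong (_* factors m n) (𝟙≡multiplicity distinct B-enum n)) ⟩
      ∑ (compositions p r) (λ n → multiplicity P n * factors m n)
        ≡⟨ ∑-compositions-multiplicity rank (factors m) ⟩
      ∑ P (factors m)
        ≡⟨ ∑-cong P (λ u → ∏-cong (λ i → trans (cong (factor u i) (lookup-toZ-difference m u i))
             (ucoeff-caveFactor B-enum u i (lookup m i)))) ⟩
      ∑ P (λ u → ∏ (λ i → stalFactor (Lσ Perm.id P u i) (lookup u i) (lookup m i)))
        ≡⟨ ∑-∏-stalFactor Perm.id mconvex distinct I-enum m ⟩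
      altCount I m ∎
    factor-vanishes : ∀ {m} n i j → lookup m i ≡ -[1+ j ] → factor n i (lookup (m -ᵥ toZ n) i) ≡ + 0
    factor-vanishes {m} n i j mᵢ<0 = begin
      factor n i (lookup (m -ᵥ toZ n) i)
        ≡⟨ cong (factor n i) (trans (lookup--ᵥ m (toZ n) i) (trans (cong₂ _-_ mᵢ<0 (lookup-toZ n i)) (ℤP.neg-minus-pos j (lookup n i)))) ⟩
      factor n i -[1+ lookup n i ℕ.+ j ]
        ≡⟨ ucoeff-caveFactor-negative (notLast i) (caveMax B n i) (lookup n i ℕ.+ j)
             (λ s≡0 → caveMax-zero B n i (ℕP.m+n≡0⇒m≡0 (lookup n i) s≡0)) ⟩
      + 0 ∎
    vanishing : ∀ m → HasNegative m → coeff (Cave r B) m ≡ + 0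
    vanishing m (i , j , mᵢ<0) = trans (coeff-Cave r B m) (∑-zero (compositions p r) _ (λ n _ →
      trans (cong (+ 𝟙 B (toZ n) *_) (∏-zero _ i (factor-vanishes {m} n i j mᵢ<0))) (ℤP.*-zeroʳ (+ 𝟙 B (toZ n)))))

-- Lattice points of the base and independence polytopes

∑ᴺ : (Fin q → ℕ) → ℕ
∑ᴺ {zero} f = 0
∑ᴺ {suc q} f = f fz ℕ.+ ∑ᴺ (λ i → f (fs i))

∑ᴺ-mono-≤ : ∀ (f g : Fin q → ℕ) → (∀ i → f i ≤ g i) → ∑ᴺ f ≤ ∑ᴺ g
∑ᴺ-mono-≤ {zero} f g f≤g = z≤n
∑ᴺ-mono-≤ {suc q} f g f≤g = ℕP.+-mono-≤ (f≤g fz) (∑ᴺ-mono-≤ _ _ (λ i → f≤g (fs i)))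

∑ᴺ-mono-< : ∀ (f g : Fin q → ℕ) → (∀ i → f i ≤ g i) → ∀ i₀ → f i₀ < g i₀ → ∑ᴺ f < ∑ᴺ g
∑ᴺ-mono-< {suc q} f g f≤g fz f<g = ℕP.+-mono-<-≤ f<g (∑ᴺ-mono-≤ _ _ (λ i → f≤g (fs i)))
∑ᴺ-mono-< {suc q} f g f≤g (fs i₀) f<g = ℕP.+-mono-≤-< (f≤g fz) (∑ᴺ-mono-< _ _ (λ i → f≤g (fs i)) i₀ f<g)

∑ᴺ-balance : ∀ (f h g k : Fin q → ℕ) → (∀ i → f i ℕ.+ h i ≡ g i ℕ.+ k i) → ∑ᴺ f ℕ.+ ∑ᴺ h ≡ ∑ᴺ g ℕ.+ ∑ᴺ k
∑ᴺ-balance {zero} f h g k _ = refl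
∑ᴺ-balance {suc q} f h g k eq = begin
  (f fz ℕ.+ ∑ᴺ f′) ℕ.+ (h fz ℕ.+ ∑ᴺ h′)  ≡⟨ interchange (f fz) (∑ᴺ f′) (h fz) (∑ᴺ h′) ⟩
  (f fz ℕ.+ h fz) ℕ.+ (∑ᴺ f′ ℕ.+ ∑ᴺ h′)  ≡⟨ cong₂ ℕ._+_ (eq fz) (∑ᴺ-balance f′ h′ g′ k′ (λ i → eq (fs i))) ⟩
  (g fz ℕ.+ k fz) ℕ.+ (∑ᴺ g′ ℕ.+ ∑ᴺ k′)  ≡⟨ interchange (g fz) (k fz) (∑ᴺ g′) (∑ᴺ k′) ⟩
  (g fz ℕ.+ ∑ᴺ g′) ℕ.+ (k fz ℕ.+ ∑ᴺ k′)  ∎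
  where
  f′ = λ i → f (fs i); h′ = λ i → h (fs i); g′ = λ i → g (fs i); k′ = λ i → k (fs i)
  open CommutativeSemigroupProperties ℕP.+-commutativeSemigroup using (interchange)

∑ᴺ-point : ∀ (a : Fin q) x → ∑ᴺ (λ i → if does (i ≟ᶠ a) then x else 0) ≡ x
∑ᴺ-point {suc q} fz x = trans (cong (x ℕ.+_) (∑ᴺ-zero q)) (ℕP.+-identityʳ x)
  where
  ∑ᴺ-zero : ∀ q → ∑ᴺ {q} (λ _ → 0) ≡ 0
  ∑ᴺ-zero zero = refl
  ∑ᴺ-zero (suc q) = ∑ᴺ-zero q
∑ᴺ-point {suc q} (fs a) x = ∑ᴺ-point a x

[_]₀₁ : Bool → ℕ → ℕ
[ b ]₀₁ x = if b then x else 0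

weight : (Fin p → Bool) → Pt p → ℕ
weight T x = ∑ᴺ (λ i → [ T i ]₀₁ (lookup x i))

weight-exchange : ∀ (T : Fin p → Bool) {w′ w a b} → a ≢ b → IsExchange w′ w a b →
  weight T w′ ℕ.+ [ T a ]₀₁ 1 ≡ weight T w ℕ.+ [ T b ]₀₁ 1
weight-exchange T {w′} {w} {a} {b} a≢b X = begin
  weight T w′ ℕ.+ [ T a ]₀₁ 1
    ≡⟨ cong (weight T w′ ℕ.+_) (sym (∑ᴺ-point a ([ T a ]₀₁ 1))) ⟩
  weight T w′ ℕ.+ ∑ᴺ (λ i → if does (i ≟ᶠ a) then [ T a ]₀₁ 1 else 0)
    ≡⟨ ∑ᴺ-balance _ _ _ _ coordinate ⟩
  weight T w ℕ.+ ∑ᴺ (λ i → if does (i ≟ᶠ b) then [ T b ]₀₁ 1 else 0)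
    ≡⟨ cong (weight T w ℕ.+_) (∑ᴺ-point b ([ T b ]₀₁ 1)) ⟩
  weight T w ℕ.+ [ T b ]₀₁ 1 ∎
  where
  open IsExchange X
  coordinate : ∀ i → [ T i ]₀₁ (lookup w′ i) ℕ.+ (if does (i ≟ᶠ a) then [ T a ]₀₁ 1 else 0)
                   ≡ [ T i ]₀₁ (lookup w i) ℕ.+ (if does (i ≟ᶠ b) then [ T b ]₀₁ 1 else 0)
  coordinate i with i ≟ᶠ a | i ≟ᶠ b
  ... | yes refl | yes refl = ⊥-elim (a≢b refl)
  ... | yes refl | no _ with T i
  ...   | true = trans (ℕP.+-comm (lookup w′ i) 1) (trans at-source (sym (ℕP.+-identityʳ _)))
  ...   | false = refl
  coordinate i | no _ | yes refl with T i
  ...   | true = trans (ℕP.+-identityʳ _) (trans at-target (ℕP.+-comm 1 (lookup w i)))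
  ...   | false = refl
  coordinate i | no i≢a | no i≢b = cong (λ z → [ T i ]₀₁ z ℕ.+ 0) (elsewhere i i≢a i≢b)

surplus : Pt p → Pt p → ℕ
surplus u w = ∑ᴺ (λ i → lookup w i ∸ lookup u i)

surplus-exchange-< : ∀ (u : Pt p) {w′ w a b} → IsExchange w′ w a b → lookup u a < lookup w a → lookup w b < lookup u b →
  surplus u w′ < surplus u w
surplus-exchange-< u {w′} {w} {a} {b} X uₐ<wₐ w_b<u_b = ∑ᴺ-mono-< _ _ coordinate-≤ a at-a
  where
  open IsExchange X
  coordinate-≤ : ∀ i → lookup w′ i ∸ lookup u i ≤ lookup w i ∸ lookup u i
  coordinate-≤ i with i ≟ᶠ a | i ≟ᶠ b
  ... | yes refl | _ = ℕP.∸-monoˡ-≤ (lookup u i) (subst (lookup w′ i ≤_) at-source (ℕP.n≤1+n _))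
  ... | no _ | yes refl = subst (_≤ lookup w i ∸ lookup u i) (sym (ℕP.m≤n⇒m∸n≡0 (subst (_≤ lookup u i) (sym at-target) w_b<u_b))) z≤n
  ... | no i≢a | no i≢b = ℕP.≤-reflexive (cong (_∸ lookup u i) (elsewhere i i≢a i≢b))
  at-a : lookup w′ a ∸ lookup u a < lookup w a ∸ lookup u a
  at-a = subst (λ z → lookup w′ a ∸ lookup u a < z ∸ lookup u a) at-source
    (ℕP.∸-monoˡ-< (ℕP.n<1+n _) (ℕP.≤-pred (subst (lookup u a <_) (sym at-source) uₐ<wₐ)))

ExchangeClosed : List (Pt p) → Pt p → (Fin p → Bool) → Set
ExchangeClosed P u T = ∀ {i j w} → T i ≡ false → T j ≡ true → w ∈ P → ¬ IsExchange w u i j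

module _ {P : List (Pt p)} (mconvex : MConvex P) {u} (u∈ : u ∈ P) {T} (closed : ExchangeClosed P u T) where

  -- Induction on the surplus of w over u: some exchange moves w towards u without lowering its weight on
  -- T, since an exchange that lowered it would yield an exchange at u moving weight into T.
  weight-maximised : ∀ {w} → w ∈ P → weight T w ≤ weight T u
  weight-maximised {w} w∈ = go (suc (surplus u w)) w∈ ℕP.≤-refl
    where
    go : ∀ fuel {w} → w ∈ P → surplus u w < fuel → weight T w ≤ weight T u
    go (suc fuel) {w} w∈ (s≤s bound)
      with FP.any? (λ k → (T k Bool.≟ false) ×-dec (lookup u k ℕ.<? lookup w k))
    ... | yes (k , Tₖ , uₖ<wₖ)
      with i , wᵢ<uᵢ , k≢i , w′ , w′∈ , X ← exchange-axiom mconvex w∈ u∈ k uₖ<wₖ =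
      ℕP.≤-trans gains (go fuel w′∈ (ℕP.<-≤-trans (surplus-exchange-< u X uₖ<wₖ wᵢ<uᵢ) bound))
      where
      gains : weight T w ≤ weight T w′
      gains = ℕP.≤-trans (ℕP.m≤m+n (weight T w) _)
        (ℕP.≤-reflexive (trans (sym (weight-exchange T k≢i X)) (trans (cong (λ b → weight T w′ ℕ.+ [ b ]₀₁ 1) Tₖ) (ℕP.+-identityʳ _))))
    ... | no none-outside
      with FP.any? (λ j → (T j Bool.≟ true) ×-dec (lookup u j ℕ.<? lookup w j))
    ...   | no none-inside = ∑ᴺ-mono-≤ _ _ coordinate
      where
      coordinate : ∀ i → [ T i ]₀₁ (lookup w i) ≤ [ T i ]₀₁ (lookup u i)
      coordinate i with T i in Tᵢ
      ... | false = z≤n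
      ... | true = ℕP.≮⇒≥ (λ uᵢ<wᵢ → none-inside (i , Tᵢ , uᵢ<wᵢ))
    ...   | yes (j , Tⱼ , uⱼ<wⱼ)
      with i , wᵢ<uᵢ , j≢i , w′ , w′∈ , X ← exchange-axiom mconvex w∈ u∈ j uⱼ<wⱼ
      with T i in Tᵢ
    ...     | true = subst (_≤ weight T u) same-weight (go fuel w′∈ (ℕP.<-≤-trans (surplus-exchange-< u X uⱼ<wⱼ wᵢ<uᵢ) bound))
      where
      same-weight : weight T w′ ≡ weight T w
      same-weight = ℕP.+-cancelʳ-≡ ([ T j ]₀₁ 1) _ _ (trans (weight-exchange T j≢i X) (cong (λ b → weight T w ℕ.+ [ b ]₀₁ 1) (trans Tᵢ (sym Tⱼ))))
    ...     | false with k , uₖ<wₖ , i≢k , v , v∈ , Y ← exchange-axiom mconvex u∈ w∈ i wᵢ<uᵢ with T k in Tₖ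
    ...       | true = ⊥-elim (closed Tᵢ Tₖ v∈ Y)
    ...       | false = ⊥-elim (none-outside (k , Tₖ , uₖ<wₖ))

module _ {P : List (Pt p)} (mconvex : MConvex P) where

  exchange-trans : ∀ {u v₁ v₂ a b c} → v₁ ∈ P → IsExchange v₁ u a b → v₂ ∈ P → IsExchange v₂ u b c →
    a ≢ b → b ≢ c → a ≢ c → ∃ λ w → w ∈ P × IsExchange w u a c
  exchange-trans {u} {v₁} {v₂} {a} {b} {c} v₁∈ X₁ v₂∈ X₂ a≢b b≢c a≢c
    with j , v₂ⱼ<v₁ⱼ , a≢j , w , w∈ , Y ← exchange-axiom mconvex v₂∈ v₁∈ a
      (subst (lookup v₁ a <_) (trans (IsExchange.at-source X₁) (sym (IsExchange.elsewhere X₂ a a≢b a≢c))) ℕP.≤-refl) = w , w∈ , record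
      { at-source = trans (Y.at-source) (X₂.elsewhere a a≢b a≢c)
      ; at-target = trans (Y.elsewhere c (a≢c ∘ sym) (λ { refl → b≢c (sym j≡b) })) X₂.at-target
      ; elsewhere = elsewhere
      }
    where
    module X₁ = IsExchange X₁
    module X₂ = IsExchange X₂
    module Y = IsExchange Y
    j≡b : j ≡ b
    j≡b with j ≟ᶠ b | j ≟ᶠ c
    ... | yes j≡b | _ = j≡b
    ... | no j≢b | yes refl = ⊥-elim (ℕP.<-asym v₂ⱼ<v₁ⱼ (subst₂ _<_ (sym (X₁.elsewhere j (a≢j ∘ sym) j≢b)) (sym X₂.at-target) ℕP.≤-refl))
    ... | no j≢b | no j≢c = ⊥-elim (ℕP.<-irrefl (trans (X₂.elsewhere j j≢b j≢c) (sym (X₁.elsewhere j (a≢j ∘ sym) j≢b))) v₂ⱼ<v₁ⱼ)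
    elsewhere : ∀ t → t ≢ a → t ≢ c → lookup w t ≡ lookup u t
    elsewhere t t≢a t≢c with t ≟ᶠ b
    ... | yes refl = trans (subst (λ j → lookup w j ≡ suc (lookup v₂ j)) j≡b Y.at-target) X₂.at-source
    ... | no t≢b = trans (Y.elsewhere t t≢a (λ { refl → t≢b j≡b })) (X₂.elsewhere t t≢b t≢c)

argmin-∈ : ∀ {A : Set} (f : A → ℕ) xs → xs ≢ [] → ∃ λ m → m ∈ xs × (∀ {x} → x ∈ xs → f m ≤ f x)
argmin-∈ f [] xs≢[] = ⊥-elim (xs≢[] refl)
argmin-∈ f (x ∷ xs) _ = argmin f x xs , argmin∈ (argmin-sel f x xs) , minimal
  where
  argmin∈ : (argmin f x xs ≡ x) ⊎ (argmin f x xs ∈ xs) → argmin f x xs ∈ x ∷ xs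
  argmin∈ (inj₁ eq) = here eq
  argmin∈ (inj₂ m∈) = there m∈
  minimal : ∀ {y} → y ∈ x ∷ xs → f (argmin f x xs) ≤ f y
  minimal (here refl) = f[argmin]≤f[⊤] {f = f} x xs
  minimal (there y∈) = All.lookup (f[argmin]≤f[xs] {f = f} x xs) y∈

deficit : Pt p → Pt p → ℕ
deficit n v = ∑ᴺ (λ i → lookup n i ∸ lookup v i)

deficit-exchange-< : ∀ (n : Pt p) {w u t c} → IsExchange w u t c → lookup u c < lookup n c → lookup n t < lookup u t →
  deficit n w < deficit n u
deficit-exchange-< n {w} {u} {t} {c} X u_c<n_c n_t<u_t = ∑ᴺ-mono-< _ _ coordinate-≤ c at-c
  where
  open IsExchange X
  coordinate-≤ : ∀ i → lookup n i ∸ lookup w i ≤ lookup n i ∸ lookup u i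
  coordinate-≤ i with i ≟ᶠ t | i ≟ᶠ c
  ... | yes refl | _ = subst (_≤ lookup n i ∸ lookup u i) (sym (ℕP.m≤n⇒m∸n≡0 (ℕP.≤-pred (subst (lookup n i <_) (sym at-source) n_t<u_t)))) z≤n
  ... | no _ | yes refl = ℕP.∸-monoʳ-≤ (lookup n i) (subst (lookup u i ≤_) (sym at-target) (ℕP.n≤1+n _))
  ... | no i≢t | no i≢c = ℕP.≤-reflexive (cong (lookup n i ∸_) (elsewhere i i≢t i≢c))
  at-c : lookup n c ∸ lookup w c < lookup n c ∸ lookup u c
  at-c = subst (λ z → lookup n c ∸ z < lookup n c ∸ lookup u c) (sym at-target) (ℕP.∸-monoʳ-< (ℕP.n<1+n _) u_c<n_c)

module _ {P : List (Pt p)} (mconvex : MConvex P) where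

  Separated : Pt p → Set
  Separated n = ∃₂ λ T u → (∀ {w} → w ∈ P → weight T w ≤ weight T u) × weight T u < weight T n

  -- If an element u of least deficit does not dominate n, then T = {coordinates where u is short of n}
  -- ∪ {coordinates that can feed one of those by an exchange} is closed under exchanges at u, so u
  -- maximises the weight of T over 𝒫, while n is heavier than u on T.
  dominated-or-separated : P ≢ [] → ∀ n → Dominated P n ⊎ Separated n
  dominated-or-separated P≢[] n with u , u∈ , u-nearest ← argmin-∈ (deficit n) P P≢[]
    with FP.any? (λ c → lookup u c ℕ.<? lookup n c)
  ... | no none-short = inj₁ (u , u∈ , λ i → ℕP.≮⇒≥ (λ uᵢ<nᵢ → none-short (i , uᵢ<nᵢ)))
  ... | yes (c₀ , u_c₀<n_c₀) = inj₂ (T , u , weight-maximised mconvex u∈ closed , strict)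
    where
    short : Fin p → Bool
    short i = lookup u i <ᵇ lookup n i
    feeds-short : Fin p → Fin p → Bool
    feeds-short t c = short c ∧ (not (does (t ≟ᶠ c)) ∧ (exchange u t c ∈ᵇ P))
    T : Fin p → Bool
    T t = short t ∨ any (feeds-short t) (allFin p)

    T-via-exchange : ∀ {t c w} → short c ≡ true → t ≢ c → w ∈ P → IsExchange w u t c → T t ≡ true
    T-via-exchange {t} {c} {w} c-short t≢c w∈ X =
      trans (cong (short t ∨_) (any-true⇐ (feeds-short t) c (∈-allFin c) c-feeds-t)) (∨-zeroʳ (short t))
      where
      c-feeds-t : feeds-short t c ≡ true
      c-feeds-t = cong₂ _∧_ c-short (cong₂ _∧_ (cong not (dec-false (t ≟ᶠ c) t≢c))
        (∈ᶻ⇒∈ᵇ _ P (w , w∈ , IsExchange⇒toZ≡exchange t≢c X)))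

    T-cases : ∀ t → T t ≡ true → short t ≡ true ⊎ ∃ λ c → short c ≡ true × t ≢ c × ∃ λ w → w ∈ P × IsExchange w u t c
    T-cases t Tₜ with short t in t-short
    ... | true = inj₁ refl
    ... | false with c , _ , feeds ← any-true⇒ (feeds-short t) (allFin p) Tₜ
      with w , w∈ , w≡ ← ∈ᵇ⇒∈ᶻ _ P (∧-conicalʳ _ _ (∧-conicalʳ (short c) _ feeds)) =
      inj₂ (c , ∧-conicalˡ _ _ feeds , t≢c , w , w∈ , toZ≡exchange⇒IsExchange t≢c w≡)
      where
      t≢c : t ≢ c
      t≢c = does-false⇒ (t ≟ᶠ c) (not-true⇒ (∧-conicalˡ _ _ (∧-conicalʳ (short c) _ feeds)))

    T⇒u≤n : ∀ t → T t ≡ true → lookup u t ≤ lookup n t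
    T⇒u≤n t Tₜ with T-cases t Tₜ
    ... | inj₁ t-short = ℕP.<⇒≤ (does-true⇒ (lookup u t ℕ.<? lookup n t) t-short)
    ... | inj₂ (c , c-short , t≢c , w , w∈ , X) = ℕP.≮⇒≥ λ n_t<u_t →
      ℕP.<⇒≱ (deficit-exchange-< n X (does-true⇒ (lookup u c ℕ.<? lookup n c) c-short) n_t<u_t) (u-nearest w∈)

    strict : weight T u < weight T n
    strict = ∑ᴺ-mono-< _ _ coordinate-≤ c₀ at-c₀
      where
      coordinate-≤ : ∀ i → [ T i ]₀₁ (lookup u i) ≤ [ T i ]₀₁ (lookup n i)
      coordinate-≤ i with T i in Tᵢ
      ... | true = T⇒u≤n i Tᵢ
      ... | false = z≤n
      c₀∈T : T c₀ ≡ true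
      c₀∈T = cong (_∨ any (feeds-short c₀) (allFin p)) (dec-true (lookup u c₀ ℕ.<? lookup n c₀) u_c₀<n_c₀)
      at-c₀ : [ T c₀ ]₀₁ (lookup u c₀) < [ T c₀ ]₀₁ (lookup n c₀)
      at-c₀ rewrite c₀∈T = u_c₀<n_c₀

    T-separates : ∀ {i j} → T i ≡ false → T j ≡ true → i ≢ j
    T-separates Tᵢ Tⱼ refl = false≢true (trans (sym Tᵢ) Tⱼ)

    closed : ExchangeClosed P u T
    closed {i} {j} {w} Tᵢ Tⱼ w∈ X with T-cases j Tⱼ
    ... | inj₁ j-short = false≢true (trans (sym Tᵢ) (T-via-exchange j-short (T-separates Tᵢ Tⱼ) w∈ X))
    ... | inj₂ (c , c-short , j≢c , v , v∈ , Y) with i ≟ᶠ c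
    ...   | yes refl = false≢true (trans (sym Tᵢ) (cong (_∨ any (feeds-short i) (allFin p)) c-short))
    ...   | no i≢c with w′ , w′∈ , Z ← exchange-trans mconvex w∈ X v∈ Y (T-separates Tᵢ Tⱼ) j≢c i≢c =
      false≢true (trans (sym Tᵢ) (T-via-exchange c-short i≢c w′∈ Z))

ℕtoℚ≡mkℚ : ∀ n → ℕtoℚ n ≡ mkℚ (+ n) 0 (Coprime.sym (1-coprimeTo n))
ℕtoℚ≡mkℚ n = ℚP.normalize-coprime (Coprime.sym (1-coprimeTo n))

ℕtoℚ-+ : ∀ a b → ℕtoℚ (a ℕ.+ b) ≡ ℕtoℚ a ℚ.+ ℕtoℚ b
ℕtoℚ-+ a b rewrite ℕtoℚ≡mkℚ a | ℕtoℚ≡mkℚ b =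
  cong (ℚ._/ 1) (sym (cong₂ ℤ._+_ (ℤP.*-identityʳ (+ a)) (ℤP.*-identityʳ (+ b))))

ℕtoℚ-mono-≤ : ∀ {a b} → a ℕ.≤ b → ℕtoℚ a ℚ.≤ ℕtoℚ b
ℕtoℚ-mono-≤ {a} {b} a≤b rewrite ℕtoℚ≡mkℚ a | ℕtoℚ≡mkℚ b =
  ℚ.*≤* (subst₂ ℤ._≤_ (sym (ℤP.*-identityʳ (+ a))) (sym (ℤP.*-identityʳ (+ b))) (ℤ.+≤+ a≤b))

ℕtoℚ-cancel-≤ : ∀ {a b} → ℕtoℚ a ℚ.≤ ℕtoℚ b → a ℕ.≤ b
ℕtoℚ-cancel-≤ {a} {b} le rewrite ℕtoℚ≡mkℚ a | ℕtoℚ≡mkℚ b with le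
... | ℚ.*≤* h = ℤP.drop‿+≤+ (subst₂ ℤ._≤_ (ℤP.*-identityʳ (+ a)) (ℤP.*-identityʳ (+ b)) h)

sumFin-cong : ∀ {f g : Fin q → ℚ} → (∀ k → f k ≡ g k) → sumFin f ≡ sumFin g
sumFin-cong {zero} _ = refl
sumFin-cong {suc m} f≡g = cong₂ ℚ._+_ (f≡g fz) (sumFin-cong (λ k → f≡g (fs k)))

sumFin-mono-≤ : ∀ (f g : Fin q → ℚ) → (∀ k → f k ℚ.≤ g k) → sumFin f ℚ.≤ sumFin g
sumFin-mono-≤ {zero} f g _ = ℚP.≤-refl
sumFin-mono-≤ {suc m} f g f≤g = ℚP.+-mono-≤ (f≤g fz) (sumFin-mono-≤ _ _ (λ k → f≤g (fs k)))

sumFin-zero : ∀ m → sumFin {m} (λ _ → 0ℚ) ≡ 0ℚ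
sumFin-zero zero = refl
sumFin-zero (suc m) = trans (ℚP.+-identityˡ _) (sumFin-zero m)

sumFin-distrib-+ : ∀ (f g : Fin q → ℚ) → sumFin (λ k → f k ℚ.+ g k) ≡ sumFin f ℚ.+ sumFin g
sumFin-distrib-+ {zero} f g = refl
sumFin-distrib-+ {suc m} f g = trans (cong (ℚ._+_ (f fz ℚ.+ g fz)) (sumFin-distrib-+ (λ k → f (fs k)) (λ k → g (fs k))))
  (interchange (f fz) (g fz) _ _)
  where
  open CommutativeSemigroupProperties (CommutativeMonoid.commutativeSemigroup ℚP.+-0-commutativeMonoid) using (interchange)

*-distribˡ-sumFin : ∀ c (f : Fin q → ℚ) → c ℚ.* sumFin f ≡ sumFin (λ k → c ℚ.* f k)
*-distribˡ-sumFin {zero} c f = ℚP.*-zeroʳ c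
*-distribˡ-sumFin {suc m} c f = trans (ℚP.*-distribˡ-+ c (f fz) _) (cong (ℚ._+_ (c ℚ.* f fz)) (*-distribˡ-sumFin c (λ k → f (fs k))))

sumFin-comm : ∀ {n} (F : Fin q → Fin n → ℚ) → sumFin (λ i → sumFin (F i)) ≡ sumFin (λ k → sumFin (λ i → F i k))
sumFin-comm {zero} {n} F = sym (sumFin-zero n)
sumFin-comm {suc m} F = trans (cong (ℚ._+_ (sumFin (F fz))) (sumFin-comm (λ i → F (fs i))))
  (sym (sumFin-distrib-+ (F fz) (λ k → sumFin (λ i → F (fs i) k))))

sumFin-point : ∀ (k₀ : Fin q) (c : Fin q → ℚ) → sumFin (λ k → if does (k ≟ᶠ k₀) then c k else 0ℚ) ≡ c k₀
sumFin-point {suc m} fz c = trans (cong (ℚ._+_ (c fz)) (sumFin-zero m)) (ℚP.+-identityʳ _)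
sumFin-point {suc m} (fs k₀) c = trans (ℚP.+-identityˡ _) (sumFin-point k₀ (λ k → c (fs k)))

ℕtoℚ-∑ᴺ : ∀ (f : Fin q → ℕ) → ℕtoℚ (∑ᴺ f) ≡ sumFin (λ i → ℕtoℚ (f i))
ℕtoℚ-∑ᴺ {zero} f = refl
ℕtoℚ-∑ᴺ {suc m} f = trans (ℕtoℚ-+ (f fz) _) (cong (ℚ._+_ (ℕtoℚ (f fz))) (ℕtoℚ-∑ᴺ (λ i → f (fs i))))

module _ {P : List (Pt p)} where

  private
    Pₖ : Fin (length P) → Pt p
    Pₖ = L.lookup P

  weight-convex : ∀ (T : Fin p → Bool) {x} (λ′ : Fin (length P) → ℚ) →
    (∀ i → lookup x i ≡ sumFin (λ k → λ′ k ℚ.* ℕtoℚ (lookup (Pₖ k) i))) →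
    sumFin (λ i → if T i then lookup x i else 0ℚ) ≡ sumFin (λ k → λ′ k ℚ.* ℕtoℚ (weight T (Pₖ k)))
  weight-convex T {x} λ′ x≡ = begin
    sumFin (λ i → if T i then lookup x i else 0ℚ)
      ≡⟨ sumFin-cong (λ i → trans (cong (λ z → if T i then z else 0ℚ) (x≡ i)) (if-sum (T i) i)) ⟩
    sumFin (λ i → sumFin (λ k → λ′ k ℚ.* ℕtoℚ ([ T i ]₀₁ (lookup (Pₖ k) i))))
      ≡⟨ sumFin-comm (λ i k → λ′ k ℚ.* ℕtoℚ ([ T i ]₀₁ (lookup (Pₖ k) i))) ⟩
    sumFin (λ k → sumFin (λ i → λ′ k ℚ.* ℕtoℚ ([ T i ]₀₁ (lookup (Pₖ k) i))))
      ≡⟨ sumFin-cong (λ k → trans (sym (*-distribˡ-sumFin (λ′ k) (λ i → ℕtoℚ ([ T i ]₀₁ (lookup (Pₖ k) i)))))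
           (cong (λ′ k ℚ.*_) (sym (ℕtoℚ-∑ᴺ (λ i → [ T i ]₀₁ (lookup (Pₖ k) i)))))) ⟩
    sumFin (λ k → λ′ k ℚ.* ℕtoℚ (weight T (Pₖ k))) ∎
    where
    if-sum : ∀ b i → (if b then sumFin (λ k → λ′ k ℚ.* ℕtoℚ (lookup (Pₖ k) i)) else 0ℚ) ≡
                     sumFin (λ k → λ′ k ℚ.* ℕtoℚ ([ b ]₀₁ (lookup (Pₖ k) i)))
    if-sum true i = refl
    if-sum false i = sym (trans (sumFin-cong (λ k → ℚP.*-zeroʳ (λ′ k))) (sumFin-zero (length P)))

  weighted-const : ∀ (λ′ : Fin (length P) → ℚ) c → sumFin λ′ ≡ 1ℚ → sumFin (λ k → λ′ k ℚ.* c) ≡ c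
  weighted-const λ′ c ∑λ′≡1 = begin
    sumFin (λ k → λ′ k ℚ.* c)  ≡⟨ sumFin-cong (λ k → ℚP.*-comm (λ′ k) c) ⟩
    sumFin (λ k → c ℚ.* λ′ k)  ≡⟨ sym (*-distribˡ-sumFin c λ′) ⟩
    c ℚ.* sumFin λ′            ≡⟨ cong (c ℚ.*_) ∑λ′≡1 ⟩
    c ℚ.* 1ℚ                   ≡⟨ ℚP.*-identityʳ c ⟩
    c                          ∎

  convex-≤ : ∀ (g : Pt p → ℕ) c (λ′ : Fin (length P) → ℚ) → (∀ k → 0ℚ ℚ.≤ λ′ k) → sumFin λ′ ≡ 1ℚ →
    (∀ {w} → w ∈ P → g w ℕ.≤ c) → sumFin (λ k → λ′ k ℚ.* ℕtoℚ (g (Pₖ k))) ℚ.≤ ℕtoℚ c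
  convex-≤ g c λ′ λ′≥0 ∑λ′≡1 g≤c = ℚP.≤-trans
    (sumFin-mono-≤ _ _ (λ k → ℚP.*-monoˡ-≤-nonNeg (λ′ k) {{ℚ.nonNegative (λ′≥0 k)}} (ℕtoℚ-mono-≤ (g≤c (∈-lookup k)))))
    (ℚP.≤-reflexive (weighted-const λ′ (ℕtoℚ c) ∑λ′≡1))

  convex-≡ : ∀ (g : Pt p → ℕ) c (λ′ : Fin (length P) → ℚ) → sumFin λ′ ≡ 1ℚ →
    (∀ {w} → w ∈ P → g w ≡ c) → sumFin (λ k → λ′ k ℚ.* ℕtoℚ (g (Pₖ k))) ≡ ℕtoℚ c
  convex-≡ g c λ′ ∑λ′≡1 g≡c =
    trans (sumFin-cong (λ k → cong (λ z → λ′ k ℚ.* ℕtoℚ z) (g≡c (∈-lookup k)))) (weighted-const λ′ (ℕtoℚ c) ∑λ′≡1)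

  InConv-point : ∀ {u} → u ∈ P → InConv P (V.map ℕtoℚ u)
  InConv-point {u} u∈ = λ′ , λ′≥0 , sumFin-point k₀ (λ _ → 1ℚ) , coordinate
    where
    k₀ : Fin (length P)
    k₀ = Any.index u∈
    λ′ : Fin (length P) → ℚ
    λ′ k = if does (k ≟ᶠ k₀) then 1ℚ else 0ℚ
    λ′≥0 : ∀ k → 0ℚ ℚ.≤ λ′ k
    λ′≥0 k with does (k ≟ᶠ k₀)
    ... | true = ℚP.nonNegative⁻¹ 1ℚ
    ... | false = ℚP.≤-refl
    coordinate : ∀ i → lookup (V.map ℕtoℚ u) i ≡ sumFin (λ k → λ′ k ℚ.* ℕtoℚ (lookup (Pₖ k) i))
    coordinate i = begin
      lookup (V.map ℕtoℚ u) i                              ≡⟨ VP.lookup-map i ℕtoℚ u ⟩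
      ℕtoℚ (lookup u i)                                    ≡⟨ cong (λ v → ℕtoℚ (lookup v i)) (lookup-index u∈) ⟩
      ℕtoℚ (lookup (Pₖ k₀) i)                              ≡⟨ sym (sumFin-point k₀ (λ k → ℕtoℚ (lookup (Pₖ k) i))) ⟩
      sumFin (λ k → if does (k ≟ᶠ k₀) then ℕtoℚ (lookup (Pₖ k) i) else 0ℚ)
        ≡⟨ sumFin-cong (λ k → sym (select (does (k ≟ᶠ k₀)) (ℕtoℚ (lookup (Pₖ k) i)))) ⟩
      sumFin (λ k → λ′ k ℚ.* ℕtoℚ (lookup (Pₖ k) i))          ∎
      where
      select : ∀ b z → (if b then 1ℚ else 0ℚ) ℚ.* z ≡ (if b then z else 0ℚ)
      select true z = ℚP.*-identityˡ z
      select false z = ℚP.*-zeroˡ z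

weight-all : ∀ (v : Pt p) → weight (λ _ → true) v ≡ ∣ v ∣ᵥ
weight-all V.[] = refl
weight-all (a V.∷ v) = cong (a ℕ.+_) (weight-all v)

module _ {P : List (Pt p)} {r} (isP : IsPolymatroid P r) where

  open IsPolymatroid isP

  InI⇒Dominated : ∀ {n} → InI P n → Dominated P n
  InI⇒Dominated {n} (x , (λ′ , λ′≥0 , ∑λ′≡1 , x≡) , n≤x) with dominated-or-separated mconvex nonempty n
  ... | inj₁ dominated = dominated
  ... | inj₂ (T , u , u-maximal , u<n) = ⊥-elim (ℕP.<⇒≱ u<n (ℕtoℚ-cancel-≤ n≤u))
    where
    coordinate : ∀ i → ℕtoℚ ([ T i ]₀₁ (lookup n i)) ℚ.≤ (if T i then lookup x i else 0ℚ)
    coordinate i with T i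
    ... | true = n≤x i
    ... | false = ℚP.≤-refl
    n≤u : ℕtoℚ (weight T n) ℚ.≤ ℕtoℚ (weight T u)
    n≤u = ℚP.≤-trans (ℚP.≤-reflexive (ℕtoℚ-∑ᴺ (λ i → [ T i ]₀₁ (lookup n i))))
      (ℚP.≤-trans (sumFin-mono-≤ _ _ coordinate)
        (ℚP.≤-trans (ℚP.≤-reflexive (weight-convex {P = P} T {x} λ′ x≡))
          (convex-≤ (weight T) (weight T u) λ′ λ′≥0 ∑λ′≡1 u-maximal)))

  Dominated⇒InI : ∀ {n} → Dominated P n → InI P n
  Dominated⇒InI {n} (u , u∈ , n≤u) = V.map ℕtoℚ u , InConv-point u∈ ,
    λ i → subst (ℚ._≤_ (ℕtoℚ (lookup n i))) (sym (VP.lookup-map i ℕtoℚ u)) (ℕtoℚ-mono-≤ (n≤u i))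

  InB⇒∈ : ∀ {n} → InB P n → n ∈ P
  InB⇒∈ {n} n∈B@(λ′ , _ , ∑λ′≡1 , n≡)
    with u , u∈ , n≤u ← InI⇒Dominated {n} (V.map ℕtoℚ n , n∈B , λ i → ℚP.≤-reflexive (sym (VP.lookup-map i ℕtoℚ n)))
    with VP.≡-dec ℕ._≟_ n u
  ... | yes refl = u∈
  ... | no n≢u = ⊥-elim (ℕP.<-irrefl (trans ∣n∣≡r (sym (rank u u∈))) (∣∣-mono-< n u n≤u n≢u))
    where
    ∣n∣≡r : ∣ n ∣ᵥ ≡ r
    ∣n∣≡r = ℕP.≤-antisym (ℕtoℚ-cancel-≤ (ℚP.≤-reflexive ∣n∣≡ᵣr)) (ℕtoℚ-cancel-≤ (ℚP.≤-reflexive (sym ∣n∣≡ᵣr)))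
      where
      ∣n∣≡ᵣr : ℕtoℚ ∣ n ∣ᵥ ≡ ℕtoℚ r
      ∣n∣≡ᵣr = begin
        ℕtoℚ ∣ n ∣ᵥ                                                ≡⟨ cong ℕtoℚ (sym (weight-all n)) ⟩
        ℕtoℚ (weight (λ _ → true) n)                               ≡⟨ ℕtoℚ-∑ᴺ (lookup n) ⟩
        sumFin (λ i → ℕtoℚ (lookup n i))                           ≡⟨ sumFin-cong (λ i → sym (VP.lookup-map i ℕtoℚ n)) ⟩
        sumFin (λ i → lookup (V.map ℕtoℚ n) i)                     ≡⟨ weight-convex {P = P} (λ _ → true) {V.map ℕtoℚ n} λ′ n≡ ⟩
        sumFin (λ k → λ′ k ℚ.* ℕtoℚ (weight (λ _ → true) (L.lookup P k)))
          ≡⟨ convex-≡ (weight (λ _ → true)) r λ′ ∑λ′≡1 (λ {w} w∈ → trans (weight-all w) (rank w w∈)) ⟩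
        ℕtoℚ r                                                     ∎

  InB⇔∈ : ∀ n → InB P n ⇔ n ∈ P
  InB⇔∈ n = mk⇔ (InB⇒∈ {n}) InConv-point

  InI⇔Dominated : ∀ n → InI P n ⇔ Dominated P n
  InI⇔Dominated n = mk⇔ (InI⇒Dominated {n}) (Dominated⇒InI {n})

theorem1p5 : ∀ {p} (P : List (Pt p)) (r : ℕ) → IsPolymatroid P r →
    (σ : Permutation′ p) →
    (B : List (Pt p)) → Enumerates B (InB P) →
    (I : List (Pt p)) → Enumerates I (InI P) →
    (Cave r B ≈ₚ Stal σ P r I) × (Stal σ P r I ≈ₚ Box I) × (Box I ≈ₚ Möb I)
theorem1p5 P r isP σ B B-enum I I-enum =
  ≈ₚ-from-coefficients cave stal , ≈ₚ-from-coefficients stal box , ≈ₚ-from-coefficients box möb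
  where
  B-lists-P : Enumerates B (_∈ P)
  B-lists-P = Enumerates-⇔ (InB⇔∈ isP) B-enum
  I-lists-dominated : Enumerates I (Dominated P)
  I-lists-dominated = Enumerates-⇔ (InI⇔Dominated isP) I-enum
  cave : Cave r B HasCoefficients altCount I
  cave = Cave-HasCoefficients isP B-lists-P I-lists-dominated
  stal : Stal σ P r I HasCoefficients altCount I
  stal = Stal-HasCoefficients σ isP I-lists-dominated
  box : Box I HasCoefficients altCount I
  box = Box-HasCoefficients I
  möb : Möb I HasCoefficients altCount I
  möb = Möb-HasCoefficients (proj₁ I-enum) (Enumerates⇒DownClosed I-lists-dominated)
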